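{- (a) For $n\ge1$, $\mathfrak{r}_{\triangle_{n,1}}=\sum_{\lambda\in OP(n)}z_\lambda^{ -1}2^{\ell(\lambda)}p_\lambda$. (b) For $n\ge3$, $\mathfrak{r}_{\triangle_{n,3}}=\sum_{\lambda\in OP(n)}c_\lambda p_\lambda$, where $c_\lambda=z_\lambda^{ -1}2^{\ell(\lambda)}$ if $m_1(\lambda)=0$, $c_\lambda=0$ if $m_1(\lambda)\in\{1,2\}$, and $c_\lambda=\binom{m_1(\lambda)-1}{2}z_\lambda^{ -1}2^{\ell(\lambda)}$ if $m_1(\lambda)\ge3$. Consequently, $\mathfrak{r}_{\triangle_{n,1}}$ and $\mathfrak{r}_{\triangle_{n,3}}$ are $p$-positive.
   Context: Boxes are indexed $(i,j)$, row $i$ from the top, column $j$ from the left. For a composition $\alpha=(\alpha_1,\dots,\alpha_\ell)$, the ribbon $\alpha$ is the set of boxes in which row $i$ has $\alpha_i$ consecutive boxes and, for $i<\ell$, the leftmost box of row $i$ lies directly above the rightmost box of row $i+1$. A marked shifted tableau of it is a filling by letters of $\{1'<1<2'<2<\cdots\}$ with weakly increasing rows and columns, at most one unmarked $k$ per column and at most one $k'$ per row for each $k$; the content $(c_1,c_2,\dots)$ counts entries $a$ with unmarked value $i$. $\mathfrak{r}_\alpha=\sum_Tx_1^{c_1}x_2^{c_2}\cdots$ over all such tableaux. For $1\le k\le n$, $\triangle_{n,k}$ is the ribbon with composition $(1^{k-1},n-k+1)$. $OP(n)$ is the set of partitions of $n$ into odd parts, $\ell(\lambda)$ is the number of parts,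 $m_i(\lambda)$ the number of parts equal to $i$, $z_\lambda=\prod_ii^{m_i(\lambda)}m_i(\lambda)!$, and $p_\lambda=\prod_ip_{\lambda_i}$ with $p_r=\sum_jx_j^r$. A symmetric function is $p$-positive if all its coefficients in the power sum basis are nonnegative. -}

module Defs where

open import Data.Bool using (Bool; true; false; _∧_; _∨_; not)
open import Data.Nat as ℕ using (ℕ; zero; suc; _∸_; _≡ᵇ_; _≤ᵇ_; _!; _%_; _/_)
open import Data.Nat.Combinatorics using (_C_)
open import Data.Product using (_×_; _,_)
open import Data.List using (List; []; _∷_; _++_; map; upTo; concatMap; zip; filterᵇ; length; foldr; replicate)
open import Data.Integer using (+_)
open import Data.Rational as Q using (ℚ; 0ℚ; 1ℚ)

-- A composition is a list of positive naturals.
-- Boxes are (row , column), rows numbered from 1 at the top,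
-- columns from 1 at the left.  The bottom row starts in column 1 and
-- the leftmost box of row i lies directly above the rightmost box of
-- row i+1.

-- column of the leftmost box of the first row of the ribbon
startCol : List ℕ → ℕ
startCol [] = 1
startCol (a ∷ []) = 1
startCol (a ∷ b ∷ r) = startCol (b ∷ r) ℕ.+ b ∸ 1

boxesFrom : ℕ → List ℕ → List (ℕ × ℕ)
boxesFrom i [] = []
boxesFrom i (a ∷ r) =
  map (λ j → (i , startCol (a ∷ r) ℕ.+ j)) (upTo a) ++ boxesFrom (suc i) r

ribbonBoxes : List ℕ → List (ℕ × ℕ)
ribbonBoxes α = boxesFrom 1 α

triangle : ℕ → ℕ → List ℕ
triangle n k = replicate (k ∸ 1) 1 ++ ((n ∸ k) ℕ.+ 1 ∷ [])

-- Letters 1' < 1 < 2' < 2 < ... < N' < N are encoded by codes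
-- 0,1,...,2N-1 : code 2(i-1) is i', code 2(i-1)+1 is i.
-- The order on letters is the order on codes.

isMarked : ℕ → Bool
isMarked c = c % 2 ≡ᵇ 0

-- 0-based index of the unmarked value |c| (value i ↦ i-1)
letterValue : ℕ → ℕ
letterValue c = c / 2

allFillings : ℕ → ℕ → List (List ℕ)
allFillings zero K = [] ∷ []
allFillings (suc m) K = concatMap (λ c → map (c ∷_) (allFillings m K)) (upTo K)

allᵇ : {A : Set} → (A → Bool) → List A → Bool
allᵇ p [] = true
allᵇ p (a ∷ as) = p a ∧ allᵇ p as

pairOK : (ℕ × ℕ) × ℕ → (ℕ × ℕ) × ℕ → Bool
pairOK ((r1 , c1) , l1) ((r2 , c2) , l2) =
  (not ((r2 ≡ᵇ r1) ∧ (c2 ≡ᵇ suc c1)) ∨ (l1 ≤ᵇ l2)) ∧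
  (not ((c2 ≡ᵇ c1) ∧ (r2 ≡ᵇ suc r1)) ∨ (l1 ≤ᵇ l2)) ∧
  -- at most one unmarked k per column
  (not ((c1 ≡ᵇ c2) ∧ not (r1 ≡ᵇ r2) ∧ (l1 ≡ᵇ l2)) ∨ isMarked l1) ∧
  -- at most one k' per row
  (not ((r1 ≡ᵇ r2) ∧ not (c1 ≡ᵇ c2) ∧ (l1 ≡ᵇ l2)) ∨ not (isMarked l1))

isTableau : List (ℕ × ℕ) → List ℕ → Bool
isTableau bs f = allᵇ (λ p → allᵇ (λ q → pairOK p q) P) P
  where P = zip bs f

tableaux : List ℕ → ℕ → List (List ℕ)
tableaux α N = filterᵇ (isTableau (ribbonBoxes α))
                       (allFillings (length (ribbonBoxes α)) (2 ℕ.* N))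

sumℚ : List ℚ → ℚ
sumℚ = foldr Q._+_ 0ℚ

prodℚ : List ℚ → ℚ
prodℚ = foldr Q._*_ 1ℚ

powℚ : ℚ → ℕ → ℚ
powℚ q zero = 1ℚ
powℚ q (suc k) = q Q.* powℚ q k

fromℕ : ℕ → ℚ
fromℕ a = + a Q./ 1

-- a / d (d is always ≥ 1 where used; the d = 0 case is a dummy)
frac : ℕ → ℕ → ℚ
frac a zero = 0ℚ
frac a (suc d) = + a Q./ suc d

-- r_α evaluated at (x_1,...,x_N) = (x 0, ..., x (N-1)), all other
-- variables set to 0.

rEval : List ℕ → (N : ℕ) → (ℕ → ℚ) → ℚ
rEval α N x = sumℚ (map (λ T → prodℚ (map (λ c → x (letterValue c)) T)) (tableaux α N))

pEval1 : ℕ → (ℕ → ℚ) → ℕ → ℚ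
pEval1 N x r = sumℚ (map (λ j → powℚ (x j) r) (upTo N))

pEval : ℕ → (ℕ → ℚ) → List ℕ → ℚ
pEval N x μ = prodℚ (map (pEval1 N x) μ)

-- Partitions (weakly decreasing lists of positive parts)

-- partitions of n with all parts ≤ k (fuel f ≥ n suffices)
partsLE : ℕ → ℕ → ℕ → List (List ℕ)
partsLE f zero k = [] ∷ []
partsLE zero (suc n) k = []
partsLE (suc f) (suc n) k =
  concatMap (λ j → map (j ∷_) (partsLE f (suc n ∸ j) j))
            (map suc (upTo (ℕ._⊓_ (suc n) k)))

partitions : ℕ → List (List ℕ)
partitions n = partsLE n n n

isOdd : ℕ → Bool
isOdd j = j % 2 ≡ᵇ 1

OP : ℕ → List (List ℕ)
OP n = filterᵇ (allᵇ isOdd) (partitions n)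

ℓ : List ℕ → ℕ
ℓ = length

mult : ℕ → List ℕ → ℕ
mult i μ = length (filterᵇ (_≡ᵇ i) μ)

sizeP : List ℕ → ℕ
sizeP = foldr ℕ._+_ 0

z : List ℕ → ℕ
z μ = foldr ℕ._*_ 1 (map (λ i → (i ℕ.^ mult i μ) ℕ.* (mult i μ) !) (map suc (upTo (sizeP μ))))

baseCoeff : List ℕ → ℚ
baseCoeff μ = frac (2 ℕ.^ ℓ μ) (z μ)

coeffA : List ℕ → ℚ
coeffA = baseCoeff

coeffB : List ℕ → ℚ
coeffB μ with mult 1 μ
... | zero = baseCoeff μ
... | suc zero = 0ℚ
... | suc (suc zero) = 0ℚ
... | suc (suc (suc m)) = fromℕ ((suc (suc m)) C 2) Q.* baseCoeff μ

{-# OPTIONS --safe #-}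
-- Write q_n for the sum over tableaux of the one-row ribbon with n boxes. Adding a
-- variable y multiplies the generating function Σ q_n t^n by (1 + y t)/(1 - y t), so
-- Σ q_n t^n = ∏_i (1 + x_i t)/(1 - x_i t) and, taking logarithmic derivatives, q satisfies
-- the Newton recurrence n q_n = Σ_{r ≥ 1} β_r q_{n-r} with β_r = 2 p_r for odd r and 0
-- for even r. Grouping the parts of an odd partition by size, the right-hand side of (a)
-- is the coefficient of t^n in ∏_{k odd} exp (2 p_k t^k / k), a product of sequences
-- obeying Newton recurrences with the single weights 2 p_k at r = k; the weights of a
-- product add up, and a sequence is determined by its Newton recurrence and its value at
-- 0, which proves (a). For (b), a tableau of △_{n,3} is a column a, b above the last
-- letter c of a row word, and summing over the column gives
-- 2 p_1² q_{n-2} - 2 p_1 q_{n-1} + q_n. On the other side, C(m - 1, 2) equals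
-- m (m - 1)/2 - m + 1 for every m ≥ 0, and multiplying the t-th coefficient of
-- exp (2 p_1 t) by t (or by t (t - 1)) shifts it by one (or two) places at the cost of a
-- factor 2 p_1 (or (2 p_1)²), which yields the same combination of the sums in (a).

module Submission where

open import Defs
open import Data.Nat using (ℕ; _≤_)
open import Data.Product using (_×_)
open import Data.List using (map)
open import Data.List.Relation.Unary.All using (All)
open import Data.Rational using (ℚ; 0ℚ) renaming (_*_ to _*ℚ_; _≤_ to _≤ℚ_)
open import Relation.Binary.PropositionalEquality using (_≡_)

open import Data.Bool using (Bool; true; false; _∧_; _∨_; not; if_then_else_; T)
import Data.Bool.Properties as BP
open import Data.Empty using (⊥-elim)
open import Data.Unit using (tt)
open import Data.Nat using (zero; suc; _+_; _*_; _<_; _∸_; _^_; _!; _⊓_; _≡ᵇ_; _≤ᵇ_; _<ᵇ_; s≤s; z≤n; _≟_; _≤?_; _<?_)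
import Data.Nat.Properties as NP
import Data.Nat.DivMod as DM
open import Data.Nat.Combinatorics using (_C_; nCk+nC[k+1]≡[n+1]C[k+1]; nC1≡n)
import Data.Integer as ℤ
import Data.Integer.Properties as ZP
open import Data.Rational using (1ℚ; ½; nonNegative) renaming (_+_ to _+ℚ_; -_ to -ℚ_)
import Data.Rational.Properties as QP
open import Data.Rational.Unnormalised using (mkℚᵘ; *≡*)
import Data.Rational.Unnormalised.Properties as UP
open import Data.Rational.Solver using (module +-*-Solver)
open +-*-Solver using (solve; _:+_; _:*_; :-_; _:=_; con)
open import Data.Product using (_,_; proj₁; proj₂)
open import Data.List using (List; []; _∷_; _++_; [_]; zip; upTo; applyUpTo; concatMap; replicate; length; filterᵇ; foldr)
import Data.List.Properties as LP
open import Data.List.Relation.Unary.All as All using ([]; _∷_)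
open import Function using (_∘_)
open import Relation.Nullary using (yes; no; contradiction)
open import Relation.Binary.Definitions using (tri<; tri≈; tri>)
open import Relation.Binary.PropositionalEquality hiding ([_])
open ≡-Reasoning

fromℕ-+ : ∀ a b → fromℕ (a + b) ≡ fromℕ a +ℚ fromℕ b
fromℕ-+ a b = QP.toℚᵘ-injective
  (UP.≃-trans (QP.toℚᵘ-fromℚᵘ (mkℚᵘ (ℤ.+ (a + b)) 0))
  (UP.≃-sym (UP.≃-trans (QP.toℚᵘ-homo-+ (fromℕ a) (fromℕ b))
    (UP.≃-trans (UP.+-cong (QP.toℚᵘ-fromℚᵘ (mkℚᵘ (ℤ.+ a) 0)) (QP.toℚᵘ-fromℚᵘ (mkℚᵘ (ℤ.+ b) 0)))
      (*≡* (trans (ZP.*-identityʳ _) (trans (cong₂ ℤ._+_ (ZP.*-identityʳ (ℤ.+ a)) (ZP.*-identityʳ (ℤ.+ b)))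
             (trans (sym (ZP.pos-+ a b)) (sym (ZP.*-identityʳ _))))))))))

fromℕ-* : ∀ a b → fromℕ (a * b) ≡ fromℕ a *ℚ fromℕ b
fromℕ-* a b = QP.toℚᵘ-injective
  (UP.≃-trans (QP.toℚᵘ-fromℚᵘ (mkℚᵘ (ℤ.+ (a * b)) 0))
  (UP.≃-sym (UP.≃-trans (QP.toℚᵘ-homo-* (fromℕ a) (fromℕ b))
    (UP.≃-trans (UP.*-cong (QP.toℚᵘ-fromℚᵘ (mkℚᵘ (ℤ.+ a) 0)) (QP.toℚᵘ-fromℚᵘ (mkℚᵘ (ℤ.+ b) 0)))
      (*≡* (trans (ZP.*-identityʳ _) (trans (sym (ZP.pos-* a b)) (sym (ZP.*-identityʳ _)))))))))

frac-*-denominator : ∀ a d → frac a (suc d) *ℚ fromℕ (suc d) ≡ fromℕ a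
frac-*-denominator a d = QP.toℚᵘ-injective
  (UP.≃-trans (QP.toℚᵘ-homo-* (frac a (suc d)) (fromℕ (suc d)))
    (UP.≃-trans (UP.*-cong (QP.toℚᵘ-fromℚᵘ (mkℚᵘ (ℤ.+ a) d)) (QP.toℚᵘ-fromℚᵘ (mkℚᵘ (ℤ.+ suc d) 0)))
      (UP.≃-sym (UP.≃-trans (QP.toℚᵘ-fromℚᵘ (mkℚᵘ (ℤ.+ a) 0))
        (*≡* (sym (trans (ZP.*-identityʳ _) (cong (λ k → ℤ.+ a ℤ.* ℤ.+ suc k) (sym (NP.*-identityʳ d))))))))))

fromℕ-suc : ∀ a → fromℕ (suc a) ≡ 1ℚ +ℚ fromℕ a
fromℕ-suc a = fromℕ-+ 1 a

*-cancelˡ-fromℕ-suc : ∀ n p q → fromℕ (suc n) *ℚ p ≡ fromℕ (suc n) *ℚ q → p ≡ q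
*-cancelˡ-fromℕ-suc n p q e = begin
  p ≡⟨ sym (QP.*-identityˡ p) ⟩
  1ℚ *ℚ p ≡⟨ cong (_*ℚ p) (sym (frac-*-denominator 1 n)) ⟩
  (frac 1 (suc n) *ℚ fromℕ (suc n)) *ℚ p ≡⟨ QP.*-assoc (frac 1 (suc n)) (fromℕ (suc n)) p ⟩
  frac 1 (suc n) *ℚ (fromℕ (suc n) *ℚ p) ≡⟨ cong (frac 1 (suc n) *ℚ_) e ⟩
  frac 1 (suc n) *ℚ (fromℕ (suc n) *ℚ q) ≡⟨ sym (QP.*-assoc (frac 1 (suc n)) (fromℕ (suc n)) q) ⟩
  (frac 1 (suc n) *ℚ fromℕ (suc n)) *ℚ q ≡⟨ cong (_*ℚ q) (frac-*-denominator 1 n) ⟩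
  1ℚ *ℚ q ≡⟨ QP.*-identityˡ q ⟩
  q ∎

frac-unique : ∀ a d q → q *ℚ fromℕ (suc d) ≡ fromℕ a → q ≡ frac a (suc d)
frac-unique a d q e = *-cancelˡ-fromℕ-suc d q (frac a (suc d))
  (trans (QP.*-comm (fromℕ (suc d)) q) (trans e (trans (sym (frac-*-denominator a d)) (QP.*-comm (frac a (suc d)) (fromℕ (suc d))))))

frac-*-suc : ∀ a b c d → frac (a * b) (suc c * suc d) ≡ frac a (suc c) *ℚ frac b (suc d)
frac-*-suc a b c d = sym (frac-unique (a * b) (d + c * suc d) _ (begin
  (frac a (suc c) *ℚ frac b (suc d)) *ℚ fromℕ (suc c * suc d) ≡⟨ cong ((frac a (suc c) *ℚ frac b (suc d)) *ℚ_) (fromℕ-* (suc c) (suc d)) ⟩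
  (frac a (suc c) *ℚ frac b (suc d)) *ℚ (fromℕ (suc c) *ℚ fromℕ (suc d))
    ≡⟨ solve 4 (λ A B C D → (A :* B) :* (C :* D) := (A :* C) :* (B :* D)) refl (frac a (suc c)) (frac b (suc d)) (fromℕ (suc c)) (fromℕ (suc d)) ⟩
  (frac a (suc c) *ℚ fromℕ (suc c)) *ℚ (frac b (suc d) *ℚ fromℕ (suc d)) ≡⟨ cong₂ _*ℚ_ (frac-*-denominator a c) (frac-*-denominator b d) ⟩
  fromℕ a *ℚ fromℕ b ≡⟨ sym (fromℕ-* a b) ⟩
  fromℕ (a * b) ∎))

frac-* : ∀ a b c d → 1 ≤ c → 1 ≤ d → frac (a * b) (c * d) ≡ frac a c *ℚ frac b d
frac-* a b (suc c) (suc d) _ _ = frac-*-suc a b c d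

frac-nonNeg : ∀ a d → 0ℚ ≤ℚ frac a d
frac-nonNeg a zero = QP.≤-refl
frac-nonNeg a (suc d) = QP.nonNegative⁻¹ (frac a (suc d)) {{QP.normalize-nonNeg a (suc d)}}

*-nonNeg : ∀ p q → 0ℚ ≤ℚ p → 0ℚ ≤ℚ q → 0ℚ ≤ℚ p *ℚ q
*-nonNeg p q hp hq = QP.nonNegative⁻¹ (p *ℚ q) {{QP.nonNeg*nonNeg⇒nonNeg p {{nonNegative hp}} q {{nonNegative hq}}}}

≡ᵇ-refl : ∀ n → (n ≡ᵇ n) ≡ true
≡ᵇ-refl zero = refl
≡ᵇ-refl (suc n) = ≡ᵇ-refl n

≢⇒≡ᵇ≡false : ∀ m n → m ≢ n → (m ≡ᵇ n) ≡ false
≢⇒≡ᵇ≡false zero zero ne = ⊥-elim (ne refl)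
≢⇒≡ᵇ≡false zero (suc n) ne = refl
≢⇒≡ᵇ≡false (suc m) zero ne = refl
≢⇒≡ᵇ≡false (suc m) (suc n) ne = ≢⇒≡ᵇ≡false m n (λ e → ne (cong suc e))

≡ᵇ≡true⇒≡ : ∀ m n → (m ≡ᵇ n) ≡ true → m ≡ n
≡ᵇ≡true⇒≡ m n e = NP.≡ᵇ⇒≡ m n (subst T (sym e) tt)

<⇒<ᵇ≡true : ∀ m n → m < n → (m <ᵇ n) ≡ true
<⇒<ᵇ≡true zero (suc n) lt = refl
<⇒<ᵇ≡true (suc m) (suc n) (s≤s lt) = <⇒<ᵇ≡true m n lt

≥⇒<ᵇ≡false : ∀ m n → n ≤ m → (m <ᵇ n) ≡ false
≥⇒<ᵇ≡false m zero le = refl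
≥⇒<ᵇ≡false (suc m) (suc n) (s≤s le) = ≥⇒<ᵇ≡false m n le

<ᵇ≡true⇒< : ∀ m n → (m <ᵇ n) ≡ true → m < n
<ᵇ≡true⇒< m n e = NP.<ᵇ⇒< m n (subst T (sym e) tt)

≤⇒≤ᵇ≡true : ∀ m n → m ≤ n → (m ≤ᵇ n) ≡ true
≤⇒≤ᵇ≡true zero n le = refl
≤⇒≤ᵇ≡true (suc m) n le = <⇒<ᵇ≡true m n le

>⇒≤ᵇ≡false : ∀ m n → n < m → (m ≤ᵇ n) ≡ false
>⇒≤ᵇ≡false (suc m) n (s≤s le) = ≥⇒<ᵇ≡false m n le

≤ᵇ≡true⇒≤ : ∀ m n → (m ≤ᵇ n) ≡ true → m ≤ n
≤ᵇ≡true⇒≤ m n e = NP.≤ᵇ⇒≤ m n (subst T (sym e) tt)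

+≤ᵇ≡≤ᵇ∸ : ∀ n S J → S ≤ n → (S + J ≤ᵇ n) ≡ (J ≤ᵇ n ∸ S)
+≤ᵇ≡≤ᵇ∸ n S J Sn with J ≤? n ∸ S
... | yes le = trans (≤⇒≤ᵇ≡true (S + J) n (subst (_≤ n) (NP.+-comm J S) (NP.m≤o∸n⇒m+n≤o J Sn le))) (sym (≤⇒≤ᵇ≡true J (n ∸ S) le))
... | no nle = trans (>⇒≤ᵇ≡false (S + J) n n<S+J) (sym (>⇒≤ᵇ≡false J (n ∸ S) (NP.≰⇒> nle)))
  where
  n<S+J : n < S + J
  n<S+J with (S + J) ≤? n
  ... | yes le' = ⊥-elim (nle (NP.m+n≤o⇒m≤o∸n J (subst (_≤ n) (NP.+-comm S J) le')))
  ... | no nle' = NP.≰⇒> nle'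

≤ᵇ∧<ᵇ∸≡≤ᵇ∸suc : ∀ n i M → i < n → (M ≤ᵇ n) ∧ (i <ᵇ n ∸ M) ≡ (M ≤ᵇ n ∸ suc i)
≤ᵇ∧<ᵇ∸≡≤ᵇ∸suc n i M i<n with M ≤? n ∸ suc i
... | yes le = trans (cong₂ _∧_ (≤⇒≤ᵇ≡true M n M≤n) (<⇒<ᵇ≡true i (n ∸ M) 1+i≤n∸M)) (sym (≤⇒≤ᵇ≡true M (n ∸ suc i) le))
  where
  M+1+i≤n : M + suc i ≤ n
  M+1+i≤n = NP.m≤o∸n⇒m+n≤o M i<n le
  M≤n : M ≤ n
  M≤n = NP.≤-trans (NP.m≤m+n M (suc i)) M+1+i≤n
  1+i≤n∸M : suc i ≤ n ∸ M
  1+i≤n∸M = NP.m+n≤o⇒m≤o∸n (suc i) (subst (_≤ n) (NP.+-comm M (suc i)) M+1+i≤n)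
... | no nle with M ≤? n
...   | no nle2 = trans (cong (_∧ (i <ᵇ n ∸ M)) (>⇒≤ᵇ≡false M n (NP.≰⇒> nle2))) (sym (>⇒≤ᵇ≡false M (n ∸ suc i) (NP.≰⇒> nle)))
...   | yes le2 with i <? n ∸ M
...     | yes lt = ⊥-elim (nle (NP.m+n≤o⇒m≤o∸n M (subst (_≤ n) (NP.+-comm (suc i) M) (NP.m≤o∸n⇒m+n≤o (suc i) le2 lt))))
...     | no nlt = trans (cong₂ _∧_ (≤⇒≤ᵇ≡true M n le2) (≥⇒<ᵇ≡false i (n ∸ M) (NP.≮⇒≥ nlt))) (sym (>⇒≤ᵇ≡false M (n ∸ suc i) (NP.≰⇒> nle)))

≤ᵇ-suc-≢ : ∀ r m → r ≢ suc m → (r ≤ᵇ suc m) ≡ (r ≤ᵇ m)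
≤ᵇ-suc-≢ r m ne with r ≤? m
... | yes le = trans (≤⇒≤ᵇ≡true r (suc m) (NP.≤-trans le (NP.n≤1+n m))) (sym (≤⇒≤ᵇ≡true r m le))
... | no nle = trans (>⇒≤ᵇ≡false r (suc m) (NP.≤∧≢⇒< (NP.≰⇒> nle) (λ e → ne (sym e)))) (sym (>⇒≤ᵇ≡false r m (NP.≰⇒> nle)))

∧≡true⇒× : ∀ x y → x ∧ y ≡ true → (x ≡ true) × (y ≡ true)
∧≡true⇒× true true e = refl , refl

∧-interchange : ∀ a b c d → (a ∧ b) ∧ (c ∧ d) ≡ (a ∧ c) ∧ (b ∧ d)
∧-interchange true true c d = refl
∧-interchange true false c d = sym (BP.∧-zeroʳ c)
∧-interchange false b c d = refl

allᵇ-∧ : {A : Set} (g h : A → Bool) (L : List A) → allᵇ (λ a → g a ∧ h a) L ≡ allᵇ g L ∧ allᵇ h L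
allᵇ-∧ g h [] = refl
allᵇ-∧ g h (a ∷ L) rewrite allᵇ-∧ g h L = ∧-interchange (g a) (h a) (allᵇ g L) (allᵇ h L)

allᵇ-++ : {A : Set} (p : A → Bool) (L M : List A) → allᵇ p (L ++ M) ≡ allᵇ p L ∧ allᵇ p M
allᵇ-++ p [] M = refl
allᵇ-++ p (a ∷ L) M = trans (cong (p a ∧_) (allᵇ-++ p L M)) (sym (BP.∧-assoc (p a) _ _))

allᵇ-replicate : {A : Set} (p : A → Bool) (t : ℕ) (k : A) → allᵇ p (replicate (suc t) k) ≡ p k
allᵇ-replicate p zero k = BP.∧-identityʳ (p k)
allᵇ-replicate p (suc t) k = trans (cong (p k ∧_) (allᵇ-replicate p t k)) (BP.∧-idem (p k))

n≢1+n : ∀ n → n ≢ suc n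
n≢1+n n e = NP.1+n≢n (sym e)

1+m+n≢n : ∀ t s → suc (t + s) ≢ s
1+m+n≢n t s e = NP.<⇒≢ (s≤s (NP.m≤n+m s t)) (sym e)

-- Finite sums

sumOver : {A : Set} → List A → (A → ℚ) → ℚ
sumOver L f = sumℚ (map f L)

iverson : Bool → ℚ → ℚ
iverson true q = q
iverson false q = 0ℚ

sumOver-cong : {A : Set} (L : List A) {f g : A → ℚ} → (∀ a → f a ≡ g a) → sumOver L f ≡ sumOver L g
sumOver-cong [] e = refl
sumOver-cong (a ∷ L) e = cong₂ _+ℚ_ (e a) (sumOver-cong L e)

sumOver-++ : {A : Set} (L M : List A) (f : A → ℚ) → sumOver (L ++ M) f ≡ sumOver L f +ℚ sumOver M f
sumOver-++ [] M f = sym (QP.+-identityˡ _)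
sumOver-++ (a ∷ L) M f = trans (cong (f a +ℚ_) (sumOver-++ L M f)) (sym (QP.+-assoc (f a) _ _))

sumOver-map : {A B : Set} (g : A → B) (L : List A) (f : B → ℚ) → sumOver (map g L) f ≡ sumOver L (f ∘ g)
sumOver-map g [] f = refl
sumOver-map g (a ∷ L) f = cong (f (g a) +ℚ_) (sumOver-map g L f)

sumOver-+ : {A : Set} (L : List A) (f g : A → ℚ) → sumOver L (λ a → f a +ℚ g a) ≡ sumOver L f +ℚ sumOver L g
sumOver-+ [] f g = sym (QP.+-identityˡ _)
sumOver-+ (a ∷ L) f g = begin
  (f a +ℚ g a) +ℚ sumOver L (λ a → f a +ℚ g a) ≡⟨ cong ((f a +ℚ g a) +ℚ_) (sumOver-+ L f g) ⟩
  (f a +ℚ g a) +ℚ (sumOver L f +ℚ sumOver L g) ≡⟨ solve 4 (λ a b c d → (a :+ b) :+ (c :+ d) := (a :+ c) :+ (b :+ d)) refl (f a) (g a) (sumOver L f) (sumOver L g) ⟩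
  (f a +ℚ sumOver L f) +ℚ (g a +ℚ sumOver L g) ∎

*-distribˡ-sumOver : {A : Set} (c : ℚ) (L : List A) (f : A → ℚ) → c *ℚ sumOver L f ≡ sumOver L (λ a → c *ℚ f a)
*-distribˡ-sumOver c [] f = QP.*-zeroʳ c
*-distribˡ-sumOver c (a ∷ L) f = trans (QP.*-distribˡ-+ c (f a) _) (cong (c *ℚ f a +ℚ_) (*-distribˡ-sumOver c L f))

*-distribʳ-sumOver : {A : Set} (c : ℚ) (L : List A) (f : A → ℚ) → sumOver L f *ℚ c ≡ sumOver L (λ a → f a *ℚ c)
*-distribʳ-sumOver c L f = trans (QP.*-comm _ c) (trans (*-distribˡ-sumOver c L f) (sumOver-cong L (λ a → QP.*-comm c (f a))))

sumOver-0 : {A : Set} (L : List A) → sumOver L (λ _ → 0ℚ) ≡ 0ℚ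
sumOver-0 [] = refl
sumOver-0 (a ∷ L) = trans (QP.+-identityˡ _) (sumOver-0 L)

sumOver-concatMap : {A B : Set} (g : A → List B) (L : List A) (f : B → ℚ) →
  sumOver (concatMap g L) f ≡ sumOver L (λ a → sumOver (g a) f)
sumOver-concatMap g [] f = refl
sumOver-concatMap g (a ∷ L) f = trans (sumOver-++ (g a) (concatMap g L) f) (cong (sumOver (g a) f +ℚ_) (sumOver-concatMap g L f))

sumOver-filterᵇ : {A : Set} (p : A → Bool) (L : List A) (f : A → ℚ) →
  sumOver (filterᵇ p L) f ≡ sumOver L (λ a → iverson (p a) (f a))
sumOver-filterᵇ p [] f = refl
sumOver-filterᵇ p (a ∷ L) f with p a
... | true = cong (f a +ℚ_) (sumOver-filterᵇ p L f)
... | false = trans (sumOver-filterᵇ p L f) (sym (QP.+-identityˡ _))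

sumOver-swap : {A B : Set} (L : List A) (M : List B) (h : A → B → ℚ) →
  sumOver L (λ a → sumOver M (h a)) ≡ sumOver M (λ b → sumOver L (λ a → h a b))
sumOver-swap [] M h = sym (sumOver-0 M)
sumOver-swap (a ∷ L) M h = begin
  sumOver M (h a) +ℚ sumOver L (λ a → sumOver M (h a)) ≡⟨ cong (sumOver M (h a) +ℚ_) (sumOver-swap L M h) ⟩
  sumOver M (h a) +ℚ sumOver M (λ b → sumOver L (λ a → h a b)) ≡⟨ sym (sumOver-+ M (h a) _) ⟩
  sumOver M (λ b → h a b +ℚ sumOver L (λ a → h a b)) ∎

sumBelow : ℕ → (ℕ → ℚ) → ℚ
sumBelow n f = sumℚ (applyUpTo f n)

sumOver-upTo : (n : ℕ) (f : ℕ → ℚ) → sumOver (upTo n) f ≡ sumBelow n f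
sumOver-upTo n f = cong sumℚ (LP.map-upTo f n)

sumBelow-cong : (n : ℕ) {f g : ℕ → ℚ} → (∀ i → f i ≡ g i) → sumBelow n f ≡ sumBelow n g
sumBelow-cong zero e = refl
sumBelow-cong (suc n) e = cong₂ _+ℚ_ (e 0) (sumBelow-cong n (λ i → e (suc i)))

sumBelow-cong< : (n : ℕ) {f g : ℕ → ℚ} → (∀ i → i < n → f i ≡ g i) → sumBelow n f ≡ sumBelow n g
sumBelow-cong< zero e = refl
sumBelow-cong< (suc n) e = cong₂ _+ℚ_ (e 0 (s≤s z≤n)) (sumBelow-cong< n (λ i lt → e (suc i) (s≤s lt)))

sumℚ-++ : (L M : List ℚ) → sumℚ (L ++ M) ≡ sumℚ L +ℚ sumℚ M
sumℚ-++ [] M = sym (QP.+-identityˡ _)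
sumℚ-++ (a ∷ L) M = trans (cong (a +ℚ_) (sumℚ-++ L M)) (sym (QP.+-assoc a _ _))

sumBelow-suc : (n : ℕ) (f : ℕ → ℚ) → sumBelow (suc n) f ≡ sumBelow n f +ℚ f n
sumBelow-suc n f = begin
  sumℚ (applyUpTo f (suc n)) ≡⟨ cong sumℚ (sym (LP.applyUpTo-∷ʳ f n)) ⟩
  sumℚ (applyUpTo f n ++ [ f n ]) ≡⟨ sumℚ-++ (applyUpTo f n) [ f n ] ⟩
  sumBelow n f +ℚ (f n +ℚ 0ℚ) ≡⟨ cong (sumBelow n f +ℚ_) (QP.+-identityʳ (f n)) ⟩
  sumBelow n f +ℚ f n ∎

sumBelow-+ : (n : ℕ) (f g : ℕ → ℚ) → sumBelow n (λ a → f a +ℚ g a) ≡ sumBelow n f +ℚ sumBelow n g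
sumBelow-+ n f g = trans (sym (sumOver-upTo n _)) (trans (sumOver-+ (upTo n) f g) (cong₂ _+ℚ_ (sumOver-upTo n f) (sumOver-upTo n g)))

*-distribˡ-sumBelow : (c : ℚ) (n : ℕ) (f : ℕ → ℚ) → c *ℚ sumBelow n f ≡ sumBelow n (λ a → c *ℚ f a)
*-distribˡ-sumBelow c n f = trans (cong (c *ℚ_) (sym (sumOver-upTo n f))) (trans (*-distribˡ-sumOver c (upTo n) f) (sumOver-upTo n _))

sumBelow-0 : (n : ℕ) → sumBelow n (λ _ → 0ℚ) ≡ 0ℚ
sumBelow-0 n = trans (sym (sumOver-upTo n _)) (sumOver-0 (upTo n))

sumBelow-swap : (n m : ℕ) (h : ℕ → ℕ → ℚ) → sumBelow n (λ a → sumBelow m (h a)) ≡ sumBelow m (λ b → sumBelow n (λ a → h a b))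
sumBelow-swap n m h = begin
  sumBelow n (λ a → sumBelow m (h a)) ≡⟨ sym (sumOver-upTo n _) ⟩
  sumOver (upTo n) (λ a → sumBelow m (h a)) ≡⟨ sumOver-cong (upTo n) (λ a → sym (sumOver-upTo m (h a))) ⟩
  sumOver (upTo n) (λ a → sumOver (upTo m) (h a)) ≡⟨ sumOver-swap (upTo n) (upTo m) h ⟩
  sumOver (upTo m) (λ b → sumOver (upTo n) (λ a → h a b)) ≡⟨ sumOver-cong (upTo m) (λ b → sumOver-upTo n _) ⟩
  sumOver (upTo m) (λ b → sumBelow n (λ a → h a b)) ≡⟨ sumOver-upTo m _ ⟩
  sumBelow m (λ b → sumBelow n (λ a → h a b)) ∎

sumBelow-extend : (n k : ℕ) (f : ℕ → ℚ) → (∀ i → n ≤ i → f i ≡ 0ℚ) → sumBelow (n + k) f ≡ sumBelow n f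
sumBelow-extend n zero f z = cong (λ m → sumBelow m f) (NP.+-identityʳ n)
sumBelow-extend n (suc k) f z = begin
  sumBelow (n + suc k) f ≡⟨ cong (λ m → sumBelow m f) (NP.+-suc n k) ⟩
  sumBelow (suc (n + k)) f ≡⟨ sumBelow-suc (n + k) f ⟩
  sumBelow (n + k) f +ℚ f (n + k) ≡⟨ cong₂ _+ℚ_ (sumBelow-extend n k f z) (z (n + k) (NP.m≤m+n n k)) ⟩
  sumBelow n f +ℚ 0ℚ ≡⟨ QP.+-identityʳ _ ⟩
  sumBelow n f ∎

sumBelow-extend≤ : (n M : ℕ) (f : ℕ → ℚ) → (∀ i → n ≤ i → f i ≡ 0ℚ) → n ≤ M → sumBelow M f ≡ sumBelow n f
sumBelow-extend≤ n M f z le = trans (cong (λ m → sumBelow m f) (sym (NP.m+[n∸m]≡n le))) (sumBelow-extend n (M ∸ n) f z)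

iverson-*ʳ : (b : Bool) (p q : ℚ) → iverson b p *ℚ q ≡ iverson b (p *ℚ q)
iverson-*ʳ true p q = refl
iverson-*ʳ false p q = QP.*-zeroˡ q

iverson-*ˡ : (b : Bool) (p q : ℚ) → p *ℚ iverson b q ≡ iverson b (p *ℚ q)
iverson-*ˡ true p q = refl
iverson-*ˡ false p q = QP.*-zeroʳ p

iverson-∧-* : (A B : Bool) (p q : ℚ) → iverson (A ∧ B) (p *ℚ q) ≡ iverson B q *ℚ iverson A p
iverson-∧-* true true p q = QP.*-comm p q
iverson-∧-* true false p q = sym (QP.*-zeroˡ p)
iverson-∧-* false B p q = sym (QP.*-zeroʳ (iverson B q))

iverson-iverson : (b c : Bool) (q : ℚ) → iverson b (iverson c q) ≡ iverson (b ∧ c) q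
iverson-iverson true c q = refl
iverson-iverson false c q = refl

iverson-comm : (b c : Bool) (q : ℚ) → iverson b (iverson c q) ≡ iverson c (iverson b q)
iverson-comm true c q = refl
iverson-comm false true q = refl
iverson-comm false false q = refl

iverson-0 : ∀ b → iverson b 0ℚ ≡ 0ℚ
iverson-0 true = refl
iverson-0 false = refl

iverson-sumBelow : (b : Bool) (M : ℕ) (g : ℕ → ℚ) → iverson b (sumBelow M g) ≡ sumBelow M (λ i → iverson b (g i))
iverson-sumBelow true M g = refl
iverson-sumBelow false M g = sym (sumBelow-0 M)

*-distribʳ-sumBelow : (c : ℚ) (n : ℕ) (f : ℕ → ℚ) → sumBelow n f *ℚ c ≡ sumBelow n (λ a → f a *ℚ c)
*-distribʳ-sumBelow c n f = trans (QP.*-comm (sumBelow n f) c) (trans (*-distribˡ-sumBelow c n f) (sumBelow-cong n (λ a → QP.*-comm c (f a))))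

sumBelow-truncate : (h K : ℕ) (g : ℕ → ℚ) → h ≤ K → sumBelow K (λ c → iverson (c <ᵇ h) (g c)) ≡ sumBelow h g
sumBelow-truncate h K g le = trans (sumBelow-extend≤ h K _ (λ i hi → cong (λ b → iverson b (g i)) (≥⇒<ᵇ≡false i h hi)) le)
                       (sumBelow-cong< h (λ i lt → cong (λ b → iverson b (g i)) (<⇒<ᵇ≡true i h lt)))

sumBelow-split : (p q : ℕ) (g : ℕ → ℚ) → sumBelow (p + q) g ≡ sumBelow p g +ℚ sumBelow q (λ j → g (p + j))
sumBelow-split zero q g = sym (QP.+-identityˡ _)
sumBelow-split (suc p) q g = trans (cong (g 0 +ℚ_) (sumBelow-split p q (g ∘ suc))) (sym (QP.+-assoc (g 0) (sumBelow p (g ∘ suc)) _))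

sumBelow-drop : (L s : ℕ) (g : ℕ → ℚ) → sumBelow L (λ m → iverson (s <ᵇ m) (g m)) ≡ sumBelow (L ∸ suc s) (λ j → g (suc s + j))
sumBelow-drop L s g with suc s ≤? L
... | yes le = begin
  sumBelow L (λ m → iverson (s <ᵇ m) (g m)) ≡⟨ cong (λ z → sumBelow z (λ m → iverson (s <ᵇ m) (g m))) (sym (NP.m+[n∸m]≡n le)) ⟩
  sumBelow (suc s + (L ∸ suc s)) (λ m → iverson (s <ᵇ m) (g m)) ≡⟨ sumBelow-split (suc s) (L ∸ suc s) (λ m → iverson (s <ᵇ m) (g m)) ⟩
  sumBelow (suc s) (λ m → iverson (s <ᵇ m) (g m)) +ℚ sumBelow (L ∸ suc s) (λ j → iverson (s <ᵇ suc s + j) (g (suc s + j)))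
    ≡⟨ cong₂ _+ℚ_ (trans (sumBelow-cong< (suc s) (λ i lt → cong (λ b → iverson b (g i)) (≥⇒<ᵇ≡false s i (NP.≤-pred lt)))) (sumBelow-0 (suc s)))
                  (sumBelow-cong (L ∸ suc s) (λ j → cong (λ b → iverson b (g (suc s + j))) (<⇒<ᵇ≡true s (suc s + j) (s≤s (NP.m≤m+n s j))))) ⟩
  0ℚ +ℚ sumBelow (L ∸ suc s) (λ j → g (suc s + j)) ≡⟨ QP.+-identityˡ _ ⟩
  sumBelow (L ∸ suc s) (λ j → g (suc s + j)) ∎
... | no nle = trans (sumBelow-cong< L (λ i lt → cong (λ b → iverson b (g i)) (≥⇒<ᵇ≡false s i (NP.≤-trans (NP.<⇒≤ lt) L≤s))))
                 (trans (sumBelow-0 L) (cong (λ z → sumBelow z (λ j → g (suc s + j))) (sym (NP.m≤n⇒m∸n≡0 (NP.≤-trans L≤s (NP.n≤1+n _))))))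
  where
  L≤s : L ≤ s
  L≤s = NP.≤-pred (NP.≰⇒> nle)

sumBelow-iverson-≡ᵇ : ∀ n k' (h : ℕ → ℚ) → sumBelow n (λ i → iverson (suc i ≡ᵇ suc k') (h i)) ≡ iverson (suc k' ≤ᵇ n) (h k')
sumBelow-iverson-≡ᵇ zero k' h = refl
sumBelow-iverson-≡ᵇ (suc n) k' h with n ≟ k'
... | yes refl = begin
  sumBelow (suc n) (λ i → iverson (i ≡ᵇ n) (h i)) ≡⟨ sumBelow-suc n _ ⟩
  sumBelow n (λ i → iverson (i ≡ᵇ n) (h i)) +ℚ iverson (n ≡ᵇ n) (h n)
    ≡⟨ cong₂ _+ℚ_ (trans (sumBelow-iverson-≡ᵇ n n h) (cong (λ b → iverson b (h n)) (>⇒≤ᵇ≡false (suc n) n NP.≤-refl))) (cong (λ b → iverson b (h n)) (≡ᵇ-refl n)) ⟩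
  0ℚ +ℚ h n ≡⟨ QP.+-identityˡ (h n) ⟩
  h n ≡⟨ cong (λ b → iverson b (h n)) (sym (≤⇒≤ᵇ≡true (suc n) (suc n) NP.≤-refl)) ⟩
  iverson (suc n ≤ᵇ suc n) (h n) ∎
... | no ne = begin
  sumBelow (suc n) (λ i → iverson (i ≡ᵇ k') (h i)) ≡⟨ sumBelow-suc n _ ⟩
  sumBelow n (λ i → iverson (i ≡ᵇ k') (h i)) +ℚ iverson (n ≡ᵇ k') (h n) ≡⟨ cong₂ _+ℚ_ (sumBelow-iverson-≡ᵇ n k' h) (cong (λ b → iverson b (h n)) (≢⇒≡ᵇ≡false n k' ne)) ⟩
  iverson (suc k' ≤ᵇ n) (h k') +ℚ 0ℚ ≡⟨ QP.+-identityʳ _ ⟩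
  iverson (suc k' ≤ᵇ n) (h k') ≡⟨ cong (λ b → iverson b (h k')) (≤ᵇ-suc) ⟩
  iverson (suc k' ≤ᵇ suc n) (h k') ∎
  where
  ≤ᵇ-suc : (suc k' ≤ᵇ n) ≡ (suc k' ≤ᵇ suc n)
  ≤ᵇ-suc with suc k' ≤? n
  ... | yes le = trans (≤⇒≤ᵇ≡true (suc k') n le) (sym (≤⇒≤ᵇ≡true (suc k') (suc n) (NP.≤-trans le (NP.n≤1+n n))))
  ... | no nle = trans (>⇒≤ᵇ≡false (suc k') n (NP.≰⇒> nle)) (sym (>⇒≤ᵇ≡false (suc k') (suc n) (s≤s (NP.≤∧≢⇒< (NP.≤-pred (NP.≰⇒> nle)) ne))))

-- Row words and the one-row ribbon

rowBound : ℕ → ℕ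
rowBound c = if isMarked c then c else suc c

columnBound : ℕ → ℕ
columnBound c = if isMarked c then suc c else c

rowBound≤1+ : ∀ c → rowBound c ≤ suc c
rowBound≤1+ c with isMarked c
... | true = NP.n≤1+n c
... | false = NP.≤-refl

columnBound≤1+ : ∀ c → columnBound c ≤ suc c
columnBound≤1+ c with isMarked c
... | true = NP.≤-refl
... | false = NP.n≤1+n c

≤rowBound : ∀ c → c ≤ rowBound c
≤rowBound c with isMarked c
... | true = NP.≤-refl
... | false = NP.n≤1+n c

≤columnBound : ∀ c → c ≤ columnBound c
≤columnBound c with isMarked c
... | true = NP.n≤1+n c
... | false = NP.≤-refl

rowNeighbours≡<ᵇrowBound : ∀ a c → (a ≤ᵇ c) ∧ (not (a ≡ᵇ c) ∨ not (isMarked a)) ≡ (a <ᵇ rowBound c)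
rowNeighbours≡<ᵇrowBound a c with NP.<-cmp a c
... | tri< lt _ _ rewrite ≤⇒≤ᵇ≡true a c (NP.<⇒≤ lt) | ≢⇒≡ᵇ≡false a c (NP.<⇒≢ lt) =
  sym (<⇒<ᵇ≡true a (rowBound c) (NP.<-≤-trans lt (≤rowBound c)))
... | tri> _ _ gt rewrite >⇒≤ᵇ≡false a c gt =
  sym (≥⇒<ᵇ≡false a (rowBound c) (NP.≤-trans (rowBound≤1+ c) gt))
... | tri≈ _ refl _ rewrite ≤⇒≤ᵇ≡true a a NP.≤-refl | ≡ᵇ-refl a with isMarked a
...   | true = sym (≥⇒<ᵇ≡false a a NP.≤-refl)
...   | false = sym (<⇒<ᵇ≡true a (suc a) NP.≤-refl)

columnNeighbours≡<ᵇcolumnBound : ∀ a c → (a ≤ᵇ c) ∧ (not (a ≡ᵇ c) ∨ isMarked a) ≡ (a <ᵇ columnBound c)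
columnNeighbours≡<ᵇcolumnBound a c with NP.<-cmp a c
... | tri< lt _ _ rewrite ≤⇒≤ᵇ≡true a c (NP.<⇒≤ lt) | ≢⇒≡ᵇ≡false a c (NP.<⇒≢ lt) =
  sym (<⇒<ᵇ≡true a (columnBound c) (NP.<-≤-trans lt (≤columnBound c)))
... | tri> _ _ gt rewrite >⇒≤ᵇ≡false a c gt =
  sym (≥⇒<ᵇ≡false a (columnBound c) (NP.≤-trans (columnBound≤1+ c) gt))
... | tri≈ _ refl _ rewrite ≤⇒≤ᵇ≡true a a NP.≤-refl | ≡ᵇ-refl a with isMarked a
...   | true = sym (<⇒<ᵇ≡true a (suc a) NP.≤-refl)
...   | false = sym (≥⇒<ᵇ≡false a a NP.≤-refl)

isRowWord : List ℕ → Bool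
isRowWord [] = true
isRowWord (a ∷ []) = true
isRowWord (a ∷ b ∷ r) = (a ≤ᵇ b) ∧ ((not (a ≡ᵇ b) ∨ not (isMarked a)) ∧ isRowWord (b ∷ r))

lastBelow : ℕ → List ℕ → Bool
lastBelow h [] = true
lastBelow h (a ∷ []) = a <ᵇ h
lastBelow h (a ∷ b ∷ r) = lastBelow h (b ∷ r)

lastBelow-∷ʳ : ∀ h f c → lastBelow h (f ++ [ c ]) ≡ (c <ᵇ h)
lastBelow-∷ʳ h [] c = refl
lastBelow-∷ʳ h (a ∷ []) c = refl
lastBelow-∷ʳ h (a ∷ b ∷ f) c = lastBelow-∷ʳ h (b ∷ f) c

isRowWord-∷ʳ : ∀ f c → isRowWord (f ++ [ c ]) ≡ isRowWord f ∧ lastBelow (rowBound c) f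
isRowWord-∷ʳ [] c = refl
isRowWord-∷ʳ (a ∷ []) c = trans (cong ((a ≤ᵇ c) ∧_) (BP.∧-identityʳ _)) (rowNeighbours≡<ᵇrowBound a c)
isRowWord-∷ʳ (a ∷ b ∷ f) c = begin
  (a ≤ᵇ b) ∧ ((not (a ≡ᵇ b) ∨ not (isMarked a)) ∧ isRowWord (b ∷ f ++ [ c ]))
    ≡⟨ cong (λ z → (a ≤ᵇ b) ∧ ((not (a ≡ᵇ b) ∨ not (isMarked a)) ∧ z)) (isRowWord-∷ʳ (b ∷ f) c) ⟩
  (a ≤ᵇ b) ∧ ((not (a ≡ᵇ b) ∨ not (isMarked a)) ∧ (isRowWord (b ∷ f) ∧ lastBelow (rowBound c) (b ∷ f)))
    ≡⟨ cong ((a ≤ᵇ b) ∧_) (sym (BP.∧-assoc (not (a ≡ᵇ b) ∨ not (isMarked a)) _ _)) ⟩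
  (a ≤ᵇ b) ∧ (((not (a ≡ᵇ b) ∨ not (isMarked a)) ∧ isRowWord (b ∷ f)) ∧ lastBelow (rowBound c) (b ∷ f))
    ≡⟨ sym (BP.∧-assoc (a ≤ᵇ b) _ _) ⟩
  ((a ≤ᵇ b) ∧ ((not (a ≡ᵇ b) ∨ not (isMarked a)) ∧ isRowWord (b ∷ f))) ∧ lastBelow (rowBound c) (b ∷ f) ∎
  where open ≡-Reasoning

FilledBox : Set
FilledBox = (ℕ × ℕ) × ℕ

allPairsOK : List FilledBox → Bool
allPairsOK P = allᵇ (λ p → allᵇ (λ q → pairOK p q) P) P

allPairsOK-∷ : ∀ p P → allPairsOK (p ∷ P) ≡ pairOK p p ∧ (allᵇ (pairOK p) P ∧ (allᵇ (λ q → pairOK q p) P ∧ allPairsOK P))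
allPairsOK-∷ p P rewrite allᵇ-∧ (λ q → pairOK q p) (λ q → allᵇ (pairOK q) P) P
  with pairOK p p | allᵇ (pairOK p) P
... | true | true = refl
... | true | false = refl
... | false | _ = refl

pairOK-refl : ∀ r s a → pairOK ((r , s) , a) ((r , s) , a) ≡ true
pairOK-refl r s a rewrite ≡ᵇ-refl r | ≡ᵇ-refl s | ≢⇒≡ᵇ≡false s (suc s) (n≢1+n s) | ≢⇒≡ᵇ≡false r (suc r) (n≢1+n r) = refl

pairOK-rightNeighbour : ∀ r s a b → pairOK ((r , s) , a) ((r , suc s) , b) ≡ (a ≤ᵇ b) ∧ (not (a ≡ᵇ b) ∨ not (isMarked a))
pairOK-rightNeighbour r s a b rewrite ≡ᵇ-refl r | ≡ᵇ-refl s | ≢⇒≡ᵇ≡false s (suc s) (n≢1+n s) | ≢⇒≡ᵇ≡false (suc s) s (λ e → n≢1+n s (sym e)) = refl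

pairOK-sameRow-right : ∀ r s j a l → j ≢ suc s → s ≢ j → pairOK ((r , s) , a) ((r , j) , l) ≡ (not (a ≡ᵇ l) ∨ not (isMarked a))
pairOK-sameRow-right r s j a l n1 n2 rewrite ≡ᵇ-refl r | ≢⇒≡ᵇ≡false j (suc s) n1 | ≢⇒≡ᵇ≡false s j n2 | ≢⇒≡ᵇ≡false j s (λ e → n2 (sym e)) = refl

pairOK-sameRow-left : ∀ r s j a l → s ≢ suc j → j ≢ s → pairOK ((r , j) , l) ((r , s) , a) ≡ (not (l ≡ᵇ a) ∨ not (isMarked l))
pairOK-sameRow-left r s j a l n1 n2 rewrite ≡ᵇ-refl r | ≢⇒≡ᵇ≡false s (suc j) n1 | ≢⇒≡ᵇ≡false j s n2 | ≢⇒≡ᵇ≡false s j (λ e → n2 (sym e)) = refl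

rowFilling : ℕ → ℕ → List ℕ → List FilledBox
rowFilling r s [] = []
rowFilling r s (l ∷ f) = ((r , s) , l) ∷ rowFilling r (suc s) f

allᵇ-pairOK-farRight : ∀ r s a t f → allᵇ (pairOK ((r , s) , a)) (rowFilling r (suc (suc (t + s))) f) ≡ allᵇ (λ l → not (a ≡ᵇ l) ∨ not (isMarked a)) f
allᵇ-pairOK-farRight r s a t [] = refl
allᵇ-pairOK-farRight r s a t (l ∷ f) =
  cong₂ _∧_ (pairOK-sameRow-right r s (suc (suc (t + s))) a l
              (λ e → 1+m+n≢n t s (NP.suc-injective e))
              (λ e → 1+m+n≢n (suc t) s (sym e)))
            (allᵇ-pairOK-farRight r s a (suc t) f)

allᵇ-pairOK-farLeft : ∀ r s a t f → allᵇ (λ q → pairOK q ((r , s) , a)) (rowFilling r (suc (t + s)) f) ≡ allᵇ (λ l → not (l ≡ᵇ a) ∨ not (isMarked l)) f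
allᵇ-pairOK-farLeft r s a t [] = refl
allᵇ-pairOK-farLeft r s a t (l ∷ f) =
  cong₂ _∧_ (pairOK-sameRow-left r s (suc (t + s)) a l
              (λ e → 1+m+n≢n (suc t) s (sym e))
              (λ e → 1+m+n≢n t s e))
            (allᵇ-pairOK-farLeft r s a (suc t) f)

allᵇ-above : (g : ℕ → Bool) (b : ℕ) (L : List ℕ) → (∀ l → b ≤ l → g l ≡ true) → allᵇ (b ≤ᵇ_) L ≡ true → allᵇ g L ≡ true
allᵇ-above g b [] h e = refl
allᵇ-above g b (l ∷ L) h e with ∧≡true⇒× (b ≤ᵇ l) _ e
... | e1 , e2 rewrite h l (≤ᵇ≡true⇒≤ b l e1) = allᵇ-above g b L h e2

isRowWord-head≤ : ∀ b f → isRowWord (b ∷ f) ≡ true → allᵇ (b ≤ᵇ_) (b ∷ f) ≡ true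
isRowWord-head≤ b [] e rewrite ≤⇒≤ᵇ≡true b b NP.≤-refl = refl
isRowWord-head≤ b (c ∷ f) e with ∧≡true⇒× (b ≤ᵇ c) _ e
... | e1 , e2 with ∧≡true⇒× _ (isRowWord (c ∷ f)) e2
... | _ , e3 rewrite ≤⇒≤ᵇ≡true b b NP.≤-refl =
  allᵇ-above (b ≤ᵇ_) c (c ∷ f) (λ l cl → ≤⇒≤ᵇ≡true b l (NP.≤-trans (≤ᵇ≡true⇒≤ b c e1) cl)) (isRowWord-head≤ c f e3)

repeatedInRow⇒unmarked : ∀ a b l → (a <ᵇ rowBound b) ≡ true → b ≤ l → a ≡ l → isMarked a ≡ false
repeatedInRow⇒unmarked a b l e bl refl with isMarked b in mb
... | true = ⊥-elim (NP.<⇒≱ (<ᵇ≡true⇒< a b e) bl)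
... | false with NP.≤-antisym (NP.≤-pred (<ᵇ≡true⇒< a (suc b) e)) bl
...   | refl = mb

noRepeatedMark-later : ∀ a b l → (a <ᵇ rowBound b) ≡ true → b ≤ l → (not (a ≡ᵇ l) ∨ not (isMarked a)) ≡ true
noRepeatedMark-later a b l e bl with a ≡ᵇ l in el
... | false = refl
... | true rewrite repeatedInRow⇒unmarked a b l e bl (≡ᵇ≡true⇒≡ a l el) = refl

noRepeatedMark-earlier : ∀ a b l → (a <ᵇ rowBound b) ≡ true → b ≤ l → (not (l ≡ᵇ a) ∨ not (isMarked l)) ≡ true
noRepeatedMark-earlier a b l e bl with l ≡ᵇ a in el
... | false = refl
... | true with ≡ᵇ≡true⇒≡ l a el
...   | refl rewrite repeatedInRow⇒unmarked l b l e bl refl = refl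

rowPairs-reduce : ∀ a b f →
  (((a ≤ᵇ b) ∧ (not (a ≡ᵇ b) ∨ not (isMarked a))) ∧ allᵇ (λ l → not (a ≡ᵇ l) ∨ not (isMarked a)) f)
  ∧ (allᵇ (λ l → not (l ≡ᵇ a) ∨ not (isMarked l)) (b ∷ f) ∧ isRowWord (b ∷ f))
  ≡ (a ≤ᵇ b) ∧ ((not (a ≡ᵇ b) ∨ not (isMarked a)) ∧ isRowWord (b ∷ f))
rowPairs-reduce a b f rewrite sym (BP.∧-assoc (a ≤ᵇ b) (not (a ≡ᵇ b) ∨ not (isMarked a)) (isRowWord (b ∷ f)))
  | rowNeighbours≡<ᵇrowBound a b with isRowWord (b ∷ f) in eR
... | false = trans (trans (cong (((a <ᵇ rowBound b) ∧ allᵇ (λ l → not (a ≡ᵇ l) ∨ not (isMarked a)) f) ∧_)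
                         (BP.∧-zeroʳ (allᵇ (λ l → not (l ≡ᵇ a) ∨ not (isMarked l)) (b ∷ f))))
                         (BP.∧-zeroʳ _)) (sym (BP.∧-zeroʳ (a <ᵇ rowBound b)))
... | true with a <ᵇ rowBound b in eA
...   | false = refl
...   | true with ∧≡true⇒× (b ≤ᵇ b) _ (isRowWord-head≤ b f eR)
...     | _ , mf rewrite allᵇ-above (λ l → not (a ≡ᵇ l) ∨ not (isMarked a)) b f (λ l → noRepeatedMark-later a b l eA) mf
                   | allᵇ-above (λ l → not (l ≡ᵇ a) ∨ not (isMarked l)) b (b ∷ f) (λ l → noRepeatedMark-earlier a b l eA) (isRowWord-head≤ b f eR) = refl

allPairsOK-row≡isRowWord : ∀ r s f → allPairsOK (rowFilling r s f) ≡ isRowWord f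
allPairsOK-row≡isRowWord r s [] = refl
allPairsOK-row≡isRowWord r s (a ∷ []) rewrite pairOK-refl r s a = refl
allPairsOK-row≡isRowWord r s (a ∷ b ∷ f) =
  trans (allPairsOK-∷ ((r , s) , a) (rowFilling r (suc s) (b ∷ f)))
  (trans (cong₂ _∧_ (pairOK-refl r s a)
           (cong₂ _∧_ (cong₂ _∧_ (pairOK-rightNeighbour r s a b) (allᵇ-pairOK-farRight r s a 0 f))
                      (cong₂ _∧_ (allᵇ-pairOK-farLeft r s a 0 (b ∷ f)) (allPairsOK-row≡isRowWord r (suc s) (b ∷ f)))))
         (rowPairs-reduce a b f))

sumOver-allFillings-∷ : (m K : ℕ) (F : List ℕ → ℚ) →
  sumOver (allFillings (suc m) K) F ≡ sumOver (upTo K) (λ c → sumOver (allFillings m K) (λ f → F (c ∷ f)))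
sumOver-allFillings-∷ m K F = trans (sumOver-concatMap (λ c → map (c ∷_) (allFillings m K)) (upTo K) F)
                      (sumOver-cong (upTo K) (λ c → sumOver-map (c ∷_) (allFillings m K) F))

sumOver-allFillings-∷ʳ : (m K : ℕ) (F : List ℕ → ℚ) →
  sumOver (allFillings (suc m) K) F ≡ sumOver (allFillings m K) (λ f → sumOver (upTo K) (λ c → F (f ++ [ c ])))
sumOver-allFillings-∷ʳ zero K F = begin
  sumOver (allFillings 1 K) F ≡⟨ sumOver-allFillings-∷ 0 K F ⟩
  sumOver (upTo K) (λ c → F [ c ] +ℚ 0ℚ) ≡⟨ sym (QP.+-identityʳ _) ⟩
  sumOver (upTo K) (λ c → F [ c ] +ℚ 0ℚ) +ℚ 0ℚ ≡⟨ cong (_+ℚ 0ℚ) (sumOver-cong (upTo K) (λ c → QP.+-identityʳ _)) ⟩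
  sumOver (upTo K) (λ c → F [ c ]) +ℚ 0ℚ ∎
sumOver-allFillings-∷ʳ (suc m) K F = begin
  sumOver (allFillings (suc (suc m)) K) F ≡⟨ sumOver-allFillings-∷ (suc m) K F ⟩
  sumOver (upTo K) (λ c → sumOver (allFillings (suc m) K) (λ f → F (c ∷ f))) ≡⟨ sumOver-cong (upTo K) (λ c → sumOver-allFillings-∷ʳ m K (λ f → F (c ∷ f))) ⟩
  sumOver (upTo K) (λ c → sumOver (allFillings m K) (λ f → sumOver (upTo K) (λ d → F (c ∷ f ++ [ d ])))) ≡⟨ sym (sumOver-allFillings-∷ m K _) ⟩
  sumOver (allFillings (suc m) K) (λ f → sumOver (upTo K) (λ c → F (f ++ [ c ]))) ∎

sumOver-allFillings-cong : (m K : ℕ) {F G : List ℕ → ℚ} → (∀ f → length f ≡ m → F f ≡ G f) →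
  sumOver (allFillings m K) F ≡ sumOver (allFillings m K) G
sumOver-allFillings-cong zero K h = cong (_+ℚ 0ℚ) (h [] refl)
sumOver-allFillings-cong (suc m) K {F} {G} h = begin
  sumOver (allFillings (suc m) K) F ≡⟨ sumOver-allFillings-∷ m K F ⟩
  sumOver (upTo K) (λ c → sumOver (allFillings m K) (λ f → F (c ∷ f))) ≡⟨ sumOver-cong (upTo K) (λ c → sumOver-allFillings-cong m K (λ f e → h (c ∷ f) (cong suc e))) ⟩
  sumOver (upTo K) (λ c → sumOver (allFillings m K) (λ f → G (c ∷ f))) ≡⟨ sym (sumOver-allFillings-∷ m K G) ⟩
  sumOver (allFillings (suc m) K) G ∎

monomial : (ℕ → ℚ) → List ℕ → ℚ
monomial x f = prodℚ (map (λ c → x (letterValue c)) f)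

monomial-∷ʳ : (x : ℕ → ℚ) (f : List ℕ) (c : ℕ) → monomial x (f ++ [ c ]) ≡ monomial x f *ℚ x (letterValue c)
monomial-∷ʳ x [] c = trans (QP.*-identityʳ (x (letterValue c))) (sym (QP.*-identityˡ (x (letterValue c))))
monomial-∷ʳ x (a ∷ f) c = trans (cong (x (letterValue a) *ℚ_) (monomial-∷ʳ x f c)) (sym (QP.*-assoc (x (letterValue a)) (monomial x f) (x (letterValue c))))

-- rowPoly x m h sums the monomials of the row words of length m whose letters have codes below h.
rowPoly : (ℕ → ℚ) → ℕ → ℕ → ℚ
rowPoly x zero hi = 1ℚ
rowPoly x (suc m) hi = sumBelow hi (λ c → x (letterValue c) *ℚ rowPoly x m (rowBound c))

sumOver-rowWords-lastBelow : (x : ℕ → ℚ) (K m hi : ℕ) → hi ≤ K →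
  sumOver (allFillings m K) (λ f → iverson (isRowWord f ∧ lastBelow hi f) (monomial x f)) ≡ rowPoly x m hi
sumOver-rowWords-lastBelow x K zero hi le = QP.+-identityʳ _
sumOver-rowWords-lastBelow x K (suc m) hi le = begin
  sumOver (allFillings (suc m) K) (λ f → iverson (isRowWord f ∧ lastBelow hi f) (monomial x f))
    ≡⟨ sumOver-allFillings-∷ʳ m K _ ⟩
  sumOver (allFillings m K) (λ f → sumOver (upTo K) (λ c → iverson (isRowWord (f ++ [ c ]) ∧ lastBelow hi (f ++ [ c ])) (monomial x (f ++ [ c ]))))
    ≡⟨ sumOver-cong (allFillings m K) (λ f → sumOver-cong (upTo K) (λ c → appendLast f c)) ⟩
  sumOver (allFillings m K) (λ f → sumOver (upTo K) (λ c → iverson (c <ᵇ hi) (x (letterValue c)) *ℚ iverson (isRowWord f ∧ lastBelow (rowBound c) f) (monomial x f)))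
    ≡⟨ sumOver-swap (allFillings m K) (upTo K) _ ⟩
  sumOver (upTo K) (λ c → sumOver (allFillings m K) (λ f → iverson (c <ᵇ hi) (x (letterValue c)) *ℚ iverson (isRowWord f ∧ lastBelow (rowBound c) f) (monomial x f)))
    ≡⟨ sumOver-cong (upTo K) (λ c → sym (*-distribˡ-sumOver (iverson (c <ᵇ hi) (x (letterValue c))) (allFillings m K) (λ f → iverson (isRowWord f ∧ lastBelow (rowBound c) f) (monomial x f)))) ⟩
  sumOver (upTo K) (λ c → iverson (c <ᵇ hi) (x (letterValue c)) *ℚ sumOver (allFillings m K) (λ f → iverson (isRowWord f ∧ lastBelow (rowBound c) f) (monomial x f)))
    ≡⟨ sumOver-cong (upTo K) boundedTail ⟩
  sumOver (upTo K) (λ c → iverson (c <ᵇ hi) (x (letterValue c) *ℚ rowPoly x m (rowBound c)))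
    ≡⟨ sumOver-upTo K _ ⟩
  sumBelow K (λ c → iverson (c <ᵇ hi) (x (letterValue c) *ℚ rowPoly x m (rowBound c)))
    ≡⟨ sumBelow-truncate hi K _ le ⟩
  rowPoly x (suc m) hi ∎
  where
  appendLast : ∀ f c → iverson (isRowWord (f ++ [ c ]) ∧ lastBelow hi (f ++ [ c ])) (monomial x (f ++ [ c ]))
                 ≡ iverson (c <ᵇ hi) (x (letterValue c)) *ℚ iverson (isRowWord f ∧ lastBelow (rowBound c) f) (monomial x f)
  appendLast f c rewrite isRowWord-∷ʳ f c | lastBelow-∷ʳ hi f c | monomial-∷ʳ x f c =
    iverson-∧-* (isRowWord f ∧ lastBelow (rowBound c) f) (c <ᵇ hi) (monomial x f) (x (letterValue c))
  boundedTail : ∀ c → iverson (c <ᵇ hi) (x (letterValue c)) *ℚ sumOver (allFillings m K) (λ f → iverson (isRowWord f ∧ lastBelow (rowBound c) f) (monomial x f))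
               ≡ iverson (c <ᵇ hi) (x (letterValue c) *ℚ rowPoly x m (rowBound c))
  boundedTail c with c <ᵇ hi in e
  ... | true = cong (x (letterValue c) *ℚ_) (sumOver-rowWords-lastBelow x K m (rowBound c) (NP.≤-trans (rowBound≤1+ c) (NP.≤-trans (<ᵇ≡true⇒< c hi e) le)))
  ... | false = QP.*-zeroˡ (sumOver (allFillings m K) (λ f → iverson (isRowWord f ∧ lastBelow (rowBound c) f) (monomial x f)))

applyUpTo-cong : {A : Set} {g h : ℕ → A} (n : ℕ) → (∀ i → g i ≡ h i) → applyUpTo g n ≡ applyUpTo h n
applyUpTo-cong zero e = refl
applyUpTo-cong (suc n) e = cong₂ _∷_ (e 0) (applyUpTo-cong n (λ i → e (suc i)))

zip-columns≡rowFilling : ∀ r s f → zip (applyUpTo (λ j → (r , s + j)) (length f)) f ≡ rowFilling r s f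
zip-columns≡rowFilling r s [] = refl
zip-columns≡rowFilling r s (l ∷ f) = cong₂ _∷_ (cong (λ z → ((r , z) , l)) (NP.+-identityʳ s))
  (trans (cong (λ L → zip L f) (applyUpTo-cong (length f) (λ i → cong (r ,_) (NP.+-suc s i)))) (zip-columns≡rowFilling r (suc s) f))

sumOver-tableaux-cong : (x : ℕ → ℚ) (K : ℕ) (bs : List (ℕ × ℕ)) (L : ℕ) (G : List ℕ → Bool) → length bs ≡ L →
  (∀ f → length f ≡ L → isTableau bs f ≡ G f) →
  sumOver (allFillings (length bs) K) (λ f → iverson (isTableau bs f) (monomial x f)) ≡ sumOver (allFillings L K) (λ f → iverson (G f) (monomial x f))
sumOver-tableaux-cong x K bs .(length bs) G refl h = sumOver-allFillings-cong (length bs) K (λ f e → cong (λ b → iverson b (monomial x f)) (h f e))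

rEval≡sumOver-allFillings : (α : List ℕ) (N : ℕ) (x : ℕ → ℚ) →
  rEval α N x ≡ sumOver (allFillings (length (ribbonBoxes α)) (2 * N)) (λ f → iverson (isTableau (ribbonBoxes α) f) (monomial x f))
rEval≡sumOver-allFillings α N x = sumOver-filterᵇ (isTableau (ribbonBoxes α)) (allFillings (length (ribbonBoxes α)) (2 * N)) (monomial x)

ribbonBoxes-row : ∀ m → ribbonBoxes (triangle (suc m) 1) ≡ applyUpTo (λ j → (1 , 1 + j)) (suc m)
ribbonBoxes-row m = trans (LP.++-identityʳ _) (trans (LP.map-upTo (λ j → (1 , 1 + j)) (m + 1))
                  (cong (applyUpTo (λ j → (1 , 1 + j))) (NP.+-comm m 1)))

sumOver-rowWords : (x : ℕ → ℚ) (K m : ℕ) →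
  sumOver (allFillings (suc m) K) (λ f → iverson (isRowWord f) (monomial x f)) ≡ rowPoly x (suc m) K
sumOver-rowWords x K m = begin
  sumOver (allFillings (suc m) K) (λ f → iverson (isRowWord f) (monomial x f)) ≡⟨ sumOver-allFillings-∷ʳ m K _ ⟩
  sumOver (allFillings m K) (λ f → sumOver (upTo K) (λ c → iverson (isRowWord (f ++ [ c ])) (monomial x (f ++ [ c ]))))
    ≡⟨ sumOver-cong (allFillings m K) (λ f → sumOver-cong (upTo K) (λ c → appendLast f c)) ⟩
  sumOver (allFillings m K) (λ f → sumOver (upTo K) (λ c → x (letterValue c) *ℚ iverson (isRowWord f ∧ lastBelow (rowBound c) f) (monomial x f)))
    ≡⟨ sumOver-swap (allFillings m K) (upTo K) _ ⟩
  sumOver (upTo K) (λ c → sumOver (allFillings m K) (λ f → x (letterValue c) *ℚ iverson (isRowWord f ∧ lastBelow (rowBound c) f) (monomial x f)))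
    ≡⟨ sumOver-cong (upTo K) (λ c → sym (*-distribˡ-sumOver (x (letterValue c)) (allFillings m K) (λ f → iverson (isRowWord f ∧ lastBelow (rowBound c) f) (monomial x f)))) ⟩
  sumOver (upTo K) (λ c → x (letterValue c) *ℚ sumOver (allFillings m K) (λ f → iverson (isRowWord f ∧ lastBelow (rowBound c) f) (monomial x f)))
    ≡⟨ sumOver-upTo K _ ⟩
  sumBelow K (λ c → x (letterValue c) *ℚ sumOver (allFillings m K) (λ f → iverson (isRowWord f ∧ lastBelow (rowBound c) f) (monomial x f)))
    ≡⟨ sumBelow-cong< K (λ c lt → cong (x (letterValue c) *ℚ_) (sumOver-rowWords-lastBelow x K m (rowBound c) (NP.≤-trans (rowBound≤1+ c) lt))) ⟩
  rowPoly x (suc m) K ∎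
  where
  appendLast : ∀ f c → iverson (isRowWord (f ++ [ c ])) (monomial x (f ++ [ c ])) ≡ x (letterValue c) *ℚ iverson (isRowWord f ∧ lastBelow (rowBound c) f) (monomial x f)
  appendLast f c rewrite isRowWord-∷ʳ f c | monomial-∷ʳ x f c = trans (sym (iverson-*ʳ (isRowWord f ∧ lastBelow (rowBound c) f) (monomial x f) (x (letterValue c))))
    (QP.*-comm (iverson (isRowWord f ∧ lastBelow (rowBound c) f) (monomial x f)) (x (letterValue c)))

rEval-row : (m N : ℕ) (x : ℕ → ℚ) → rEval (triangle (suc m) 1) N x ≡ rowPoly x (suc m) (2 * N)
rEval-row m N x = trans (rEval≡sumOver-allFillings (triangle (suc m) 1) N x)
  (trans (sumOver-tableaux-cong x (2 * N) (ribbonBoxes (triangle (suc m) 1)) (suc m) isRowWord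
            (trans (cong length (ribbonBoxes-row m)) (LP.length-applyUpTo (λ j → (1 , 1 + j)) (suc m)))
            (λ f e → trans (cong (λ L → allPairsOK (zip L f)) (trans (ribbonBoxes-row m) (cong (applyUpTo (λ j → (1 , 1 + j))) (sym e))))
                     (trans (cong allPairsOK (zip-columns≡rowFilling 1 1 f)) (allPairsOK-row≡isRowWord 1 1 f))))
         (sumOver-rowWords x (2 * N) m))

-- The hook ribbon

pairOK-12 : ∀ s a b → pairOK ((1 , s) , a) ((2 , s) , b) ≡ (a <ᵇ columnBound b)
pairOK-12 s a b rewrite ≡ᵇ-refl s = trans (cong ((a ≤ᵇ b) ∧_) (BP.∧-identityʳ _)) (columnNeighbours≡<ᵇcolumnBound a b)

pairOK-21 : ∀ s a b → pairOK ((2 , s) , b) ((1 , s) , a) ≡ (not (b ≡ᵇ a) ∨ isMarked b)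
pairOK-21 s a b rewrite ≡ᵇ-refl s = BP.∧-identityʳ _

pairOK-13-otherColumn : ∀ s a j l → j ≢ s → pairOK ((1 , s) , a) ((3 , j) , l) ≡ true
pairOK-13-otherColumn s a j l ne rewrite ≢⇒≡ᵇ≡false j s ne | ≢⇒≡ᵇ≡false s j (λ e → ne (sym e)) = refl

pairOK-13 : ∀ s a l → pairOK ((1 , s) , a) ((3 , s) , l) ≡ (not (a ≡ᵇ l) ∨ isMarked a)
pairOK-13 s a l rewrite ≡ᵇ-refl s = BP.∧-identityʳ _

pairOK-31-otherColumn : ∀ s a j l → j ≢ s → pairOK ((3 , j) , l) ((1 , s) , a) ≡ true
pairOK-31-otherColumn s a j l ne rewrite ≢⇒≡ᵇ≡false j s ne | ≢⇒≡ᵇ≡false s j (λ e → ne (sym e)) = refl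

pairOK-31 : ∀ s a l → pairOK ((3 , s) , l) ((1 , s) , a) ≡ (not (l ≡ᵇ a) ∨ isMarked l)
pairOK-31 s a l rewrite ≡ᵇ-refl s = BP.∧-identityʳ _

pairOK-23-otherColumn : ∀ s b j l → j ≢ s → pairOK ((2 , s) , b) ((3 , j) , l) ≡ true
pairOK-23-otherColumn s b j l ne rewrite ≢⇒≡ᵇ≡false j s ne | ≢⇒≡ᵇ≡false s j (λ e → ne (sym e)) = refl

pairOK-23 : ∀ s b l → pairOK ((2 , s) , b) ((3 , s) , l) ≡ (b <ᵇ columnBound l)
pairOK-23 s b l rewrite ≡ᵇ-refl s = trans (cong ((b ≤ᵇ l) ∧_) (BP.∧-identityʳ _)) (columnNeighbours≡<ᵇcolumnBound b l)

pairOK-32-otherColumn : ∀ s b j l → j ≢ s → pairOK ((3 , j) , l) ((2 , s) , b) ≡ true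
pairOK-32-otherColumn s b j l ne rewrite ≢⇒≡ᵇ≡false j s ne | ≢⇒≡ᵇ≡false s j (λ e → ne (sym e)) = refl

pairOK-32 : ∀ s b l → pairOK ((3 , s) , l) ((2 , s) , b) ≡ (not (l ≡ᵇ b) ∨ isMarked l)
pairOK-32 s b l rewrite ≡ᵇ-refl s = BP.∧-identityʳ _

allᵇ-rowFilling-∷ʳ : (g : FilledBox → Bool) (r t : ℕ) (w : List ℕ) (c : ℕ) →
  (∀ j l → j ≢ length w + t → g ((r , j) , l) ≡ true) →
  allᵇ g (rowFilling r t (w ++ [ c ])) ≡ g ((r , length w + t) , c) ∧ true
allᵇ-rowFilling-∷ʳ g r t [] c h = refl
allᵇ-rowFilling-∷ʳ g r t (a ∷ w) c h =
  trans (cong₂ _∧_ (h t a (λ e → 1+m+n≢n (length w) t (sym e)))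
                   (allᵇ-rowFilling-∷ʳ g r (suc t) w c (λ j l ne → h j l (λ e → ne (trans e (sym (NP.+-suc (length w) t)))))))
        (cong (λ z → g ((r , z) , c) ∧ true) (NP.+-suc (length w) t))

<ᵇcolumnBound⇒≤ : ∀ a b → (a <ᵇ columnBound b) ≡ true → a ≤ b
<ᵇcolumnBound⇒≤ a b e = NP.≤-pred (NP.≤-trans (<ᵇ≡true⇒< a (columnBound b) e) (columnBound≤1+ b))

<ᵇcolumnBound-self⇒marked : ∀ a → (a <ᵇ columnBound a) ≡ true → isMarked a ≡ true
<ᵇcolumnBound-self⇒marked a e with isMarked a
... | true = refl
... | false = ⊥-elim (NP.<-irrefl refl (<ᵇ≡true⇒< a a e))

hookConditions-reduce : ∀ col₁₂ rep₁₃ rep₂₁ rep₃₁ col₂₃ rep₃₂ rest → (col₁₂ ∧ col₂₃ ≡ true → (rep₁₃ ≡ true) × ((rep₂₁ ≡ true) × ((rep₃₁ ≡ true) × (rep₃₂ ≡ true)))) →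
  true ∧ ((col₁₂ ∧ (rep₁₃ ∧ true)) ∧ ((rep₂₁ ∧ (rep₃₁ ∧ true)) ∧ (true ∧ (col₂₃ ∧ ((rep₃₂ ∧ true) ∧ rest))))) ≡ (col₁₂ ∧ col₂₃) ∧ rest
hookConditions-reduce false rep₁₃ rep₂₁ rep₃₁ col₂₃ rep₃₂ rest repeats = refl
hookConditions-reduce true rep₁₃ rep₂₁ rep₃₁ false rep₃₂ rest repeats =
  trans (cong ((rep₁₃ ∧ true) ∧_) (BP.∧-zeroʳ (rep₂₁ ∧ (rep₃₁ ∧ true)))) (BP.∧-zeroʳ (rep₁₃ ∧ true))
hookConditions-reduce true rep₁₃ rep₂₁ rep₃₁ true rep₃₂ rest repeats with repeats refl
... | refl , refl , refl , refl = refl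

columnRepeatsMarked : ∀ a b c → (a <ᵇ columnBound b) ∧ (b <ᵇ columnBound c) ≡ true →
  ((not (a ≡ᵇ c) ∨ isMarked a) ≡ true) × (((not (b ≡ᵇ a) ∨ isMarked b) ≡ true) × (((not (c ≡ᵇ a) ∨ isMarked c) ≡ true) × ((not (c ≡ᵇ b) ∨ isMarked c) ≡ true)))
columnRepeatsMarked a b c e with ∧≡true⇒× (a <ᵇ columnBound b) (b <ᵇ columnBound c) e
... | eab , ebc = repeat-ac , repeat-ba , repeat-ca , repeat-cb
  where
  ab : a ≤ b
  ab = <ᵇcolumnBound⇒≤ a b eab
  bc : b ≤ c
  bc = <ᵇcolumnBound⇒≤ b c ebc
  repeat-ac : (not (a ≡ᵇ c) ∨ isMarked a) ≡ true
  repeat-ac with a ≡ᵇ c in e1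
  ... | false = refl
  ... | true with ≡ᵇ≡true⇒≡ a c e1
  ...   | refl with NP.≤-antisym ab bc
  ...     | refl = <ᵇcolumnBound-self⇒marked a eab
  repeat-ba : (not (b ≡ᵇ a) ∨ isMarked b) ≡ true
  repeat-ba with b ≡ᵇ a in e1
  ... | false = refl
  ... | true with ≡ᵇ≡true⇒≡ b a e1
  ...   | refl = <ᵇcolumnBound-self⇒marked b eab
  repeat-ca : (not (c ≡ᵇ a) ∨ isMarked c) ≡ true
  repeat-ca with c ≡ᵇ a in e1
  ... | false = refl
  ... | true with ≡ᵇ≡true⇒≡ c a e1
  ...   | refl with NP.≤-antisym ab bc
  ...     | refl = <ᵇcolumnBound-self⇒marked c eab
  repeat-cb : (not (c ≡ᵇ b) ∨ isMarked c) ≡ true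
  repeat-cb with c ≡ᵇ b in e1
  ... | false = refl
  ... | true with ≡ᵇ≡true⇒≡ c b e1
  ...   | refl = <ᵇcolumnBound-self⇒marked c ebc

allPairsOK-hook : ∀ a b w c →
  allPairsOK (((1 , length w + 1) , a) ∷ ((2 , length w + 1) , b) ∷ rowFilling 3 1 (w ++ [ c ]))
  ≡ ((a <ᵇ columnBound b) ∧ (b <ᵇ columnBound c)) ∧ (isRowWord w ∧ lastBelow (rowBound c) w)
allPairsOK-hook a b w c =
  trans (allPairsOK-∷ p1 (p2 ∷ P))
  (trans (cong₂ _∧_ (pairOK-refl 1 s a)
          (cong₂ _∧_ (cong₂ _∧_ (pairOK-12 s a b) (trans (allᵇ-rowFilling-∷ʳ (pairOK p1) 3 1 w c (λ j l ne → pairOK-13-otherColumn s a j l ne)) (cong (_∧ true) (pairOK-13 s a c))))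
          (cong₂ _∧_ (cong₂ _∧_ (pairOK-21 s a b) (trans (allᵇ-rowFilling-∷ʳ (λ q → pairOK q p1) 3 1 w c (λ j l ne → pairOK-31-otherColumn s a j l ne)) (cong (_∧ true) (pairOK-31 s a c))))
           (trans (allPairsOK-∷ p2 P)
             (cong₂ _∧_ (pairOK-refl 2 s b)
              (cong₂ _∧_ (trans (allᵇ-rowFilling-∷ʳ (pairOK p2) 3 1 w c (λ j l ne → pairOK-23-otherColumn s b j l ne)) (trans (cong (_∧ true) (pairOK-23 s b c)) (BP.∧-identityʳ _)))
               (cong₂ _∧_ (trans (allᵇ-rowFilling-∷ʳ (λ q → pairOK q p2) 3 1 w c (λ j l ne → pairOK-32-otherColumn s b j l ne)) (cong (_∧ true) (pairOK-32 s b c)))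
                 (trans (allPairsOK-row≡isRowWord 3 1 (w ++ [ c ])) (isRowWord-∷ʳ w c)))))))))
  (hookConditions-reduce (a <ᵇ columnBound b) _ _ _ (b <ᵇ columnBound c) _ (isRowWord w ∧ lastBelow (rowBound c) w) (columnRepeatsMarked a b c)))
  where
  s : ℕ
  s = length w + 1
  p1 : FilledBox
  p1 = ((1 , s) , a)
  p2 : FilledBox
  p2 = ((2 , s) , b)
  P : List FilledBox
  P = rowFilling 3 1 (w ++ [ c ])

ribbonBoxes-hook : ∀ m → ribbonBoxes (triangle (suc (suc (suc m))) 3) ≡
  (1 , m + 1) ∷ (2 , m + 1) ∷ applyUpTo (λ j → (3 , 1 + j)) (suc m)
ribbonBoxes-hook m = cong₂ _∷_ (cong (1 ,_) (trans (NP.+-identityʳ _) (NP.m+n∸n≡m (m + 1) 1)))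
  (cong₂ _∷_ (cong (2 ,_) (NP.+-identityʳ _))
    (trans (LP.++-identityʳ _) (trans (LP.map-upTo (λ j → (3 , 1 + j)) (m + 1))
      (cong (applyUpTo (λ j → (3 , 1 + j))) (NP.+-comm m 1)))))

isColumn : ℕ → ℕ → ℕ → Bool
isColumn a b c = (a <ᵇ columnBound b) ∧ (b <ᵇ columnBound c)

columnTopSum : (ℕ → ℚ) → ℕ → ℕ → ℚ
columnTopSum x K c = sumOver (upTo K) (λ a → sumOver (upTo K) (λ b → iverson (isColumn a b c) (x (letterValue a) *ℚ x (letterValue b))))

isHookFilling : ℕ → List ℕ → Bool
isHookFilling m (a ∷ b ∷ g) = allPairsOK (((1 , m + 1) , a) ∷ ((2 , m + 1) , b) ∷ rowFilling 3 1 g)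
isHookFilling m _ = false

isTableau-hook : ∀ m f → length f ≡ suc (suc (suc m)) → isTableau (ribbonBoxes (triangle (suc (suc (suc m))) 3)) f ≡ isHookFilling m f
isTableau-hook m (a ∷ b ∷ g) e = trans
  (cong (λ L → allPairsOK (zip L (a ∷ b ∷ g)))
    (trans (ribbonBoxes-hook m) (cong (λ k → (1 , m + 1) ∷ (2 , m + 1) ∷ applyUpTo (λ j → (3 , 1 + j)) k) (sym (NP.suc-injective (NP.suc-injective e))))))
  (cong (λ L → allPairsOK (((1 , m + 1) , a) ∷ ((2 , m + 1) , b) ∷ L)) (zip-columns≡rowFilling 3 1 g))

length-ribbonBoxes-hook : ∀ m → length (ribbonBoxes (triangle (suc (suc (suc m))) 3)) ≡ suc (suc (suc m))
length-ribbonBoxes-hook m = trans (cong length (ribbonBoxes-hook m)) (cong (λ k → suc (suc k)) (LP.length-applyUpTo (λ j → (3 , 1 + j)) (suc m)))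

hookTerm-split : (x : ℕ → ℚ) (m a b c : ℕ) (w : List ℕ) → length w ≡ m →
  iverson (isHookFilling m (a ∷ b ∷ w ++ [ c ])) (monomial x (a ∷ b ∷ w ++ [ c ]))
  ≡ (iverson (isColumn a b c) (x (letterValue a) *ℚ x (letterValue b)) *ℚ x (letterValue c)) *ℚ iverson (isRowWord w ∧ lastBelow (rowBound c) w) (monomial x w)
hookTerm-split x m a b c w refl rewrite allPairsOK-hook a b w c | monomial-∷ʳ x w c with isColumn a b c | isRowWord w ∧ lastBelow (rowBound c) w
... | true | true = solve 4 (λ A B W C → A :* (B :* (W :* C)) := (A :* B :* C) :* W) refl (x (letterValue a)) (x (letterValue b)) (monomial x w) (x (letterValue c))
... | true | false = sym (QP.*-zeroʳ ((x (letterValue a) *ℚ x (letterValue b)) *ℚ x (letterValue c)))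
... | false | R = sym (trans (cong (_*ℚ iverson R (monomial x w)) (QP.*-zeroˡ (x (letterValue c)))) (QP.*-zeroˡ (iverson R (monomial x w))))

sumOver-allFillings-hookShape : (m K : ℕ) (F : List ℕ → ℚ) → sumOver (allFillings (suc (suc (suc m))) K) F
  ≡ sumOver (upTo K) (λ a → sumOver (upTo K) (λ b → sumOver (allFillings m K) (λ w → sumOver (upTo K) (λ c → F (a ∷ b ∷ w ++ [ c ])))))
sumOver-allFillings-hookShape m K F = begin
  sumOver (allFillings (suc (suc (suc m))) K) F
    ≡⟨ sumOver-allFillings-∷ (suc (suc m)) K F ⟩
  sumOver (upTo K) (λ a → sumOver (allFillings (suc (suc m)) K) (λ f → F (a ∷ f)))
    ≡⟨ sumOver-cong (upTo K) (λ a → sumOver-allFillings-∷ (suc m) K (λ f → F (a ∷ f))) ⟩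
  sumOver (upTo K) (λ a → sumOver (upTo K) (λ b → sumOver (allFillings (suc m) K) (λ g → F (a ∷ b ∷ g))))
    ≡⟨ sumOver-cong (upTo K) (λ a → sumOver-cong (upTo K) (λ b → sumOver-allFillings-∷ʳ m K (λ g → F (a ∷ b ∷ g)))) ⟩
  sumOver (upTo K) (λ a → sumOver (upTo K) (λ b → sumOver (allFillings m K) (λ w → sumOver (upTo K) (λ c → F (a ∷ b ∷ w ++ [ c ]))))) ∎

*-distribʳ-sumOver² : {A B : Set} (L : List A) (M : List B) (I : A → B → ℚ) (y : ℚ) →
  sumOver L (λ a → sumOver M (I a)) *ℚ y ≡ sumOver L (λ a → sumOver M (λ b → I a b *ℚ y))
*-distribʳ-sumOver² L M I y = trans (*-distribʳ-sumOver y L _) (sumOver-cong L (λ a → *-distribʳ-sumOver y M (I a)))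

rEval-hook-columnTopSum : (m N : ℕ) (x : ℕ → ℚ) → rEval (triangle (suc (suc (suc m))) 3) N x ≡
  sumBelow (2 * N) (λ c → (columnTopSum x (2 * N) c *ℚ x (letterValue c)) *ℚ rowPoly x m (rowBound c))
rEval-hook-columnTopSum m N x = begin
  rEval (triangle (suc (suc (suc m))) 3) N x ≡⟨ rEval≡sumOver-allFillings (triangle (suc (suc (suc m))) 3) N x ⟩
  sumOver (allFillings (length HB) K) (λ f → iverson (isTableau HB f) (monomial x f))
    ≡⟨ sumOver-tableaux-cong x K HB (suc (suc (suc m))) (isHookFilling m) (length-ribbonBoxes-hook m) (isTableau-hook m) ⟩
  sumOver (allFillings (suc (suc (suc m))) K) F ≡⟨ sumOver-allFillings-hookShape m K F ⟩
  sumOver (upTo K) (λ a → sumOver (upTo K) (λ b → sumOver (allFillings m K) (λ w → sumOver (upTo K) (λ c → F (a ∷ b ∷ w ++ [ c ])))))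
    ≡⟨ sumOver-cong (upTo K) (λ a → sumOver-cong (upTo K) (λ b → sumOver-allFillings-cong m K (λ w e → sumOver-cong (upTo K) (λ c → hookTerm-split x m a b c w e)))) ⟩
  sumOver (upTo K) (λ a → sumOver (upTo K) (λ b → sumOver (allFillings m K) (λ w → sumOver (upTo K) (λ c → P a b c *ℚ Q c w))))
    ≡⟨ sumOver-cong (upTo K) (λ a → sumOver-cong (upTo K) (λ b → sumOver-swap (allFillings m K) (upTo K) (λ w c → P a b c *ℚ Q c w))) ⟩
  sumOver (upTo K) (λ a → sumOver (upTo K) (λ b → sumOver (upTo K) (λ c → sumOver (allFillings m K) (λ w → P a b c *ℚ Q c w))))
    ≡⟨ sumOver-cong (upTo K) (λ a → sumOver-cong (upTo K) (λ b → sumOver-cong (upTo K) (λ c → sym (*-distribˡ-sumOver (P a b c) (allFillings m K) (Q c))))) ⟩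
  sumOver (upTo K) (λ a → sumOver (upTo K) (λ b → sumOver (upTo K) (λ c → P a b c *ℚ B c)))
    ≡⟨ trans (sumOver-cong (upTo K) (λ a → sumOver-swap (upTo K) (upTo K) (λ b c → P a b c *ℚ B c))) (sumOver-swap (upTo K) (upTo K) _) ⟩
  sumOver (upTo K) (λ c → sumOver (upTo K) (λ a → sumOver (upTo K) (λ b → P a b c *ℚ B c)))
    ≡⟨ sumOver-cong (upTo K) (λ c → sym (*-distribʳ-sumOver² (upTo K) (upTo K) (λ a b → P a b c) (B c))) ⟩
  sumOver (upTo K) (λ c → sumOver (upTo K) (λ a → sumOver (upTo K) (λ b → P a b c)) *ℚ B c)
    ≡⟨ sumOver-cong (upTo K) (λ c → cong (_*ℚ B c) (sym (*-distribʳ-sumOver² (upTo K) (upTo K) (λ a b → I a b c) (x (letterValue c))))) ⟩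
  sumOver (upTo K) (λ c → (columnTopSum x K c *ℚ x (letterValue c)) *ℚ B c) ≡⟨ sumOver-upTo K _ ⟩
  sumBelow K (λ c → (columnTopSum x K c *ℚ x (letterValue c)) *ℚ B c)
    ≡⟨ sumBelow-cong< K (λ c lt → cong ((columnTopSum x K c *ℚ x (letterValue c)) *ℚ_) (sumOver-rowWords-lastBelow x K m (rowBound c) (NP.≤-trans (rowBound≤1+ c) lt))) ⟩
  sumBelow K (λ c → (columnTopSum x K c *ℚ x (letterValue c)) *ℚ rowPoly x m (rowBound c)) ∎
  where
  K : ℕ
  K = 2 * N
  HB : List (ℕ × ℕ)
  HB = ribbonBoxes (triangle (suc (suc (suc m))) 3)
  F : List ℕ → ℚ
  F f = iverson (isHookFilling m f) (monomial x f)
  I : ℕ → ℕ → ℕ → ℚ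
  I a b c = iverson (isColumn a b c) (x (letterValue a) *ℚ x (letterValue b))
  P : ℕ → ℕ → ℕ → ℚ
  P a b c = I a b c *ℚ x (letterValue c)
  Q : ℕ → List ℕ → ℚ
  Q c w = iverson (isRowWord w ∧ lastBelow (rowBound c) w) (monomial x w)
  B : ℕ → ℚ
  B c = sumOver (allFillings m K) (Q c)

-- Newton recurrences

newtonSum : (ℕ → ℚ) → (ℕ → ℚ) → ℕ → ℚ
newtonSum β a n = sumBelow n (λ i → β (suc i) *ℚ a (n ∸ suc i))

NewtonRecurrence : (ℕ → ℚ) → (ℕ → ℚ) → Set
NewtonRecurrence β a = ∀ n → fromℕ n *ℚ a n ≡ newtonSum β a n

convBy : ℕ → (ℕ → ℚ) → (ℕ → ℚ) → ℕ → ℚ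
convBy k f a n = sumBelow (suc n) (λ m → iverson (m * k ≤ᵇ n) (f m *ℚ a (n ∸ m * k)))

sumBelow-multiples-truncate : (k' M n' : ℕ) (g : ℕ → ℚ) → suc n' ≤ M →
  sumBelow M (λ m → iverson (m * suc k' ≤ᵇ n') (g m)) ≡ sumBelow (suc n') (λ m → iverson (m * suc k' ≤ᵇ n') (g m))
sumBelow-multiples-truncate k' M n' g le = sumBelow-extend≤ (suc n') M _ (λ i hi → cong (λ b → iverson b (g i)) (>⇒≤ᵇ≡false (i * suc k') n' (NP.<-≤-trans hi (NP.m≤m*n i (suc k'))))) le

sumBelow-newtonSum-convBy : (k' : ℕ) (f a β : ℕ → ℚ) (n : ℕ) →
  sumBelow (suc n) (λ m → iverson (m * suc k' ≤ᵇ n) (f m *ℚ newtonSum β a (n ∸ m * suc k'))) ≡ newtonSum β (convBy (suc k') f a) n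
sumBelow-newtonSum-convBy k' f a β n = begin
  sumBelow (suc n) (λ m → iverson (m * k ≤ᵇ n) (f m *ℚ newtonSum β a (n ∸ m * k)))
    ≡⟨ sumBelow-cong (suc n) expandNewtonSum ⟩
  sumBelow (suc n) (λ m → sumBelow n (λ i → iverson ((m * k ≤ᵇ n) ∧ (i <ᵇ n ∸ m * k)) (f m *ℚ (β (suc i) *ℚ a (n ∸ m * k ∸ suc i)))))
    ≡⟨ sumBelow-swap (suc n) n (λ m i → iverson ((m * k ≤ᵇ n) ∧ (i <ᵇ n ∸ m * k)) (f m *ℚ (β (suc i) *ℚ a (n ∸ m * k ∸ suc i)))) ⟩
  sumBelow n (λ i → sumBelow (suc n) (λ m → iverson ((m * k ≤ᵇ n) ∧ (i <ᵇ n ∸ m * k)) (f m *ℚ (β (suc i) *ℚ a (n ∸ m * k ∸ suc i)))))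
    ≡⟨ sumBelow-cong< n collectConvBy ⟩
  newtonSum β (convBy k f a) n ∎
  where
  k : ℕ
  k = suc k'
  expandNewtonSum : ∀ m → iverson (m * k ≤ᵇ n) (f m *ℚ newtonSum β a (n ∸ m * k))
    ≡ sumBelow n (λ i → iverson ((m * k ≤ᵇ n) ∧ (i <ᵇ n ∸ m * k)) (f m *ℚ (β (suc i) *ℚ a (n ∸ m * k ∸ suc i))))
  expandNewtonSum m = begin
    iverson b (f m *ℚ newtonSum β a (n ∸ m * k)) ≡⟨ cong (iverson b) (*-distribˡ-sumBelow (f m) (n ∸ m * k) _) ⟩
    iverson b (sumBelow (n ∸ m * k) (λ i → f m *ℚ (β (suc i) *ℚ a (n ∸ m * k ∸ suc i))))
      ≡⟨ cong (iverson b) (sym (sumBelow-truncate (n ∸ m * k) n _ (NP.m∸n≤m n (m * k)))) ⟩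
    iverson b (sumBelow n (λ i → iverson (i <ᵇ n ∸ m * k) (f m *ℚ (β (suc i) *ℚ a (n ∸ m * k ∸ suc i)))))
      ≡⟨ iverson-sumBelow b n _ ⟩
    sumBelow n (λ i → iverson b (iverson (i <ᵇ n ∸ m * k) (f m *ℚ (β (suc i) *ℚ a (n ∸ m * k ∸ suc i)))))
      ≡⟨ sumBelow-cong n (λ i → iverson-iverson b (i <ᵇ n ∸ m * k) _) ⟩
    sumBelow n (λ i → iverson (b ∧ (i <ᵇ n ∸ m * k)) (f m *ℚ (β (suc i) *ℚ a (n ∸ m * k ∸ suc i)))) ∎
    where
    b : Bool
    b = m * k ≤ᵇ n
  collectConvBy : ∀ i → i < n → sumBelow (suc n) (λ m → iverson ((m * k ≤ᵇ n) ∧ (i <ᵇ n ∸ m * k)) (f m *ℚ (β (suc i) *ℚ a (n ∸ m * k ∸ suc i))))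
                          ≡ β (suc i) *ℚ convBy k f a (n ∸ suc i)
  collectConvBy i lt = begin
    sumBelow (suc n) (λ m → iverson ((m * k ≤ᵇ n) ∧ (i <ᵇ n ∸ m * k)) (f m *ℚ (β (suc i) *ℚ a (n ∸ m * k ∸ suc i))))
      ≡⟨ sumBelow-cong (suc n) (λ m → cong₂ iverson (≤ᵇ∧<ᵇ∸≡≤ᵇ∸suc n i (m * k) lt)
            (trans (solve 3 (λ F B A → F :* (B :* A) := B :* (F :* A)) refl (f m) (β (suc i)) (a (n ∸ m * k ∸ suc i)))
                   (cong (λ z → β (suc i) *ℚ (f m *ℚ a z)) (∸-swap m)))) ⟩
    sumBelow (suc n) (λ m → iverson (m * k ≤ᵇ n ∸ suc i) (β (suc i) *ℚ (f m *ℚ a (n ∸ suc i ∸ m * k))))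
      ≡⟨ sumBelow-cong (suc n) (λ m → sym (iverson-*ˡ (m * k ≤ᵇ n ∸ suc i) (β (suc i)) (f m *ℚ a (n ∸ suc i ∸ m * k)))) ⟩
    sumBelow (suc n) (λ m → β (suc i) *ℚ iverson (m * k ≤ᵇ n ∸ suc i) (f m *ℚ a (n ∸ suc i ∸ m * k)))
      ≡⟨ sym (*-distribˡ-sumBelow (β (suc i)) (suc n) (λ m → iverson (m * k ≤ᵇ n ∸ suc i) (f m *ℚ a (n ∸ suc i ∸ m * k)))) ⟩
    β (suc i) *ℚ sumBelow (suc n) (λ m → iverson (m * k ≤ᵇ n ∸ suc i) (f m *ℚ a (n ∸ suc i ∸ m * k)))
      ≡⟨ cong (β (suc i) *ℚ_) (sumBelow-multiples-truncate k' (suc n) (n ∸ suc i) (λ m → f m *ℚ a (n ∸ suc i ∸ m * k)) (s≤s (NP.m∸n≤m n (suc i)))) ⟩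
    β (suc i) *ℚ convBy k f a (n ∸ suc i) ∎
    where
    ∸-swap : ∀ m → n ∸ m * k ∸ suc i ≡ n ∸ suc i ∸ m * k
    ∸-swap m = trans (NP.∸-+-assoc n (m * k) (suc i)) (trans (cong (n ∸_) (NP.+-comm (m * k) (suc i))) (sym (NP.∸-+-assoc n (suc i) (m * k))))

sumBelow-shifted-convBy : (k' : ℕ) (f a : ℕ → ℚ) (d : ℚ) (n s : ℕ) →
  sumBelow (n ∸ s) (λ j → iverson ((suc s + j) * suc k' ≤ᵇ n) ((d *ℚ f (suc s + j ∸ suc s)) *ℚ a (n ∸ (suc s + j) * suc k')))
  ≡ iverson (suc s * suc k' ≤ᵇ n) (d *ℚ convBy (suc k') f a (n ∸ suc s * suc k'))
sumBelow-shifted-convBy k' f a d n s with suc s * suc k' ≤? n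
... | yes le = begin
  sumBelow (n ∸ s) (λ j → iverson ((suc s + j) * k ≤ᵇ n) ((d *ℚ f (suc s + j ∸ suc s)) *ℚ a (n ∸ (suc s + j) * k)))
    ≡⟨ sumBelow-cong (n ∸ s) shiftTerm ⟩
  sumBelow (n ∸ s) (λ j → d *ℚ iverson (j * k ≤ᵇ n') (f j *ℚ a (n' ∸ j * k)))
    ≡⟨ sym (*-distribˡ-sumBelow d (n ∸ s) (λ j → iverson (j * k ≤ᵇ n') (f j *ℚ a (n' ∸ j * k)))) ⟩
  d *ℚ sumBelow (n ∸ s) (λ j → iverson (j * k ≤ᵇ n') (f j *ℚ a (n' ∸ j * k)))
    ≡⟨ cong (d *ℚ_) (sumBelow-multiples-truncate k' (n ∸ s) n' (λ j → f j *ℚ a (n' ∸ j * k)) range) ⟩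
  d *ℚ convBy k f a n'
    ≡⟨ sym (cong (λ b → iverson b (d *ℚ convBy k f a n')) (≤⇒≤ᵇ≡true (suc s * k) n le)) ⟩
  iverson (suc s * k ≤ᵇ n) (d *ℚ convBy k f a n') ∎
  where
  k : ℕ
  k = suc k'
  S : ℕ
  S = suc s * k
  n' : ℕ
  n' = n ∸ S
  s<n : s < n
  s<n = NP.<-≤-trans (NP.≤-trans (NP.n<1+n s) (NP.m≤m*n (suc s) k)) le
  range : suc n' ≤ n ∸ s
  range = subst (suc n' ≤_) (sym (NP.+-∸-assoc 1 s<n)) (s≤s (NP.∸-monoʳ-≤ n (NP.m≤m*n (suc s) k)))
  shiftTerm : ∀ j → iverson ((suc s + j) * k ≤ᵇ n) ((d *ℚ f (suc s + j ∸ suc s)) *ℚ a (n ∸ (suc s + j) * k))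
                    ≡ d *ℚ iverson (j * k ≤ᵇ n') (f j *ℚ a (n' ∸ j * k))
  shiftTerm j = begin
    iverson ((suc s + j) * k ≤ᵇ n) ((d *ℚ f (suc s + j ∸ suc s)) *ℚ a (n ∸ (suc s + j) * k))
      ≡⟨ cong₂ (λ u v → iverson (u ≤ᵇ n) ((d *ℚ f (suc s + j ∸ suc s)) *ℚ a (n ∸ v))) (NP.*-distribʳ-+ k (suc s) j) (NP.*-distribʳ-+ k (suc s) j) ⟩
    iverson (S + j * k ≤ᵇ n) ((d *ℚ f (suc s + j ∸ suc s)) *ℚ a (n ∸ (S + j * k)))
      ≡⟨ cong₂ (λ u v → iverson u ((d *ℚ f v) *ℚ a (n ∸ (S + j * k)))) (+≤ᵇ≡≤ᵇ∸ n S (j * k) le) (NP.m+n∸m≡n (suc s) j) ⟩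
    iverson (j * k ≤ᵇ n') ((d *ℚ f j) *ℚ a (n ∸ (S + j * k)))
      ≡⟨ cong (λ v → iverson (j * k ≤ᵇ n') ((d *ℚ f j) *ℚ a v)) (sym (NP.∸-+-assoc n S (j * k))) ⟩
    iverson (j * k ≤ᵇ n') ((d *ℚ f j) *ℚ a (n' ∸ j * k))
      ≡⟨ cong (iverson (j * k ≤ᵇ n')) (QP.*-assoc d (f j) (a (n' ∸ j * k))) ⟩
    iverson (j * k ≤ᵇ n') (d *ℚ (f j *ℚ a (n' ∸ j * k)))
      ≡⟨ sym (iverson-*ˡ (j * k ≤ᵇ n') d (f j *ℚ a (n' ∸ j * k))) ⟩
    d *ℚ iverson (j * k ≤ᵇ n') (f j *ℚ a (n' ∸ j * k)) ∎
... | no nle = trans (sumBelow-cong (n ∸ s) (λ j → cong (λ b → iverson b ((d *ℚ f (suc s + j ∸ suc s)) *ℚ a (n ∸ (suc s + j) * suc k')))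
                       (>⇒≤ᵇ≡false ((suc s + j) * suc k') n (NP.<-≤-trans (NP.≰⇒> nle) (NP.*-monoˡ-≤ (suc k') (NP.m≤m+n (suc s) j))))))
                 (trans (sumBelow-0 (n ∸ s)) (sym (cong (λ b → iverson b (d *ℚ convBy (suc k') f a (n ∸ suc s * suc k'))) (>⇒≤ᵇ≡false (suc s * suc k') n (NP.≰⇒> nle)))))

sumBelow-shiftedNewton-convBy : (k' : ℕ) (f a δ : ℕ → ℚ) (n : ℕ) →
  sumBelow (suc n) (λ m → iverson (m * suc k' ≤ᵇ n) (sumBelow m (λ s → δ (suc s) *ℚ f (m ∸ suc s)) *ℚ a (n ∸ m * suc k')))
  ≡ sumBelow (suc n) (λ s → iverson (suc s * suc k' ≤ᵇ n) (δ (suc s) *ℚ convBy (suc k') f a (n ∸ suc s * suc k')))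
sumBelow-shiftedNewton-convBy k' f a δ n = begin
  sumBelow (suc n) (λ m → iverson (m * k ≤ᵇ n) (sumBelow m (λ s → δ (suc s) *ℚ f (m ∸ suc s)) *ℚ a (n ∸ m * k)))
    ≡⟨ sumBelow-cong< (suc n) expandInner ⟩
  sumBelow (suc n) (λ m → sumBelow (suc n) (λ s → iverson (s <ᵇ m) (H s m)))
    ≡⟨ sumBelow-swap (suc n) (suc n) (λ m s → iverson (s <ᵇ m) (H s m)) ⟩
  sumBelow (suc n) (λ s → sumBelow (suc n) (λ m → iverson (s <ᵇ m) (H s m)))
    ≡⟨ sumBelow-cong (suc n) (λ s → sumBelow-drop (suc n) s (H s)) ⟩
  sumBelow (suc n) (λ s → sumBelow (n ∸ s) (λ j → H s (suc s + j)))
    ≡⟨ sumBelow-cong (suc n) (λ s → sumBelow-shifted-convBy k' f a (δ (suc s)) n s) ⟩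
  sumBelow (suc n) (λ s → iverson (suc s * k ≤ᵇ n) (δ (suc s) *ℚ convBy k f a (n ∸ suc s * k))) ∎
  where
  k : ℕ
  k = suc k'
  H : ℕ → ℕ → ℚ
  H s m = iverson (m * k ≤ᵇ n) ((δ (suc s) *ℚ f (m ∸ suc s)) *ℚ a (n ∸ m * k))
  expandInner : ∀ m → m < suc n → iverson (m * k ≤ᵇ n) (sumBelow m (λ s → δ (suc s) *ℚ f (m ∸ suc s)) *ℚ a (n ∸ m * k))
                              ≡ sumBelow (suc n) (λ s → iverson (s <ᵇ m) (H s m))
  expandInner m lt = begin
    iverson b (sumBelow m (λ s → δ (suc s) *ℚ f (m ∸ suc s)) *ℚ A)
      ≡⟨ cong (iverson b) (*-distribʳ-sumBelow A m (λ s → δ (suc s) *ℚ f (m ∸ suc s))) ⟩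
    iverson b (sumBelow m (λ s → (δ (suc s) *ℚ f (m ∸ suc s)) *ℚ A))
      ≡⟨ cong (iverson b) (sym (sumBelow-truncate m (suc n) (λ s → (δ (suc s) *ℚ f (m ∸ suc s)) *ℚ A) (NP.<⇒≤ lt))) ⟩
    iverson b (sumBelow (suc n) (λ s → iverson (s <ᵇ m) ((δ (suc s) *ℚ f (m ∸ suc s)) *ℚ A)))
      ≡⟨ iverson-sumBelow b (suc n) (λ s → iverson (s <ᵇ m) ((δ (suc s) *ℚ f (m ∸ suc s)) *ℚ A)) ⟩
    sumBelow (suc n) (λ s → iverson b (iverson (s <ᵇ m) ((δ (suc s) *ℚ f (m ∸ suc s)) *ℚ A)))
      ≡⟨ sumBelow-cong (suc n) (λ s → iverson-comm b (s <ᵇ m) ((δ (suc s) *ℚ f (m ∸ suc s)) *ℚ A)) ⟩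
    sumBelow (suc n) (λ s → iverson (s <ᵇ m) (H s m)) ∎
    where
    b : Bool
    b = m * k ≤ᵇ n
    A : ℚ
    A = a (n ∸ m * k)

-- The logarithmic derivative of a product: convolving a with the k-dilation of f adds the
-- k-dilated Newton weights of f to those of a.
newton-convBy : (k' : ℕ) (f a β δ : ℕ → ℚ) → NewtonRecurrence β a →
  (∀ m → fromℕ (m * suc k') *ℚ f m ≡ sumBelow m (λ s → δ (suc s) *ℚ f (m ∸ suc s))) →
  ∀ n → fromℕ n *ℚ convBy (suc k') f a n ≡
        sumBelow (suc n) (λ s → iverson (suc s * suc k' ≤ᵇ n) (δ (suc s) *ℚ convBy (suc k') f a (n ∸ suc s * suc k')))
        +ℚ newtonSum β (convBy (suc k') f a) n
newton-convBy k' f a β δ newton-a newton-f n = begin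
  fromℕ n *ℚ convBy k f a n ≡⟨ *-distribˡ-sumBelow (fromℕ n) (suc n) (λ m → iverson (m * k ≤ᵇ n) (f m *ℚ a (n ∸ m * k))) ⟩
  sumBelow (suc n) (λ m → fromℕ n *ℚ iverson (m * k ≤ᵇ n) (f m *ℚ a (n ∸ m * k)))
    ≡⟨ sumBelow-cong (suc n) splitWeight ⟩
  sumBelow (suc n) (λ m → iverson (m * k ≤ᵇ n) (sumBelow m (λ s → δ (suc s) *ℚ f (m ∸ suc s)) *ℚ a (n ∸ m * k))
                   +ℚ iverson (m * k ≤ᵇ n) (f m *ℚ newtonSum β a (n ∸ m * k)))
    ≡⟨ sumBelow-+ (suc n) (λ m → iverson (m * k ≤ᵇ n) (sumBelow m (λ s → δ (suc s) *ℚ f (m ∸ suc s)) *ℚ a (n ∸ m * k)))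
                      (λ m → iverson (m * k ≤ᵇ n) (f m *ℚ newtonSum β a (n ∸ m * k))) ⟩
  _ ≡⟨ cong₂ _+ℚ_ (sumBelow-shiftedNewton-convBy k' f a δ n) (sumBelow-newtonSum-convBy k' f a β n) ⟩
  _ ∎
  where
  k : ℕ
  k = suc k'
  splitWeight : ∀ m → fromℕ n *ℚ iverson (m * k ≤ᵇ n) (f m *ℚ a (n ∸ m * k)) ≡
             iverson (m * k ≤ᵇ n) (sumBelow m (λ s → δ (suc s) *ℚ f (m ∸ suc s)) *ℚ a (n ∸ m * k))
             +ℚ iverson (m * k ≤ᵇ n) (f m *ℚ newtonSum β a (n ∸ m * k))
  splitWeight m with m * k ≤? n
  ... | yes le rewrite ≤⇒≤ᵇ≡true (m * k) n le = begin
    fromℕ n *ℚ (f m *ℚ A) ≡⟨ cong (λ z → fromℕ z *ℚ (f m *ℚ A)) (sym (NP.m+[n∸m]≡n le)) ⟩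
    fromℕ (M + (n ∸ M)) *ℚ (f m *ℚ A) ≡⟨ cong (_*ℚ (f m *ℚ A)) (fromℕ-+ M (n ∸ M)) ⟩
    (fromℕ M +ℚ fromℕ (n ∸ M)) *ℚ (f m *ℚ A)
      ≡⟨ solve 4 (λ X Y F Aa → (X :+ Y) :* (F :* Aa) := (X :* F) :* Aa :+ F :* (Y :* Aa)) refl (fromℕ M) (fromℕ (n ∸ M)) (f m) A ⟩
    (fromℕ M *ℚ f m) *ℚ A +ℚ f m *ℚ (fromℕ (n ∸ M) *ℚ A)
      ≡⟨ cong₂ (λ u v → u *ℚ A +ℚ f m *ℚ v) (newton-f m) (newton-a (n ∸ M)) ⟩
    sumBelow m (λ s → δ (suc s) *ℚ f (m ∸ suc s)) *ℚ A +ℚ f m *ℚ newtonSum β a (n ∸ M) ∎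
    where
    M : ℕ
    M = m * k
    A : ℚ
    A = a (n ∸ M)
  ... | no nle rewrite >⇒≤ᵇ≡false (m * k) n (NP.≰⇒> nle) = QP.*-zeroʳ (fromℕ n)

newton-unique : (β β' a b : ℕ → ℚ) (K : ℕ) → NewtonRecurrence β a → NewtonRecurrence β' b → a 0 ≡ b 0 →
  (∀ r → r ≤ K → β r ≡ β' r) → ∀ n → n ≤ K → a n ≡ b n
newton-unique β β' a b K newton-a newton-b e0 eβ n nK = below n n NP.≤-refl nK
  where
  below : ∀ n j → j ≤ n → j ≤ K → a j ≡ b j
  below n zero jn jK = e0
  below zero (suc j) () jK
  below (suc n) (suc j) jn jK = *-cancelˡ-fromℕ-suc j (a (suc j)) (b (suc j))
    (trans (newton-a (suc j)) (trans (sumBelow-cong< (suc j) (λ i lt →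
       cong₂ _*ℚ_ (eβ (suc i) (NP.≤-trans lt jK))
                  (below n (j ∸ i) (NP.≤-trans (NP.m∸n≤m j i) (NP.≤-pred jn)) (NP.≤-trans (NP.m∸n≤m j i) (NP.≤-trans (NP.n≤1+n j) jK)))))
     (sym (newton-b (suc j)))))

newtonSum-+ : (β γ a : ℕ → ℚ) (n : ℕ) → newtonSum (λ r → β r +ℚ γ r) a n ≡ newtonSum β a n +ℚ newtonSum γ a n
newtonSum-+ β γ a n = trans (sumBelow-cong n (λ i → QP.*-distribʳ-+ (a (n ∸ suc i)) (β (suc i)) (γ (suc i))))
                       (sumBelow-+ n (λ i → β (suc i) *ℚ a (n ∸ suc i)) (λ i → γ (suc i) *ℚ a (n ∸ suc i)))

newtonSum-congˡ : (β γ a : ℕ → ℚ) (n : ℕ) → (∀ r → β r ≡ γ r) → newtonSum β a n ≡ newtonSum γ a n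
newtonSum-congˡ β γ a n e = sumBelow-cong n (λ i → cong (_*ℚ a (n ∸ suc i)) (e (suc i)))

-- The one-row sums

two : ℚ
two = 1ℚ +ℚ 1ℚ

double-suc : ∀ v → 2 * suc v ≡ suc (suc (2 * v))
double-suc v = NP.*-suc 2 v

letterValue-2* : ∀ v → letterValue (2 * v) ≡ v
letterValue-2* zero = refl
letterValue-2* (suc v) = trans (cong letterValue (double-suc v)) (trans (DM.m/n≡1+[m∸n]/n {suc (suc (2 * v))} {2} (s≤s (s≤s z≤n))) (cong suc (letterValue-2* v)))

letterValue-1+2* : ∀ v → letterValue (suc (2 * v)) ≡ v
letterValue-1+2* zero = refl
letterValue-1+2* (suc v) = trans (cong (λ z → letterValue (suc z)) (double-suc v)) (trans (DM.m/n≡1+[m∸n]/n {suc (suc (suc (2 * v)))} {2} (s≤s (s≤s z≤n))) (cong suc (letterValue-1+2* v)))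

isMarked-2* : ∀ v → isMarked (2 * v) ≡ true
isMarked-2* zero = refl
isMarked-2* (suc v) = trans (cong isMarked (double-suc v)) (isMarked-2* v)

isMarked-1+2* : ∀ v → isMarked (suc (2 * v)) ≡ false
isMarked-1+2* zero = refl
isMarked-1+2* (suc v) = trans (cong (λ z → isMarked (suc z)) (double-suc v)) (isMarked-1+2* v)

-- q_m in the variables x 0, …, x (v - 1): the codes below 2 v are the letters 1', 1, …, v', v.
rowSum : (ℕ → ℚ) → ℕ → ℕ → ℚ
rowSum x v m = rowPoly x m (2 * v)

rowSum-suc-suc : ∀ x v m → rowSum x (suc v) (suc m) ≡ rowSum x v (suc m) +ℚ x v *ℚ rowSum x v m +ℚ x v *ℚ rowSum x (suc v) m
rowSum-suc-suc x v m = begin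
  sumBelow (2 * suc v) g ≡⟨ cong (λ z → sumBelow z g) (double-suc v) ⟩
  sumBelow (suc (suc (2 * v))) g ≡⟨ sumBelow-suc (suc (2 * v)) g ⟩
  sumBelow (suc (2 * v)) g +ℚ g (suc (2 * v)) ≡⟨ cong (_+ℚ g (suc (2 * v))) (sumBelow-suc (2 * v) g) ⟩
  sumBelow (2 * v) g +ℚ g (2 * v) +ℚ g (suc (2 * v)) ≡⟨ cong₂ (λ u w → sumBelow (2 * v) g +ℚ u +ℚ w) markedTerm unmarkedTerm ⟩
  rowSum x v (suc m) +ℚ x v *ℚ rowSum x v m +ℚ x v *ℚ rowSum x (suc v) m ∎
  where
  g : ℕ → ℚ
  g c = x (letterValue c) *ℚ rowPoly x m (rowBound c)
  markedTerm : g (2 * v) ≡ x v *ℚ rowSum x v m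
  markedTerm rewrite letterValue-2* v | isMarked-2* v = refl
  unmarkedTerm : g (suc (2 * v)) ≡ x v *ℚ rowSum x (suc v) m
  unmarkedTerm rewrite letterValue-1+2* v | isMarked-1+2* v | double-suc v = refl

δ₀ : ℕ → ℚ
δ₀ zero = 1ℚ
δ₀ (suc m) = 0ℚ

-- The coefficients of (1 + y t)/(1 - y t).
rowSum₁ : ℚ → ℕ → ℚ
rowSum₁ y zero = 1ℚ
rowSum₁ y (suc m) = y *ℚ (rowSum₁ y m +ℚ δ₀ m)

conv : (ℕ → ℚ) → (ℕ → ℚ) → ℕ → ℚ
conv f a n = sumBelow (suc n) (λ m → f m *ℚ a (n ∸ m))

convBy-1 : ∀ f a n → convBy 1 f a n ≡ conv f a n
convBy-1 f a n = sumBelow-cong< (suc n) (λ m lt → trans (cong (λ z → iverson (z ≤ᵇ n) (f m *ℚ a (n ∸ z))) (NP.*-identityʳ m))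
                                        (cong (λ b → iverson b (f m *ℚ a (n ∸ m))) (≤⇒≤ᵇ≡true m n (NP.≤-pred lt))))

sumBelow-δ₀ : ∀ n (g : ℕ → ℚ) → sumBelow (suc n) (λ m → δ₀ m *ℚ g m) ≡ g 0
sumBelow-δ₀ n g = trans (cong₂ _+ℚ_ (QP.*-identityˡ (g 0)) (trans (sumBelow-cong n (λ m → QP.*-zeroˡ (g (suc m)))) (sumBelow-0 n))) (QP.+-identityʳ (g 0))

rowSum-suc : ∀ x v n → rowSum x (suc v) n ≡ conv (rowSum₁ (x v)) (rowSum x v) n
rowSum-suc x v zero = sym (QP.+-identityʳ _)
rowSum-suc x v (suc n) = begin
  rowSum x (suc v) (suc n) ≡⟨ rowSum-suc-suc x v n ⟩
  rowSum x v (suc n) +ℚ y *ℚ rowSum x v n +ℚ y *ℚ rowSum x (suc v) n ≡⟨ cong (λ z → rowSum x v (suc n) +ℚ y *ℚ rowSum x v n +ℚ y *ℚ z) (rowSum-suc x v n) ⟩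
  rowSum x v (suc n) +ℚ y *ℚ rowSum x v n +ℚ y *ℚ conv e (rowSum x v) n
    ≡⟨ solve 4 (λ a0 Y a1 C → a0 :+ Y :* a1 :+ Y :* C := con 1ℚ :* a0 :+ Y :* (C :+ a1)) refl (rowSum x v (suc n)) y (rowSum x v n) (conv e (rowSum x v) n) ⟩
  1ℚ *ℚ rowSum x v (suc n) +ℚ y *ℚ (conv e (rowSum x v) n +ℚ rowSum x v n)
    ≡⟨ cong (λ z → 1ℚ *ℚ rowSum x v (suc n) +ℚ y *ℚ (conv e (rowSum x v) n +ℚ z)) (sym (sumBelow-δ₀ n (λ m → rowSum x v (n ∸ m)))) ⟩
  1ℚ *ℚ rowSum x v (suc n) +ℚ y *ℚ (conv e (rowSum x v) n +ℚ sumBelow (suc n) (λ m → δ₀ m *ℚ rowSum x v (n ∸ m)))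
    ≡⟨ cong (λ z → 1ℚ *ℚ rowSum x v (suc n) +ℚ y *ℚ z) (sym (sumBelow-+ (suc n) (λ m → e m *ℚ rowSum x v (n ∸ m)) (λ m → δ₀ m *ℚ rowSum x v (n ∸ m)))) ⟩
  1ℚ *ℚ rowSum x v (suc n) +ℚ y *ℚ sumBelow (suc n) (λ m → e m *ℚ rowSum x v (n ∸ m) +ℚ δ₀ m *ℚ rowSum x v (n ∸ m))
    ≡⟨ cong (λ z → 1ℚ *ℚ rowSum x v (suc n) +ℚ z) (*-distribˡ-sumBelow y (suc n) (λ m → e m *ℚ rowSum x v (n ∸ m) +ℚ δ₀ m *ℚ rowSum x v (n ∸ m))) ⟩
  1ℚ *ℚ rowSum x v (suc n) +ℚ sumBelow (suc n) (λ m → y *ℚ (e m *ℚ rowSum x v (n ∸ m) +ℚ δ₀ m *ℚ rowSum x v (n ∸ m)))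
    ≡⟨ cong (λ z → 1ℚ *ℚ rowSum x v (suc n) +ℚ z) (sumBelow-cong (suc n) (λ m →
         solve 4 (λ Y E I Aa → Y :* (E :* Aa :+ I :* Aa) := Y :* (E :+ I) :* Aa) refl y (e m) (δ₀ m) (rowSum x v (n ∸ m)))) ⟩
  conv e (rowSum x v) (suc n) ∎
  where
  y : ℚ
  y = x v
  e : ℕ → ℚ
  e = rowSum₁ y

isOdd-suc : ∀ j → isOdd (suc j) ≡ not (isOdd j)
isOdd-suc zero = refl
isOdd-suc (suc zero) = refl
isOdd-suc (suc (suc j)) = isOdd-suc j

twiceOddPower : ℚ → ℕ → ℚ
twiceOddPower y r = iverson (isOdd r) (two *ℚ powℚ y r)

rowSum₁-suc : ∀ y j → rowSum₁ y (suc j) ≡ two *ℚ powℚ y (suc j)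
rowSum₁-suc y zero = solve 1 (λ Y → Y :* (con 1ℚ :+ con 1ℚ) := (con 1ℚ :+ con 1ℚ) :* (Y :* con 1ℚ)) refl y
rowSum₁-suc y (suc j) = trans (cong (λ z → y *ℚ (z +ℚ 0ℚ)) (rowSum₁-suc y j))
  (solve 2 (λ Y P → Y :* ((con 1ℚ :+ con 1ℚ) :* (Y :* P) :+ con 0ℚ) := (con 1ℚ :+ con 1ℚ) :* (Y :* (Y :* P))) refl y (powℚ y j))

rowSum₁-newton-step : ∀ y j → y *ℚ (rowSum₁ y j +ℚ fromℕ (suc j) *ℚ δ₀ j) ≡ y *ℚ twiceOddPower y j +ℚ twiceOddPower y (suc j)
rowSum₁-newton-step y zero = solve 1 (λ Y → Y :* (con 1ℚ :+ con 1ℚ :* con 1ℚ) := Y :* con 0ℚ :+ (con 1ℚ :+ con 1ℚ) :* (Y :* con 1ℚ)) refl y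
rowSum₁-newton-step y (suc j) rewrite rowSum₁-suc y j | isOdd-suc (suc j) with isOdd (suc j)
... | true = solve 3 (λ Y P F → Y :* ((con 1ℚ :+ con 1ℚ) :* (Y :* P) :+ F :* con 0ℚ) := Y :* ((con 1ℚ :+ con 1ℚ) :* (Y :* P)) :+ con 0ℚ) refl y (powℚ y j) (fromℕ (suc (suc j)))
... | false = solve 3 (λ Y P F → Y :* ((con 1ℚ :+ con 1ℚ) :* (Y :* P) :+ F :* con 0ℚ) := Y :* con 0ℚ :+ (con 1ℚ :+ con 1ℚ) :* (Y :* (Y :* P))) refl y (powℚ y j) (fromℕ (suc (suc j)))

sumBelow-twiceOddPower-δ₀ : ∀ y j → sumBelow j (λ s → twiceOddPower y (suc s) *ℚ δ₀ (j ∸ suc s)) ≡ twiceOddPower y j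
sumBelow-twiceOddPower-δ₀ y zero = refl
sumBelow-twiceOddPower-δ₀ y (suc j) = begin
  sumBelow (suc j) (λ s → twiceOddPower y (suc s) *ℚ δ₀ (suc j ∸ suc s)) ≡⟨ sumBelow-suc j _ ⟩
  sumBelow j (λ s → twiceOddPower y (suc s) *ℚ δ₀ (j ∸ s)) +ℚ twiceOddPower y (suc j) *ℚ δ₀ (j ∸ j)
    ≡⟨ cong₂ _+ℚ_ (trans (sumBelow-cong< j (λ s lt → trans (cong (λ z → twiceOddPower y (suc s) *ℚ δ₀ z) (NP.+-∸-assoc 1 lt)) (QP.*-zeroʳ (twiceOddPower y (suc s))))) (sumBelow-0 j))
                  (cong (λ z → twiceOddPower y (suc j) *ℚ δ₀ z) (NP.n∸n≡0 j)) ⟩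
  0ℚ +ℚ twiceOddPower y (suc j) *ℚ 1ℚ ≡⟨ trans (QP.+-identityˡ _) (QP.*-identityʳ _) ⟩
  twiceOddPower y (suc j) ∎

newtonSum-rowSum₁-suc : ∀ y j → newtonSum (twiceOddPower y) (rowSum₁ y) (suc j)
  ≡ y *ℚ newtonSum (twiceOddPower y) (rowSum₁ y) j +ℚ (y *ℚ twiceOddPower y j +ℚ twiceOddPower y (suc j))
newtonSum-rowSum₁-suc y j = begin
  sumBelow (suc j) (λ s → twiceOddPower y (suc s) *ℚ rowSum₁ y (j ∸ s)) ≡⟨ sumBelow-suc j _ ⟩
  sumBelow j (λ s → twiceOddPower y (suc s) *ℚ rowSum₁ y (j ∸ s)) +ℚ twiceOddPower y (suc j) *ℚ rowSum₁ y (j ∸ j)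
    ≡⟨ cong₂ _+ℚ_ (sumBelow-cong< j (λ s lt → cong (λ z → twiceOddPower y (suc s) *ℚ rowSum₁ y z) (NP.+-∸-assoc 1 lt)))
                  (cong (λ z → twiceOddPower y (suc j) *ℚ rowSum₁ y z) (NP.n∸n≡0 j)) ⟩
  sumBelow j (λ s → twiceOddPower y (suc s) *ℚ (y *ℚ (rowSum₁ y (j ∸ suc s) +ℚ δ₀ (j ∸ suc s)))) +ℚ twiceOddPower y (suc j) *ℚ 1ℚ
    ≡⟨ cong₂ _+ℚ_ (sumBelow-cong j (λ s → solve 4 (λ G Y E I → G :* (Y :* (E :+ I)) := Y :* (G :* E) :+ Y :* (G :* I)) refl (twiceOddPower y (suc s)) y (rowSum₁ y (j ∸ suc s)) (δ₀ (j ∸ suc s))))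
                  (QP.*-identityʳ _) ⟩
  sumBelow j (λ s → y *ℚ (twiceOddPower y (suc s) *ℚ rowSum₁ y (j ∸ suc s)) +ℚ y *ℚ (twiceOddPower y (suc s) *ℚ δ₀ (j ∸ suc s))) +ℚ twiceOddPower y (suc j)
    ≡⟨ cong (_+ℚ twiceOddPower y (suc j)) (sumBelow-+ j _ _) ⟩
  sumBelow j (λ s → y *ℚ (twiceOddPower y (suc s) *ℚ rowSum₁ y (j ∸ suc s))) +ℚ sumBelow j (λ s → y *ℚ (twiceOddPower y (suc s) *ℚ δ₀ (j ∸ suc s))) +ℚ twiceOddPower y (suc j)
    ≡⟨ cong₂ (λ u w → u +ℚ w +ℚ twiceOddPower y (suc j)) (sym (*-distribˡ-sumBelow y j _)) (trans (sym (*-distribˡ-sumBelow y j _)) (cong (y *ℚ_) (sumBelow-twiceOddPower-δ₀ y j))) ⟩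
  y *ℚ R j +ℚ y *ℚ twiceOddPower y j +ℚ twiceOddPower y (suc j) ≡⟨ QP.+-assoc (y *ℚ R j) _ _ ⟩
  y *ℚ R j +ℚ (y *ℚ twiceOddPower y j +ℚ twiceOddPower y (suc j)) ∎
  where
  R : ℕ → ℚ
  R = newtonSum (twiceOddPower y) (rowSum₁ y)

rowSum₁-newton : ∀ y → NewtonRecurrence (twiceOddPower y) (rowSum₁ y)
rowSum₁-newton y zero = refl
rowSum₁-newton y (suc j) = begin
  fromℕ (suc j) *ℚ (y *ℚ (rowSum₁ y j +ℚ δ₀ j)) ≡⟨ cong (_*ℚ (y *ℚ (rowSum₁ y j +ℚ δ₀ j))) (fromℕ-suc j) ⟩
  (1ℚ +ℚ fromℕ j) *ℚ (y *ℚ (rowSum₁ y j +ℚ δ₀ j))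
    ≡⟨ solve 4 (λ J Y E I → (con 1ℚ :+ J) :* (Y :* (E :+ I)) := Y :* (J :* E) :+ Y :* (E :+ (con 1ℚ :+ J) :* I)) refl (fromℕ j) y (rowSum₁ y j) (δ₀ j) ⟩
  y *ℚ (fromℕ j *ℚ rowSum₁ y j) +ℚ y *ℚ (rowSum₁ y j +ℚ (1ℚ +ℚ fromℕ j) *ℚ δ₀ j)
    ≡⟨ cong₂ (λ u w → y *ℚ u +ℚ y *ℚ (rowSum₁ y j +ℚ w *ℚ δ₀ j)) (rowSum₁-newton y j) (sym (fromℕ-suc j)) ⟩
  y *ℚ R j +ℚ y *ℚ (rowSum₁ y j +ℚ fromℕ (suc j) *ℚ δ₀ j) ≡⟨ cong (y *ℚ R j +ℚ_) (rowSum₁-newton-step y j) ⟩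
  y *ℚ R j +ℚ (y *ℚ twiceOddPower y j +ℚ twiceOddPower y (suc j)) ≡⟨ sym (newtonSum-rowSum₁-suc y j) ⟩
  R (suc j) ∎
  where
  R : ℕ → ℚ
  R = newtonSum (twiceOddPower y) (rowSum₁ y)

-- t ∂ₜ log ∏_{i < v} (1 + x_i t)/(1 - x_i t) = Σ_{r odd} 2 p_r t^r.
twiceOddPowerSum : (ℕ → ℚ) → ℕ → ℕ → ℚ
twiceOddPowerSum x v r = iverson (isOdd r) (two *ℚ sumBelow v (λ i → powℚ (x i) r))

newtonSum-congʳ : (β a b : ℕ → ℚ) (n : ℕ) → (∀ m → a m ≡ b m) → newtonSum β a n ≡ newtonSum β b n
newtonSum-congʳ β a b n e = sumBelow-cong n (λ i → cong (β (suc i) *ℚ_) (e (n ∸ suc i)))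

rowSum-newton : ∀ x v → NewtonRecurrence (twiceOddPowerSum x v) (rowSum x v)
rowSum-newton x zero zero = refl
rowSum-newton x zero (suc n) = trans (QP.*-zeroʳ (fromℕ (suc n))) (sym (trans (sumBelow-cong (suc n) (λ i → trans (cong (_*ℚ rowSum x 0 (n ∸ i)) (iverson-0 (isOdd (suc i)))) (QP.*-zeroˡ (rowSum x 0 (n ∸ i))))) (sumBelow-0 (suc n))))
rowSum-newton x (suc v) n = begin
  fromℕ n *ℚ rowSum x (suc v) n ≡⟨ cong (fromℕ n *ℚ_) (rowSum-suc≡c n) ⟩
  fromℕ n *ℚ c n ≡⟨ newton-convBy 0 e (rowSum x v) (twiceOddPowerSum x v) (twiceOddPower y) (rowSum-newton x v) (λ m → trans (cong (λ z → fromℕ z *ℚ rowSum₁ y m) (NP.*-identityʳ m)) (rowSum₁-newton y m)) n ⟩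
  sumBelow (suc n) (λ s → iverson (suc s * 1 ≤ᵇ n) (twiceOddPower y (suc s) *ℚ c (n ∸ suc s * 1))) +ℚ newtonSum (twiceOddPowerSum x v) c n
    ≡⟨ cong (_+ℚ newtonSum (twiceOddPowerSum x v) c n) shiftedSum ⟩
  newtonSum (twiceOddPower y) c n +ℚ newtonSum (twiceOddPowerSum x v) c n ≡⟨ sym (newtonSum-+ (twiceOddPower y) (twiceOddPowerSum x v) c n) ⟩
  newtonSum (λ r → twiceOddPower y r +ℚ twiceOddPowerSum x v r) c n ≡⟨ newtonSum-congˡ _ _ c n weights-suc ⟩
  newtonSum (twiceOddPowerSum x (suc v)) c n ≡⟨ newtonSum-congʳ (twiceOddPowerSum x (suc v)) c (rowSum x (suc v)) n (λ m → sym (rowSum-suc≡c m)) ⟩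
  newtonSum (twiceOddPowerSum x (suc v)) (rowSum x (suc v)) n ∎
  where
  y : ℚ
  y = x v
  e : ℕ → ℚ
  e = rowSum₁ y
  c : ℕ → ℚ
  c = convBy 1 e (rowSum x v)
  rowSum-suc≡c : ∀ m → rowSum x (suc v) m ≡ c m
  rowSum-suc≡c m = trans (rowSum-suc x v m) (sym (convBy-1 e (rowSum x v) m))
  shiftedSum : sumBelow (suc n) (λ s → iverson (suc s * 1 ≤ᵇ n) (twiceOddPower y (suc s) *ℚ c (n ∸ suc s * 1))) ≡ newtonSum (twiceOddPower y) c n
  shiftedSum = begin
    sumBelow (suc n) (λ s → iverson (suc s * 1 ≤ᵇ n) (twiceOddPower y (suc s) *ℚ c (n ∸ suc s * 1)))
      ≡⟨ sumBelow-cong (suc n) (λ s → cong (λ z → iverson (z ≤ᵇ n) (twiceOddPower y (suc s) *ℚ c (n ∸ z))) (NP.*-identityʳ (suc s))) ⟩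
    sumBelow (suc n) (λ s → iverson (suc s ≤ᵇ n) (twiceOddPower y (suc s) *ℚ c (n ∸ suc s))) ≡⟨ sumBelow-suc n _ ⟩
    sumBelow n (λ s → iverson (suc s ≤ᵇ n) (twiceOddPower y (suc s) *ℚ c (n ∸ suc s))) +ℚ iverson (suc n ≤ᵇ n) (twiceOddPower y (suc n) *ℚ c (n ∸ suc n))
      ≡⟨ cong₂ _+ℚ_ (sumBelow-cong< n (λ s lt → cong (λ b → iverson b (twiceOddPower y (suc s) *ℚ c (n ∸ suc s))) (≤⇒≤ᵇ≡true (suc s) n lt)))
                    (cong (λ b → iverson b (twiceOddPower y (suc n) *ℚ c (n ∸ suc n))) (>⇒≤ᵇ≡false (suc n) n NP.≤-refl)) ⟩
    newtonSum (twiceOddPower y) c n +ℚ 0ℚ ≡⟨ QP.+-identityʳ _ ⟩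
    newtonSum (twiceOddPower y) c n ∎
  weights-suc : ∀ r → twiceOddPower y r +ℚ twiceOddPowerSum x v r ≡ twiceOddPowerSum x (suc v) r
  weights-suc r with isOdd r
  ... | true = trans (solve 2 (λ P S → (con 1ℚ :+ con 1ℚ) :* P :+ (con 1ℚ :+ con 1ℚ) :* S := (con 1ℚ :+ con 1ℚ) :* (S :+ P)) refl (powℚ y r) (sumBelow v (λ i → powℚ (x i) r)))
                     (cong (two *ℚ_) (sym (sumBelow-suc v (λ i → powℚ (x i) r))))
  ... | false = refl

-- Summing over the column of the hook

codeSum : (ℕ → ℚ) → ℕ → ℚ
codeSum x h = sumBelow h (λ a → x (letterValue a))

columnPairSum : (ℕ → ℚ) → ℕ → ℚ
columnPairSum x h = sumBelow h (λ b → x (letterValue b) *ℚ codeSum x (columnBound b))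

columnTopSum≡columnPairSum : ∀ x K c → c < K → columnTopSum x K c ≡ columnPairSum x (columnBound c)
columnTopSum≡columnPairSum x K c lt = begin
  columnTopSum x K c ≡⟨ sumOver-cong (upTo K) (λ a → sumOver-upTo K _) ⟩
  sumOver (upTo K) (λ a → sumBelow K (λ b → iverson (isColumn a b c) (x (letterValue a) *ℚ x (letterValue b)))) ≡⟨ sumOver-upTo K _ ⟩
  sumBelow K (λ a → sumBelow K (λ b → iverson (isColumn a b c) (x (letterValue a) *ℚ x (letterValue b))))
    ≡⟨ sumBelow-swap K K _ ⟩
  sumBelow K (λ b → sumBelow K (λ a → iverson (isColumn a b c) (x (letterValue a) *ℚ x (letterValue b))))
    ≡⟨ sumBelow-cong K sumOverTop ⟩
  sumBelow K (λ b → iverson (b <ᵇ columnBound c) (x (letterValue b) *ℚ codeSum x (columnBound b)))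
    ≡⟨ sumBelow-truncate (columnBound c) K _ (NP.≤-trans (columnBound≤1+ c) lt) ⟩
  columnPairSum x (columnBound c) ∎
  where
  sumOverTop : ∀ b → sumBelow K (λ a → iverson (isColumn a b c) (x (letterValue a) *ℚ x (letterValue b))) ≡ iverson (b <ᵇ columnBound c) (x (letterValue b) *ℚ codeSum x (columnBound b))
  sumOverTop b with b <ᵇ columnBound c in eb
  ... | false = trans (sumBelow-cong K (λ a → cong (λ z → iverson z (x (letterValue a) *ℚ x (letterValue b))) (BP.∧-zeroʳ (a <ᵇ columnBound b)))) (sumBelow-0 K)
  ... | true = begin
    sumBelow K (λ a → iverson ((a <ᵇ columnBound b) ∧ true) (x (letterValue a) *ℚ x (letterValue b)))
      ≡⟨ sumBelow-cong K (λ a → iverson-∧-* (a <ᵇ columnBound b) true (x (letterValue a)) (x (letterValue b))) ⟩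
    sumBelow K (λ a → x (letterValue b) *ℚ iverson (a <ᵇ columnBound b) (x (letterValue a))) ≡⟨ sym (*-distribˡ-sumBelow (x (letterValue b)) K _) ⟩
    x (letterValue b) *ℚ sumBelow K (λ a → iverson (a <ᵇ columnBound b) (x (letterValue a)))
      ≡⟨ cong (x (letterValue b) *ℚ_) (sumBelow-truncate (columnBound b) K _ columnBound≤K) ⟩
    x (letterValue b) *ℚ codeSum x (columnBound b) ∎
    where
    columnBound≤K : columnBound b ≤ K
    columnBound≤K = NP.≤-trans (columnBound≤1+ b) (NP.≤-trans (s≤s (NP.≤-pred (NP.≤-trans (<ᵇ≡true⇒< b (columnBound c) eb) (columnBound≤1+ c)))) lt)

sumVars : (ℕ → ℚ) → ℕ → ℚ
sumVars x v = sumBelow v x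

columnBound-2* : ∀ v → columnBound (2 * v) ≡ suc (2 * v)
columnBound-2* v rewrite isMarked-2* v = refl

columnBound-1+2* : ∀ v → columnBound (suc (2 * v)) ≡ suc (2 * v)
columnBound-1+2* v rewrite isMarked-1+2* v = refl

rowBound-2* : ∀ v → rowBound (2 * v) ≡ 2 * v
rowBound-2* v rewrite isMarked-2* v = refl

rowBound-1+2* : ∀ v → rowBound (suc (2 * v)) ≡ 2 * suc v
rowBound-1+2* v rewrite isMarked-1+2* v = sym (double-suc v)

sumBelow-2*suc : ∀ v (g : ℕ → ℚ) → sumBelow (2 * suc v) g ≡ sumBelow (2 * v) g +ℚ g (2 * v) +ℚ g (suc (2 * v))
sumBelow-2*suc v g = trans (cong (λ z → sumBelow z g) (double-suc v)) (trans (sumBelow-suc (suc (2 * v)) g) (cong (_+ℚ g (suc (2 * v))) (sumBelow-suc (2 * v) g)))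

codeSum-2* : ∀ x v → codeSum x (2 * v) ≡ two *ℚ sumVars x v
codeSum-2* x zero = refl
codeSum-2* x (suc v) = begin
  codeSum x (2 * suc v) ≡⟨ sumBelow-2*suc v _ ⟩
  codeSum x (2 * v) +ℚ x (letterValue (2 * v)) +ℚ x (letterValue (suc (2 * v)))
    ≡⟨ cong₂ (λ u w → u +ℚ x w +ℚ x (letterValue (suc (2 * v)))) (codeSum-2* x v) (letterValue-2* v) ⟩
  two *ℚ sumVars x v +ℚ x v +ℚ x (letterValue (suc (2 * v))) ≡⟨ cong (λ w → two *ℚ sumVars x v +ℚ x v +ℚ x w) (letterValue-1+2* v) ⟩
  two *ℚ sumVars x v +ℚ x v +ℚ x v ≡⟨ solve 2 (λ X y → (con 1ℚ :+ con 1ℚ) :* X :+ y :+ y := (con 1ℚ :+ con 1ℚ) :* (X :+ y)) refl (sumVars x v) (x v) ⟩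
  two *ℚ (sumVars x v +ℚ x v) ≡⟨ cong (two *ℚ_) (sym (sumBelow-suc v x)) ⟩
  two *ℚ sumVars x (suc v) ∎

codeSum-1+2* : ∀ x v → codeSum x (suc (2 * v)) ≡ two *ℚ sumVars x v +ℚ x v
codeSum-1+2* x v = trans (sumBelow-suc (2 * v) _) (cong₂ (λ u w → u +ℚ x w) (codeSum-2* x v) (letterValue-2* v))

columnPairSum-2* : ∀ x v → columnPairSum x (2 * v) ≡ two *ℚ (sumVars x v *ℚ sumVars x v)
columnPairSum-2* x zero = refl
columnPairSum-2* x (suc v) = begin
  columnPairSum x (2 * suc v) ≡⟨ sumBelow-2*suc v _ ⟩
  columnPairSum x (2 * v) +ℚ x (letterValue (2 * v)) *ℚ codeSum x (columnBound (2 * v)) +ℚ x (letterValue (suc (2 * v))) *ℚ codeSum x (columnBound (suc (2 * v)))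
    ≡⟨ cong₂ (λ u w → u +ℚ x w *ℚ codeSum x (columnBound (2 * v)) +ℚ x (letterValue (suc (2 * v))) *ℚ codeSum x (columnBound (suc (2 * v)))) (columnPairSum-2* x v) (letterValue-2* v) ⟩
  two *ℚ (X *ℚ X) +ℚ y *ℚ codeSum x (columnBound (2 * v)) +ℚ x (letterValue (suc (2 * v))) *ℚ codeSum x (columnBound (suc (2 * v)))
    ≡⟨ cong₂ (λ u w → two *ℚ (X *ℚ X) +ℚ y *ℚ codeSum x u +ℚ x (letterValue (suc (2 * v))) *ℚ codeSum x w) (columnBound-2* v) (columnBound-1+2* v) ⟩
  two *ℚ (X *ℚ X) +ℚ y *ℚ codeSum x (suc (2 * v)) +ℚ x (letterValue (suc (2 * v))) *ℚ codeSum x (suc (2 * v))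
    ≡⟨ cong₂ (λ u w → two *ℚ (X *ℚ X) +ℚ y *ℚ u +ℚ x w *ℚ u) (codeSum-1+2* x v) (letterValue-1+2* v) ⟩
  two *ℚ (X *ℚ X) +ℚ y *ℚ (two *ℚ X +ℚ y) +ℚ y *ℚ (two *ℚ X +ℚ y)
    ≡⟨ solve 2 (λ X y → (con 1ℚ :+ con 1ℚ) :* (X :* X) :+ y :* ((con 1ℚ :+ con 1ℚ) :* X :+ y) :+ y :* ((con 1ℚ :+ con 1ℚ) :* X :+ y)
                       := (con 1ℚ :+ con 1ℚ) :* ((X :+ y) :* (X :+ y))) refl X y ⟩
  two *ℚ ((X +ℚ y) *ℚ (X +ℚ y)) ≡⟨ cong (λ z → two *ℚ (z *ℚ z)) (sym (sumBelow-suc v x)) ⟩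
  two *ℚ (sumVars x (suc v) *ℚ sumVars x (suc v)) ∎
  where
  X = sumVars x v
  y : ℚ
  y = x v

columnPairClosedForm : (ℕ → ℚ) → ℕ → ℚ
columnPairClosedForm x v = two *ℚ (sumVars x v *ℚ sumVars x v) +ℚ x v *ℚ (two *ℚ sumVars x v +ℚ x v)

columnPairSum-1+2* : ∀ x v → columnPairSum x (suc (2 * v)) ≡ columnPairClosedForm x v
columnPairSum-1+2* x v = trans (sumBelow-suc (2 * v) _)
  (cong₂ _+ℚ_ (columnPairSum-2* x v) (trans (cong₂ (λ w u → x w *ℚ codeSum x u) (letterValue-2* v) (columnBound-2* v)) (cong (x v *ℚ_) (codeSum-1+2* x v))))

hookSum : (ℕ → ℚ) → ℕ → ℕ → ℚ
hookSum x v m = sumBelow (2 * v) (λ c → (columnPairSum x (columnBound c) *ℚ x (letterValue c)) *ℚ rowPoly x m (rowBound c))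

hookSum-suc : ∀ x v m → hookSum x (suc v) m ≡ hookSum x v m +ℚ (columnPairClosedForm x v *ℚ x v) *ℚ rowSum x v m +ℚ (columnPairClosedForm x v *ℚ x v) *ℚ rowSum x (suc v) m
hookSum-suc x v m = trans (sumBelow-2*suc v _) (cong₂ (λ u w → hookSum x v m +ℚ u +ℚ w) markedTerm unmarkedTerm)
  where
  markedTerm : (columnPairSum x (columnBound (2 * v)) *ℚ x (letterValue (2 * v))) *ℚ rowPoly x m (rowBound (2 * v)) ≡ (columnPairClosedForm x v *ℚ x v) *ℚ rowSum x v m
  markedTerm rewrite columnBound-2* v | letterValue-2* v | rowBound-2* v | columnPairSum-1+2* x v = refl
  unmarkedTerm : (columnPairSum x (columnBound (suc (2 * v))) *ℚ x (letterValue (suc (2 * v)))) *ℚ rowPoly x m (rowBound (suc (2 * v))) ≡ (columnPairClosedForm x v *ℚ x v) *ℚ rowSum x (suc v) m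
  unmarkedTerm rewrite columnBound-1+2* v | letterValue-1+2* v | rowBound-1+2* v | columnPairSum-1+2* x v = refl

hookClosedForm : (ℕ → ℚ) → ℕ → ℕ → ℚ
hookClosedForm x v m = two *ℚ (sumVars x v *ℚ sumVars x v) *ℚ rowSum x v (suc m) +ℚ -ℚ (two *ℚ sumVars x v *ℚ rowSum x v (suc (suc m))) +ℚ rowSum x v (suc (suc (suc m)))

hookSum≡hookClosedForm : ∀ x v m → hookSum x v m ≡ hookClosedForm x v m
hookSum≡hookClosedForm x zero m = refl
hookSum≡hookClosedForm x (suc v) m = begin
  hookSum x (suc v) m ≡⟨ hookSum-suc x v m ⟩
  hookSum x v m +ℚ (columnPairClosedForm x v *ℚ y) *ℚ a0 +ℚ (columnPairClosedForm x v *ℚ y) *ℚ b0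
    ≡⟨ cong (λ z → z +ℚ (columnPairClosedForm x v *ℚ y) *ℚ a0 +ℚ (columnPairClosedForm x v *ℚ y) *ℚ b0) (hookSum≡hookClosedForm x v m) ⟩
  hookClosedForm x v m +ℚ (columnPairClosedForm x v *ℚ y) *ℚ a0 +ℚ (columnPairClosedForm x v *ℚ y) *ℚ b0
    ≡⟨ solve 7 (λ X Y A0 A1 A2 A3 B0 →
         (con two :* (X :* X) :* A1 :+ :- (con two :* X :* A2) :+ A3) :+ ((con two :* (X :* X) :+ Y :* (con two :* X :+ Y)) :* Y) :* A0 :+ ((con two :* (X :* X) :+ Y :* (con two :* X :+ Y)) :* Y) :* B0
         := con two :* ((X :+ Y) :* (X :+ Y)) :* (A1 :+ Y :* A0 :+ Y :* B0)
            :+ :- (con two :* (X :+ Y) :* (A2 :+ Y :* A1 :+ Y :* (A1 :+ Y :* A0 :+ Y :* B0)))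
            :+ (A3 :+ Y :* A2 :+ Y :* (A2 :+ Y :* A1 :+ Y :* (A1 :+ Y :* A0 :+ Y :* B0)))) refl X y a0 a1 a2 a3 b0 ⟩
  two *ℚ ((X +ℚ y) *ℚ (X +ℚ y)) *ℚ B1 +ℚ -ℚ (two *ℚ (X +ℚ y) *ℚ B2) +ℚ B3
    ≡⟨ cong₂ (λ u w → two *ℚ (u *ℚ u) *ℚ w +ℚ -ℚ (two *ℚ u *ℚ B2) +ℚ B3) (sym (sumBelow-suc v x)) (sym expand₁) ⟩
  two *ℚ (sumVars x (suc v) *ℚ sumVars x (suc v)) *ℚ rowSum x (suc v) (suc m) +ℚ -ℚ (two *ℚ sumVars x (suc v) *ℚ B2) +ℚ B3
    ≡⟨ cong (λ w → two *ℚ (sumVars x (suc v) *ℚ sumVars x (suc v)) *ℚ rowSum x (suc v) (suc m) +ℚ -ℚ (two *ℚ sumVars x (suc v) *ℚ w) +ℚ B3) (sym expand₂) ⟩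
  two *ℚ (sumVars x (suc v) *ℚ sumVars x (suc v)) *ℚ rowSum x (suc v) (suc m) +ℚ -ℚ (two *ℚ sumVars x (suc v) *ℚ rowSum x (suc v) (suc (suc m))) +ℚ B3
    ≡⟨ cong (λ w → two *ℚ (sumVars x (suc v) *ℚ sumVars x (suc v)) *ℚ rowSum x (suc v) (suc m) +ℚ -ℚ (two *ℚ sumVars x (suc v) *ℚ rowSum x (suc v) (suc (suc m))) +ℚ w) (sym expand₃) ⟩
  hookClosedForm x (suc v) m ∎
  where
  X : ℚ
  X = sumVars x v
  y : ℚ
  y = x v
  a0 : ℚ
  a0 = rowSum x v m
  a1 : ℚ
  a1 = rowSum x v (suc m)
  a2 : ℚ
  a2 = rowSum x v (suc (suc m))
  a3 : ℚ
  a3 = rowSum x v (suc (suc (suc m)))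
  b0 : ℚ
  b0 = rowSum x (suc v) m
  B1 : ℚ
  B1 = a1 +ℚ y *ℚ a0 +ℚ y *ℚ b0
  B2 : ℚ
  B2 = a2 +ℚ y *ℚ a1 +ℚ y *ℚ B1
  B3 : ℚ
  B3 = a3 +ℚ y *ℚ a2 +ℚ y *ℚ B2
  expand₁ : rowSum x (suc v) (suc m) ≡ B1
  expand₁ = rowSum-suc-suc x v m
  expand₂ : rowSum x (suc v) (suc (suc m)) ≡ B2
  expand₂ = trans (rowSum-suc-suc x v (suc m)) (cong (λ z → a2 +ℚ y *ℚ a1 +ℚ y *ℚ z) expand₁)
  expand₃ : rowSum x (suc v) (suc (suc (suc m))) ≡ B3
  expand₃ = trans (rowSum-suc-suc x v (suc (suc m))) (cong (λ z → a3 +ℚ y *ℚ a2 +ℚ y *ℚ z) expand₂)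

rEval-hook : ∀ m N x → rEval (triangle (suc (suc (suc m))) 3) N x ≡ hookClosedForm x N m
rEval-hook m N x = trans (rEval-hook-columnTopSum m N x)
  (trans (sumBelow-cong< (2 * N) (λ c lt → cong (λ z → (z *ℚ x (letterValue c)) *ℚ rowPoly x m (rowBound c)) (columnTopSum≡columnPairSum x (2 * N) c lt)))
         (hookSum≡hookClosedForm x N m))

-- Sums over partitions

partitionSum : ℕ → ℕ → (List ℕ → ℚ) → ℚ
partitionSum n k F = sumOver (partsLE n n k) F

sumOver-partsLE-suc : ∀ f n k (F : List ℕ → ℚ) → sumOver (partsLE (suc f) (suc n) k) F ≡
  sumBelow (suc n ⊓ k) (λ j → sumOver (partsLE f (n ∸ j) (suc j)) (λ ν → F (suc j ∷ ν)))
sumOver-partsLE-suc f n k F = begin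
  sumOver (concatMap G (map suc (upTo (suc n ⊓ k)))) F ≡⟨ sumOver-concatMap G (map suc (upTo (suc n ⊓ k))) F ⟩
  sumOver (map suc (upTo (suc n ⊓ k))) (λ j → sumOver (G j) F) ≡⟨ sumOver-map suc (upTo (suc n ⊓ k)) (λ j → sumOver (G j) F) ⟩
  sumOver (upTo (suc n ⊓ k)) (λ j → sumOver (G (suc j)) F) ≡⟨ sumOver-cong (upTo (suc n ⊓ k)) (λ j → sumOver-map (suc j ∷_) (partsLE f (n ∸ j) (suc j)) F) ⟩
  sumOver (upTo (suc n ⊓ k)) (λ j → sumOver (partsLE f (n ∸ j) (suc j)) (λ ν → F (suc j ∷ ν))) ≡⟨ sumOver-upTo (suc n ⊓ k) (λ j → sumOver (partsLE f (n ∸ j) (suc j)) (λ ν → F (suc j ∷ ν))) ⟩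
  sumBelow (suc n ⊓ k) (λ j → sumOver (partsLE f (n ∸ j) (suc j)) (λ ν → F (suc j ∷ ν))) ∎
  where
  G : ℕ → List (List ℕ)
  G j = map (j ∷_) (partsLE f (suc n ∸ j) j)

sumOver-partsLE-fuel : ∀ f f' n k (F : List ℕ → ℚ) → n ≤ f → n ≤ f' → sumOver (partsLE f n k) F ≡ sumOver (partsLE f' n k) F
sumOver-partsLE-fuel f f' zero k F _ _ = refl
sumOver-partsLE-fuel (suc f) (suc f') (suc n) k F (s≤s le) (s≤s le') =
  trans (sumOver-partsLE-suc f n k F) (trans (sumBelow-cong (suc n ⊓ k) (λ j →
    sumOver-partsLE-fuel f f' (n ∸ j) (suc j) (λ ν → F (suc j ∷ ν)) (NP.≤-trans (NP.m∸n≤m n j) le) (NP.≤-trans (NP.m∸n≤m n j) le')))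
    (sym (sumOver-partsLE-suc f' n k F)))

partitionSum-suc : ∀ n k' (F : List ℕ → ℚ) → partitionSum n (suc k') F ≡ partitionSum n k' F +ℚ iverson (suc k' ≤ᵇ n) (partitionSum (n ∸ suc k') (suc k') (λ ν → F (suc k' ∷ ν)))
partitionSum-suc zero k' F = sym (QP.+-identityʳ _)
partitionSum-suc (suc n) k' F with k' <? suc n
... | yes lt = begin
  partitionSum (suc n) (suc k') F ≡⟨ sumOver-partsLE-suc n n (suc k') F ⟩
  sumBelow (suc n ⊓ suc k') H ≡⟨ cong (λ z → sumBelow z H) (NP.m≥n⇒m⊓n≡n lt) ⟩
  sumBelow (suc k') H ≡⟨ sumBelow-suc k' H ⟩
  sumBelow k' H +ℚ H k' ≡⟨ cong₂ _+ℚ_ (cong (λ z → sumBelow z H) (sym (NP.m≥n⇒m⊓n≡n (NP.<⇒≤ lt)))) (sumOver-partsLE-fuel n (n ∸ k') (n ∸ k') (suc k') _ (NP.m∸n≤m n k') NP.≤-refl) ⟩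
  sumBelow (suc n ⊓ k') H +ℚ partitionSum (n ∸ k') (suc k') (λ ν → F (suc k' ∷ ν))
    ≡⟨ cong₂ _+ℚ_ (sym (sumOver-partsLE-suc n n k' F)) (sym (cong (λ b → iverson b (partitionSum (n ∸ k') (suc k') (λ ν → F (suc k' ∷ ν)))) (<⇒<ᵇ≡true k' (suc n) lt))) ⟩
  partitionSum (suc n) k' F +ℚ iverson (suc k' ≤ᵇ suc n) (partitionSum (suc n ∸ suc k') (suc k') (λ ν → F (suc k' ∷ ν))) ∎
  where
  H : ℕ → ℚ
  H j = sumOver (partsLE n (n ∸ j) (suc j)) (λ ν → F (suc j ∷ ν))
... | no nlt = begin
  partitionSum (suc n) (suc k') F ≡⟨ sumOver-partsLE-suc n n (suc k') F ⟩
  sumBelow (suc n ⊓ suc k') H ≡⟨ cong (λ z → sumBelow z H) (trans (NP.m≤n⇒m⊓n≡m (NP.<⇒≤ (NP.≰⇒> nlt))) (sym (NP.m≤n⇒m⊓n≡m (NP.≤-pred (NP.≰⇒> nlt))))) ⟩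
  sumBelow (suc n ⊓ k') H ≡⟨ sym (sumOver-partsLE-suc n n k' F) ⟩
  partitionSum (suc n) k' F ≡⟨ sym (QP.+-identityʳ _) ⟩
  partitionSum (suc n) k' F +ℚ 0ℚ ≡⟨ cong (λ b → partitionSum (suc n) k' F +ℚ iverson b (partitionSum (suc n ∸ suc k') (suc k') (λ ν → F (suc k' ∷ ν)))) (sym (≥⇒<ᵇ≡false k' (suc n) (NP.≤-pred (NP.≰⇒> nlt)))) ⟩
  partitionSum (suc n) k' F +ℚ iverson (suc k' ≤ᵇ suc n) (partitionSum (suc n ∸ suc k') (suc k') (λ ν → F (suc k' ∷ ν))) ∎
  where
  H : ℕ → ℚ
  H j = sumOver (partsLE n (n ∸ j) (suc j)) (λ ν → F (suc j ∷ ν))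

BoundedPartition : ℕ → ℕ → List ℕ → Set
BoundedPartition k n ν = All (λ p → (1 ≤ p) × (p ≤ k)) ν × (sizeP ν ≡ n)

sumOver-partsLE-cong : ∀ f n k (F G : List ℕ → ℚ) → (∀ ν → BoundedPartition k n ν → F ν ≡ G ν) → sumOver (partsLE f n k) F ≡ sumOver (partsLE f n k) G
sumOver-partsLE-cong f zero k F G h = cong (_+ℚ 0ℚ) (h [] ([] , refl))
sumOver-partsLE-cong zero (suc n) k F G h = refl
sumOver-partsLE-cong (suc f) (suc n) k F G h =
  trans (sumOver-partsLE-suc f n k F) (trans (sumBelow-cong< (suc n ⊓ k) (λ j lt →
    sumOver-partsLE-cong f (n ∸ j) (suc j) (λ ν → F (suc j ∷ ν)) (λ ν → G (suc j ∷ ν)) (λ ν g → h (suc j ∷ ν) (extend j ν lt g))))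
    (sym (sumOver-partsLE-suc f n k G)))
  where
  extend : ∀ j ν → j < suc n ⊓ k → BoundedPartition (suc j) (n ∸ j) ν → BoundedPartition k (suc n) (suc j ∷ ν)
  extend j ν lt (al , sz) = ((s≤s z≤n , jk) ∷ All.map (λ { (a , b) → a , NP.≤-trans b jk }) al) ,
                          cong suc (trans (cong (j +_) sz) (NP.m+[n∸m]≡n jn))
    where
    jk : suc j ≤ k
    jk = NP.≤-trans lt (NP.m⊓n≤n (suc n) k)
    jn : j ≤ n
    jn = NP.≤-pred (NP.≤-trans lt (NP.m⊓n≤m (suc n) k))

replicate-++-∷ : ∀ t (k : ℕ) (ν : List ℕ) → replicate t k ++ k ∷ ν ≡ replicate (suc t) k ++ ν
replicate-++-∷ zero k ν = refl
replicate-++-∷ (suc t) k ν = cong (k ∷_) (replicate-++-∷ t k ν)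

Factorises : ℕ → (ℕ → ℚ) → (List ℕ → ℚ) → (List ℕ → ℚ) → Set
Factorises k' E F F' = ∀ t j ν → BoundedPartition k' j ν → F (replicate t (suc k') ++ ν) ≡ E t *ℚ F' ν

-- t counts the parts equal to suc k' removed so far.
LargestPartExpansion : ℕ → (ℕ → ℚ) → (List ℕ → ℚ) → (List ℕ → ℚ) → ℕ → ℕ → Set
LargestPartExpansion k' E F F' n t = partitionSum n (suc k') (λ ν → F (replicate t (suc k') ++ ν)) ≡
  sumBelow (suc n) (λ m → iverson (m * suc k' ≤ᵇ n) (E (t + m) *ℚ partitionSum (n ∸ m * suc k') k' F'))

largestPartExpansion-step : ∀ k' E F F' → Factorises k' E F F' → ∀ n t →
  (suc k' ≤ n → ∀ t' → LargestPartExpansion k' E F F' (n ∸ suc k') t') → LargestPartExpansion k' E F F' n t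
largestPartExpansion-step k' E F F' fac n t rec = begin
  partitionSum n k (λ ν → F (replicate t k ++ ν)) ≡⟨ partitionSum-suc n k' _ ⟩
  partitionSum n k' (λ ν → F (replicate t k ++ ν)) +ℚ iverson (k ≤ᵇ n) (partitionSum (n ∸ k) k (λ ν → F (replicate t k ++ k ∷ ν)))
    ≡⟨ cong₂ _+ℚ_ noMorePartsK (cong (iverson (k ≤ᵇ n)) (sumOver-cong (partsLE (n ∸ k) (n ∸ k) k) (λ ν → cong F (replicate-++-∷ t k ν)))) ⟩
  E (t + 0) *ℚ partitionSum n k' F' +ℚ iverson (k ≤ᵇ n) (partitionSum (n ∸ k) k (λ ν → F (replicate (suc t) k ++ ν)))
    ≡⟨ cong (E (t + 0) *ℚ partitionSum n k' F' +ℚ_) anotherPartK ⟩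
  sumBelow (suc n) (λ m → iverson (m * k ≤ᵇ n) (E (t + m) *ℚ partitionSum (n ∸ m * k) k' F')) ∎
  where
  k : ℕ
  k = suc k'
  noMorePartsK : partitionSum n k' (λ ν → F (replicate t k ++ ν)) ≡ E (t + 0) *ℚ partitionSum n k' F'
  noMorePartsK = trans (sumOver-partsLE-cong n n k' _ (λ ν → E t *ℚ F' ν) (λ ν g → fac t n ν g))
    (trans (sym (*-distribˡ-sumOver (E t) (partsLE n n k') F')) (cong (λ z → E z *ℚ partitionSum n k' F') (sym (NP.+-identityʳ t))))
  anotherPartK : iverson (k ≤ᵇ n) (partitionSum (n ∸ k) k (λ ν → F (replicate (suc t) k ++ ν)))
    ≡ sumBelow n (λ m → iverson (suc m * k ≤ᵇ n) (E (t + suc m) *ℚ partitionSum (n ∸ suc m * k) k' F'))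
  anotherPartK with k ≤? n
  ... | yes kn = begin
    iverson (k ≤ᵇ n) (partitionSum (n ∸ k) k (λ ν → F (replicate (suc t) k ++ ν)))
      ≡⟨ cong (λ b → iverson b (partitionSum (n ∸ k) k (λ ν → F (replicate (suc t) k ++ ν)))) (≤⇒≤ᵇ≡true k n kn) ⟩
    partitionSum (n ∸ k) k (λ ν → F (replicate (suc t) k ++ ν)) ≡⟨ rec kn (suc t) ⟩
    sumBelow (suc (n ∸ k)) (λ m → iverson (m * k ≤ᵇ n ∸ k) (E (suc t + m) *ℚ partitionSum (n ∸ k ∸ m * k) k' F'))
      ≡⟨ sym (sumBelow-multiples-truncate k' n (n ∸ k) _ range) ⟩
    sumBelow n (λ m → iverson (m * k ≤ᵇ n ∸ k) (E (suc t + m) *ℚ partitionSum (n ∸ k ∸ m * k) k' F'))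
      ≡⟨ sumBelow-cong n (λ m → cong₂ iverson (sym (+≤ᵇ≡≤ᵇ∸ n k (m * k) kn))
           (cong₂ (λ u v → E u *ℚ partitionSum v k' F') (sym (NP.+-suc t m)) (NP.∸-+-assoc n k (m * k)))) ⟩
    sumBelow n (λ m → iverson (suc m * k ≤ᵇ n) (E (t + suc m) *ℚ partitionSum (n ∸ suc m * k) k' F')) ∎
    where
    range : suc (n ∸ k) ≤ n
    range = subst (_≤ n) (NP.+-∸-assoc 1 {n} {k} kn) (NP.∸-monoʳ-≤ (suc n) (s≤s (z≤n {k'})))
  ... | no k≰n = trans (cong (λ b → iverson b (partitionSum (n ∸ k) k (λ ν → F (replicate (suc t) k ++ ν)))) (>⇒≤ᵇ≡false k n (NP.≰⇒> k≰n)))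
                 (sym (trans (sumBelow-cong n (λ m → cong (λ b → iverson b (E (t + suc m) *ℚ partitionSum (n ∸ suc m * k) k' F'))
                                (>⇒≤ᵇ≡false (suc m * k) n (NP.<-≤-trans (NP.≰⇒> k≰n) (NP.m≤m+n k (m * k))))))
                       (sumBelow-0 n)))

largestPartExpansion : ∀ k' E F F' → Factorises k' E F F' → ∀ n t → LargestPartExpansion k' E F F' n t
largestPartExpansion k' E F F' fac n t = byFuel n n NP.≤-refl t
  where
  byFuel : ∀ fuel n → n ≤ fuel → ∀ t → LargestPartExpansion k' E F F' n t
  byFuel zero n n≤0 t = largestPartExpansion-step k' E F F' fac n t (λ k≤n → contradiction (NP.≤-trans k≤n n≤0) λ ())
  byFuel (suc fuel) n n≤fuel t = largestPartExpansion-step k' E F F' fac n t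
    (λ k≤n t' → byFuel fuel (n ∸ suc k') (NP.≤-pred (NP.≤-trans (NP.∸-monoʳ-< {n} {suc k'} {0} (s≤s z≤n) k≤n) n≤fuel)) t')

productBelow : ℕ → (ℕ → ℕ) → ℕ
productBelow M h = foldr _*_ 1 (applyUpTo h M)

productBelow-suc : ∀ M h → productBelow (suc M) h ≡ productBelow M h * h M
productBelow-suc zero h = trans (NP.*-identityʳ (h 0)) (sym (NP.*-identityˡ (h 0)))
productBelow-suc (suc M) h = trans (cong (h 0 *_) (productBelow-suc M (h ∘ suc))) (sym (NP.*-assoc (h 0) (productBelow M (h ∘ suc)) (h (suc M))))

productBelow-cong< : ∀ M {h h' : ℕ → ℕ} → (∀ i → i < M → h i ≡ h' i) → productBelow M h ≡ productBelow M h'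
productBelow-cong< zero e = refl
productBelow-cong< (suc M) e = cong₂ _*_ (e 0 (s≤s z≤n)) (productBelow-cong< M (λ i lt → e (suc i) (s≤s lt)))

productBelow-update : ∀ M (h h' : ℕ → ℕ) p c → p < M → (∀ i → i ≢ p → h' i ≡ h i) → h' p ≡ c * h p → productBelow M h' ≡ c * productBelow M h
productBelow-update zero h h' p c () e1 e2
productBelow-update (suc M) h h' p c lt e1 e2 with p ≟ M
... | yes refl = begin
  productBelow (suc p) h' ≡⟨ productBelow-suc p h' ⟩
  productBelow p h' * h' p ≡⟨ cong₂ _*_ (productBelow-cong< p (λ i lt' → e1 i (NP.<⇒≢ lt'))) e2 ⟩
  productBelow p h * (c * h p) ≡⟨ rearrange ⟩
  c * (productBelow p h * h p) ≡⟨ cong (c *_) (sym (productBelow-suc p h)) ⟩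
  c * productBelow (suc p) h ∎
  where
  open ≡-Reasoning
  rearrange : productBelow p h * (c * h p) ≡ c * (productBelow p h * h p)
  rearrange = trans (sym (NP.*-assoc (productBelow p h) c (h p))) (trans (cong (_* h p) (NP.*-comm (productBelow p h) c)) (NP.*-assoc c (productBelow p h) (h p)))
... | no ne = begin
  productBelow (suc M) h' ≡⟨ productBelow-suc M h' ⟩
  productBelow M h' * h' M ≡⟨ cong₂ _*_ (productBelow-update M h h' p c (NP.≤∧≢⇒< (NP.≤-pred lt) ne) e1 e2) (e1 M (λ e → ne (sym e))) ⟩
  (c * productBelow M h) * h M ≡⟨ NP.*-assoc c (productBelow M h) (h M) ⟩
  c * (productBelow M h * h M) ≡⟨ cong (c *_) (sym (productBelow-suc M h)) ⟩
  c * productBelow (suc M) h ∎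
  where open ≡-Reasoning

productBelow-extend : ∀ S e (h : ℕ → ℕ) → (∀ i → S ≤ i → h i ≡ 1) → productBelow (S + e) h ≡ productBelow S h
productBelow-extend S zero h e1 = cong (λ z → productBelow z h) (NP.+-identityʳ S)
productBelow-extend S (suc e) h e1 = trans (cong (λ z → productBelow z h) (NP.+-suc S e)) (trans (productBelow-suc (S + e) h)
  (trans (cong₂ _*_ (productBelow-extend S e h e1) (e1 (S + e) (NP.m≤m+n S e))) (NP.*-identityʳ (productBelow S h))))

mult-∷-≡ : ∀ i k L → (k ≡ᵇ i) ≡ true → mult i (k ∷ L) ≡ suc (mult i L)
mult-∷-≡ i k L e rewrite e = refl

mult-∷-≢ : ∀ i k L → (k ≡ᵇ i) ≡ false → mult i (k ∷ L) ≡ mult i L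
mult-∷-≢ i k L e rewrite e = refl

mult-replicate-≢ : ∀ i k t ν → k ≢ i → mult i (replicate t k ++ ν) ≡ mult i ν
mult-replicate-≢ i k zero ν ne = refl
mult-replicate-≢ i k (suc t) ν ne = trans (mult-∷-≢ i k _ (≢⇒≡ᵇ≡false k i ne)) (mult-replicate-≢ i k t ν ne)

mult-replicate : ∀ k t ν → mult k (replicate t k ++ ν) ≡ t + mult k ν
mult-replicate k zero ν = refl
mult-replicate k (suc t) ν = trans (mult-∷-≡ k k _ (≡ᵇ-refl k)) (cong suc (mult-replicate k t ν))

mult-absent : ∀ i ν → All (λ p → p < i) ν → mult i ν ≡ 0
mult-absent i [] al = refl
mult-absent i (p ∷ ν) (lt ∷ al) = trans (mult-∷-≢ i p ν (≢⇒≡ᵇ≡false p i (NP.<⇒≢ lt))) (mult-absent i ν al)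

parts≤sizeP : ∀ ν → All (λ p → p ≤ sizeP ν) ν
parts≤sizeP [] = []
parts≤sizeP (p ∷ ν) = NP.m≤m+n p (sizeP ν) ∷ All.map (λ le → NP.≤-trans le (NP.m≤n+m (sizeP ν) p)) (parts≤sizeP ν)

zFactor : List ℕ → ℕ → ℕ
zFactor μ i = (i ^ mult i μ) * (mult i μ) !

z≡productBelow : ∀ μ → z μ ≡ productBelow (sizeP μ) (λ i → zFactor μ (suc i))
z≡productBelow μ = cong (foldr _*_ 1) (trans (cong (map (zFactor μ)) (LP.map-upTo suc (sizeP μ))) (LP.map-applyUpTo suc (zFactor μ) (sizeP μ)))

sizeP-++ : ∀ L M → sizeP (L ++ M) ≡ sizeP L + sizeP M
sizeP-++ [] M = refl
sizeP-++ (a ∷ L) M = trans (cong (a +_) (sizeP-++ L M)) (sym (NP.+-assoc a (sizeP L) (sizeP M)))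

sizeP-replicate : ∀ t k → sizeP (replicate t k) ≡ t * k
sizeP-replicate zero k = refl
sizeP-replicate (suc t) k = cong (k +_) (sizeP-replicate t k)

productBelow-zFactor-extend : ∀ ν e → productBelow (sizeP ν + e) (λ i → zFactor ν (suc i)) ≡ z ν
productBelow-zFactor-extend ν e = trans (productBelow-extend (sizeP ν) e _ (λ i le → beyondSize i le)) (sym (z≡productBelow ν))
  where
  beyondSize : ∀ i → sizeP ν ≤ i → zFactor ν (suc i) ≡ 1
  beyondSize i le rewrite mult-absent (suc i) ν (All.map (λ q → s≤s (NP.≤-trans q le)) (parts≤sizeP ν)) = refl

z-replicate : ∀ k' j ν t → BoundedPartition k' j ν → z (replicate t (suc k') ++ ν) ≡ ((suc k') ^ t * t !) * z ν
z-replicate k' j ν zero g = sym (NP.+-identityʳ (z ν))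
z-replicate k' j ν (suc t) (al , sz) = begin
  z μ ≡⟨ z≡productBelow μ ⟩
  productBelow (sizeP μ) (λ i → zFactor μ (suc i)) ≡⟨ cong (λ M → productBelow M (λ i → zFactor μ (suc i))) size-μ ⟩
  productBelow (sizeP ν + suc t * k) (λ i → zFactor μ (suc i))
    ≡⟨ productBelow-update (sizeP ν + suc t * k) (λ i → zFactor ν (suc i)) (λ i → zFactor μ (suc i)) k' c k<size otherFactors factorK ⟩
  c * productBelow (sizeP ν + suc t * k) (λ i → zFactor ν (suc i)) ≡⟨ cong (c *_) (productBelow-zFactor-extend ν (suc t * k)) ⟩
  c * z ν ∎
  where
  open ≡-Reasoning
  k : ℕ
  k = suc k'
  μ : List ℕ
  μ = replicate (suc t) k ++ ν
  c : ℕ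
  c = k ^ suc t * suc t !
  size-μ : sizeP μ ≡ sizeP ν + suc t * k
  size-μ = trans (sizeP-++ (replicate (suc t) k) ν) (trans (cong (_+ sizeP ν) (sizeP-replicate (suc t) k)) (NP.+-comm (suc t * k) (sizeP ν)))
  k<size : k' < sizeP ν + suc t * k
  k<size = NP.≤-trans (NP.m≤m+n k (t * k)) (NP.m≤n+m (suc t * k) (sizeP ν))
  k-absent : mult k ν ≡ 0
  k-absent = mult-absent k ν (All.map (λ { (_ , b) → s≤s b }) al)
  otherFactors : ∀ i → i ≢ k' → zFactor μ (suc i) ≡ zFactor ν (suc i)
  otherFactors i ne rewrite mult-replicate-≢ (suc i) k (suc t) ν (λ e → ne (sym (NP.suc-injective e))) = refl
  factorK : zFactor μ k ≡ c * zFactor ν k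
  factorK rewrite mult-replicate k (suc t) ν | k-absent | NP.+-identityʳ t = sym (NP.*-identityʳ c)

productBelow-pos : ∀ M h → (∀ i → 1 ≤ h i) → 1 ≤ productBelow M h
productBelow-pos zero h p = NP.≤-refl
productBelow-pos (suc M) h p = NP.*-mono-≤ (p 0) (productBelow-pos M (h ∘ suc) (λ i → p (suc i)))

z-pos : ∀ μ → 1 ≤ z μ
z-pos μ = subst (1 ≤_) (sym (z≡productBelow μ)) (productBelow-pos (sizeP μ) _ (λ i → NP.*-mono-≤ (NP.m^n>0 (suc i) (mult (suc i) μ)) (NP.1≤n! (mult (suc i) μ))))

power*factorial-pos : ∀ k t → 1 ≤ suc k ^ t * t !
power*factorial-pos k t = NP.*-mono-≤ (NP.m^n>0 (suc k) t) (NP.1≤n! t)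

-- The power-sum side

oddTerm : ℕ → (ℕ → ℚ) → List ℕ → ℚ
oddTerm N x ν = iverson (allᵇ isOdd ν) (baseCoeff ν *ℚ pEval N x ν)

-- The contribution of t parts equal to k to z⁻¹ 2^ℓ p.
partTerm : ℕ → (ℕ → ℚ) → ℕ → ℕ → ℚ
partTerm N x k t = iverson ((t ≡ᵇ 0) ∨ isOdd k) (frac (2 ^ t) (k ^ t * t !) *ℚ powℚ (pEval1 N x k) t)

pEval-++ : ∀ N x L M → pEval N x (L ++ M) ≡ pEval N x L *ℚ pEval N x M
pEval-++ N x [] M = sym (QP.*-identityˡ _)
pEval-++ N x (a ∷ L) M = trans (cong (pEval1 N x a *ℚ_) (pEval-++ N x L M)) (sym (QP.*-assoc (pEval1 N x a) (pEval N x L) (pEval N x M)))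

pEval-replicate : ∀ N x t k → pEval N x (replicate t k) ≡ powℚ (pEval1 N x k) t
pEval-replicate N x zero k = refl
pEval-replicate N x (suc t) k = cong (pEval1 N x k *ℚ_) (pEval-replicate N x t k)

oddTerm-replicate : ∀ N x k' j ν t → BoundedPartition k' j ν → oddTerm N x (replicate t (suc k') ++ ν) ≡ partTerm N x (suc k') t *ℚ oddTerm N x ν
oddTerm-replicate N x k' j ν zero g = sym (QP.*-identityˡ (oddTerm N x ν))
oddTerm-replicate N x k' j ν (suc t) g = begin
  iverson (allᵇ isOdd μ) (frac (2 ^ length μ) (z μ) *ℚ pEval N x μ)
    ≡⟨ cong₂ (λ b q → iverson b q) (trans (allᵇ-++ isOdd (replicate (suc t) k) ν) (cong (_∧ allᵇ isOdd ν) (allᵇ-replicate isOdd t k))) (cong₂ _*ℚ_ coefficient-split power-split) ⟩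
  iverson (isOdd k ∧ allᵇ isOdd ν) ((frac (2 ^ suc t) c *ℚ baseCoeff ν) *ℚ (P *ℚ pEval N x ν))
    ≡⟨ cong (iverson (isOdd k ∧ allᵇ isOdd ν)) (solve 4 (λ F B Pp Q → (F :* B) :* (Pp :* Q) := (F :* Pp) :* (B :* Q)) refl (frac (2 ^ suc t) c) (baseCoeff ν) P (pEval N x ν)) ⟩
  iverson (isOdd k ∧ allᵇ isOdd ν) ((frac (2 ^ suc t) c *ℚ P) *ℚ (baseCoeff ν *ℚ pEval N x ν))
    ≡⟨ iverson-∧-* (isOdd k) (allᵇ isOdd ν) _ _ ⟩
  oddTerm N x ν *ℚ partTerm N x k (suc t) ≡⟨ QP.*-comm (oddTerm N x ν) (partTerm N x k (suc t)) ⟩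
  partTerm N x k (suc t) *ℚ oddTerm N x ν ∎
  where
  k : ℕ
  k = suc k'
  μ : List ℕ
  μ = replicate (suc t) k ++ ν
  c : ℕ
  c = k ^ suc t * suc t !
  P = powℚ (pEval1 N x k) (suc t)
  coefficient-split : frac (2 ^ length μ) (z μ) ≡ frac (2 ^ suc t) c *ℚ baseCoeff ν
  coefficient-split = begin
    frac (2 ^ length μ) (z μ) ≡⟨ cong₂ frac (trans (cong (2 ^_) (trans (LP.length-++ (replicate (suc t) k)) (cong (_+ length ν) (LP.length-replicate (suc t)))))
                                                   (NP.^-distribˡ-+-* 2 (suc t) (length ν)))
                                            (z-replicate k' j ν (suc t) g) ⟩
    frac (2 ^ suc t * 2 ^ length ν) (c * z ν) ≡⟨ frac-* (2 ^ suc t) (2 ^ length ν) c (z ν) (power*factorial-pos k' (suc t)) (z-pos ν) ⟩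
    frac (2 ^ suc t) c *ℚ baseCoeff ν ∎
  power-split : pEval N x μ ≡ P *ℚ pEval N x ν
  power-split = trans (pEval-++ N x (replicate (suc t) k) ν) (cong (_*ℚ pEval N x ν) (pEval-replicate N x (suc t) k))

partNewtonWeight : ℕ → (ℕ → ℚ) → ℕ → ℕ → ℚ
partNewtonWeight N x k (suc zero) = iverson (isOdd k) (two *ℚ pEval1 N x k)
partNewtonWeight N x k _ = 0ℚ

partTerm-newton : ∀ N x k' m → fromℕ (m * suc k') *ℚ partTerm N x (suc k') m ≡ sumBelow m (λ s → partNewtonWeight N x (suc k') (suc s) *ℚ partTerm N x (suc k') (m ∸ suc s))
partTerm-newton N x k' zero = refl
partTerm-newton N x k' (suc m) = begin
  fromℕ (suc m * k) *ℚ partTerm N x k (suc m) ≡⟨ lastFactor ⟩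
  partNewtonWeight N x k 1 *ℚ partTerm N x k m ≡⟨ sym (trans (cong (partNewtonWeight N x k 1 *ℚ partTerm N x k m +ℚ_) (trans (sumBelow-cong m (λ s → QP.*-zeroˡ (partTerm N x k (m ∸ suc s)))) (sumBelow-0 m))) (QP.+-identityʳ _)) ⟩
  sumBelow (suc m) (λ s → partNewtonWeight N x k (suc s) *ℚ partTerm N x k (suc m ∸ suc s)) ∎
  where
  k : ℕ
  k = suc k'
  pk : ℚ
  pk = pEval1 N x k
  lastFactor : fromℕ (suc m * k) *ℚ partTerm N x k (suc m) ≡ partNewtonWeight N x k 1 *ℚ partTerm N x k m
  lastFactor with isOdd k
  ... | false = trans (QP.*-zeroʳ (fromℕ (suc m * k))) (sym (QP.*-zeroˡ (iverson ((m ≡ᵇ 0) ∨ false) (frac (2 ^ m) (k ^ m * m !) *ℚ powℚ pk m))))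
  ... | true rewrite BP.∨-zeroʳ (m ≡ᵇ 0) = begin
    fromℕ (suc m * k) *ℚ (frac (2 ^ suc m) (k ^ suc m * suc m !) *ℚ powℚ pk (suc m))
      ≡⟨ cong (λ z → fromℕ (suc m * k) *ℚ (frac (2 ^ suc m) z *ℚ powℚ pk (suc m))) denominator-split ⟩
    fromℕ c *ℚ (frac (2 * 2 ^ m) (c * D) *ℚ (pk *ℚ powℚ pk m))
      ≡⟨ cong (λ z → fromℕ c *ℚ (z *ℚ (pk *ℚ powℚ pk m))) (frac-* 2 (2 ^ m) c D (s≤s z≤n) (power*factorial-pos k' m)) ⟩
    fromℕ c *ℚ ((frac 2 c *ℚ frac (2 ^ m) D) *ℚ (pk *ℚ powℚ pk m))
      ≡⟨ solve 5 (λ Cc F2 FD P Pm → Cc :* ((F2 :* FD) :* (P :* Pm)) := (F2 :* Cc) :* P :* (FD :* Pm)) refl (fromℕ c) (frac 2 c) (frac (2 ^ m) D) pk (powℚ pk m) ⟩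
    (frac 2 c *ℚ fromℕ c) *ℚ pk *ℚ (frac (2 ^ m) D *ℚ powℚ pk m)
      ≡⟨ cong (λ z → z *ℚ pk *ℚ (frac (2 ^ m) D *ℚ powℚ pk m)) (trans (cong (λ z → frac 2 z *ℚ fromℕ z) c≡suc) (frac-*-denominator 2 (m + k' + m * k'))) ⟩
    two *ℚ pk *ℚ (frac (2 ^ m) D *ℚ powℚ pk m) ∎
    where
    c : ℕ
    c = suc m * k
    D : ℕ
    D = k ^ m * m !
    c≡suc : c ≡ suc (m + k' + m * k')
    c≡suc = cong suc (trans (NP.+-comm k' (m * k)) (trans (cong (_+ k') (NP.*-suc m k')) (trans (NP.+-assoc m (m * k') k') (trans (cong (m +_) (NP.+-comm (m * k') k')) (sym (NP.+-assoc m k' (m * k')))))))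
    denominator-split : k ^ suc m * suc m ! ≡ c * D
    denominator-split = trans (cong (k ^ suc m *_) refl) (rearrange (k) (k ^ m) (suc m) (m !))
      where
      rearrange : ∀ a b c d → (a * b) * (c * d) ≡ (c * a) * (b * d)
      rearrange a b c d = trans (NP.*-assoc a b (c * d)) (trans (cong (a *_) (trans (sym (NP.*-assoc b c d)) (trans (cong (_* d) (NP.*-comm b c)) (NP.*-assoc c b d))))
                      (trans (sym (NP.*-assoc a c (b * d))) (cong (_* (b * d)) (NP.*-comm a c))))

-- The convolution of b with partTerm k dilated by k, for 2 ≤ k ≤ K + 1; with b = partTerm₁ it is
-- the power-sum side restricted to parts ≤ K + 1.
partConv : ℕ → (ℕ → ℚ) → ℕ → (ℕ → ℚ) → ℕ → ℚ
partConv N x zero b = b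
partConv N x (suc K) b = convBy (suc (suc K)) (partTerm N x (suc (suc K))) (partConv N x K b)

partTerm₁ : ℕ → (ℕ → ℚ) → ℕ → ℚ
partTerm₁ N x = partTerm N x 1

weightedOddTerm : ℕ → (ℕ → ℚ) → (ℕ → ℚ) → List ℕ → ℚ
weightedOddTerm N x g ν = g (mult 1 ν) *ℚ oddTerm N x ν

partitionSum-0 : ∀ j → partitionSum j 0 (λ _ → 1ℚ) ≡ iverson (j ≡ᵇ 0) 1ℚ
partitionSum-0 zero = refl
partitionSum-0 (suc j) = refl

BoundedPartition-0 : ∀ j ν → BoundedPartition 0 j ν → ν ≡ []
BoundedPartition-0 j [] g = refl
BoundedPartition-0 j (p ∷ ν) (((a , b) ∷ _) , _) = ⊥-elim (NP.<-irrefl refl (NP.≤-trans a b))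

partitionSum≡partConv : ∀ N x g K n → partitionSum n (suc K) (weightedOddTerm N x g) ≡ partConv N x K (λ m → g m *ℚ partTerm₁ N x m) n
partitionSum≡partConv N x g zero n = begin
  partitionSum n 1 (weightedOddTerm N x g) ≡⟨ largestPartExpansion 0 (λ m → g m *ℚ partTerm₁ N x m) (weightedOddTerm N x g) (λ _ → 1ℚ) factorises n 0 ⟩
  sumBelow (suc n) (λ m → iverson (m * 1 ≤ᵇ n) ((g m *ℚ partTerm₁ N x m) *ℚ partitionSum (n ∸ m * 1) 0 (λ _ → 1ℚ))) ≡⟨ sumBelow-suc n _ ⟩
  sumBelow n (λ m → iverson (m * 1 ≤ᵇ n) ((g m *ℚ partTerm₁ N x m) *ℚ partitionSum (n ∸ m * 1) 0 (λ _ → 1ℚ)))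
    +ℚ iverson (n * 1 ≤ᵇ n) ((g n *ℚ partTerm₁ N x n) *ℚ partitionSum (n ∸ n * 1) 0 (λ _ → 1ℚ))
    ≡⟨ cong₂ _+ℚ_ (trans (sumBelow-cong< n (λ m lt → nonemptyRest m lt)) (sumBelow-0 n)) emptyRest ⟩
  0ℚ +ℚ g n *ℚ partTerm₁ N x n ≡⟨ QP.+-identityˡ _ ⟩
  g n *ℚ partTerm₁ N x n ∎
  where
  factorises : Factorises 0 (λ m → g m *ℚ partTerm₁ N x m) (weightedOddTerm N x g) (λ _ → 1ℚ)
  factorises t j ν gd with BoundedPartition-0 j ν gd
  ... | refl = begin
    g (mult 1 (replicate t 1 ++ [])) *ℚ oddTerm N x (replicate t 1 ++ []) ≡⟨ cong₂ (λ u w → g u *ℚ w) (trans (mult-replicate 1 t []) (NP.+-identityʳ t)) (oddTerm-replicate N x 0 0 [] t ([] , refl)) ⟩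
    g t *ℚ (partTerm₁ N x t *ℚ 1ℚ) ≡⟨ sym (QP.*-assoc (g t) (partTerm₁ N x t) 1ℚ) ⟩
    (g t *ℚ partTerm₁ N x t) *ℚ 1ℚ ∎
  nonemptyRest : ∀ m → m < n → iverson (m * 1 ≤ᵇ n) ((g m *ℚ partTerm₁ N x m) *ℚ partitionSum (n ∸ m * 1) 0 (λ _ → 1ℚ)) ≡ 0ℚ
  nonemptyRest m lt rewrite NP.*-identityʳ m | partitionSum-0 (n ∸ m) | ≢⇒≡ᵇ≡false (n ∸ m) 0 (NP.m>n⇒m∸n≢0 lt) =
    trans (cong (iverson (m ≤ᵇ n)) (QP.*-zeroʳ (g m *ℚ partTerm₁ N x m))) (iverson-0 (m ≤ᵇ n))
  emptyRest : iverson (n * 1 ≤ᵇ n) ((g n *ℚ partTerm₁ N x n) *ℚ partitionSum (n ∸ n * 1) 0 (λ _ → 1ℚ)) ≡ g n *ℚ partTerm₁ N x n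
  emptyRest rewrite NP.*-identityʳ n | NP.n∸n≡0 n | ≤⇒≤ᵇ≡true n n NP.≤-refl = QP.*-identityʳ _
partitionSum≡partConv N x g (suc K) n = begin
  partitionSum n (suc (suc K)) (λ ν → weightedOddTerm N x g (replicate 0 (suc (suc K)) ++ ν))
    ≡⟨ largestPartExpansion (suc K) (partTerm N x (suc (suc K))) (weightedOddTerm N x g) (weightedOddTerm N x g) factorises n 0 ⟩
  sumBelow (suc n) (λ m → iverson (m * suc (suc K) ≤ᵇ n) (partTerm N x (suc (suc K)) m *ℚ partitionSum (n ∸ m * suc (suc K)) (suc K) (weightedOddTerm N x g)))
    ≡⟨ sumBelow-cong (suc n) (λ m → cong (λ z → iverson (m * suc (suc K) ≤ᵇ n) (partTerm N x (suc (suc K)) m *ℚ z)) (partitionSum≡partConv N x g K (n ∸ m * suc (suc K)))) ⟩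
  partConv N x (suc K) (λ m → g m *ℚ partTerm₁ N x m) n ∎
  where
  factorises : Factorises (suc K) (partTerm N x (suc (suc K))) (weightedOddTerm N x g) (weightedOddTerm N x g)
  factorises t j ν gd = begin
    g (mult 1 (replicate t (suc (suc K)) ++ ν)) *ℚ oddTerm N x (replicate t (suc (suc K)) ++ ν)
      ≡⟨ cong₂ (λ u w → g u *ℚ w) (mult-replicate-≢ 1 (suc (suc K)) t ν (λ e → NP.1+n≢0 (NP.suc-injective e))) (oddTerm-replicate N x (suc K) j ν t gd) ⟩
    g (mult 1 ν) *ℚ (partTerm N x (suc (suc K)) t *ℚ oddTerm N x ν)
      ≡⟨ solve 3 (λ G E W → G :* (E :* W) := E :* (G :* W)) refl (g (mult 1 ν)) (partTerm N x (suc (suc K)) t) (oddTerm N x ν) ⟩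
    partTerm N x (suc (suc K)) t *ℚ weightedOddTerm N x g ν ∎

twiceOddPowerSum≤ : ℕ → (ℕ → ℚ) → ℕ → ℕ → ℚ
twiceOddPowerSum≤ N x K r = iverson (isOdd r ∧ (r ≤ᵇ suc K)) (two *ℚ pEval1 N x r)

twiceOddPowerSum≤-suc : ∀ N x K' r → twiceOddPowerSum≤ N x (suc K') r ≡ twiceOddPowerSum≤ N x K' r +ℚ iverson (r ≡ᵇ suc (suc K')) (partNewtonWeight N x (suc (suc K')) 1)
twiceOddPowerSum≤-suc N x K' r with r ≟ suc (suc K')
... | yes refl rewrite >⇒≤ᵇ≡false (suc (suc K')) (suc K') NP.≤-refl | ≤⇒≤ᵇ≡true (suc (suc K')) (suc (suc K')) NP.≤-refl
      | BP.∧-zeroʳ (isOdd (suc (suc K'))) | ≡ᵇ-refl (suc K')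
        = trans (cong (λ b → iverson b (two *ℚ pEval1 N x (suc (suc K')))) (BP.∧-identityʳ (isOdd (suc (suc K'))))) (sym (QP.+-identityˡ (iverson (isOdd (suc (suc K'))) (two *ℚ pEval1 N x (suc (suc K'))))))
... | no ne rewrite ≢⇒≡ᵇ≡false r (suc (suc K')) ne | ≤ᵇ-suc-≢ r (suc K') ne = sym (QP.+-identityʳ _)

partConv-newton : ∀ N x K → NewtonRecurrence (twiceOddPowerSum≤ N x K) (partConv N x K (partTerm₁ N x))
partConv-newton N x zero n = trans (cong (λ z → fromℕ z *ℚ partTerm₁ N x n) (sym (NP.*-identityʳ n))) (trans (partTerm-newton N x 0 n) (sumBelow-cong n weight₁))
  where
  weight₁ : ∀ s → partNewtonWeight N x 1 (suc s) *ℚ partTerm₁ N x (n ∸ suc s) ≡ twiceOddPowerSum≤ N x 0 (suc s) *ℚ partTerm₁ N x (n ∸ suc s)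
  weight₁ zero = refl
  weight₁ (suc s) rewrite BP.∧-zeroʳ (isOdd (suc (suc s))) = refl
partConv-newton N x (suc K') n = begin
  fromℕ n *ℚ c n ≡⟨ newton-convBy (suc K') (partTerm N x k) (partConv N x K' (partTerm₁ N x)) (twiceOddPowerSum≤ N x K') (partNewtonWeight N x k) (partConv-newton N x K') (partTerm-newton N x (suc K')) n ⟩
  sumBelow (suc n) (λ s → iverson (suc s * k ≤ᵇ n) (partNewtonWeight N x k (suc s) *ℚ c (n ∸ suc s * k))) +ℚ newtonSum (twiceOddPowerSum≤ N x K') c n
    ≡⟨ cong (_+ℚ newtonSum (twiceOddPowerSum≤ N x K') c n) shiftedSum ⟩
  iverson (k ≤ᵇ n) (d *ℚ c (n ∸ k)) +ℚ newtonSum (twiceOddPowerSum≤ N x K') c n ≡⟨ QP.+-comm (iverson (k ≤ᵇ n) (d *ℚ c (n ∸ k))) (newtonSum (twiceOddPowerSum≤ N x K') c n) ⟩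
  newtonSum (twiceOddPowerSum≤ N x K') c n +ℚ iverson (k ≤ᵇ n) (d *ℚ c (n ∸ k)) ≡⟨ cong (newtonSum (twiceOddPowerSum≤ N x K') c n +ℚ_) (sym singleWeight) ⟩
  newtonSum (twiceOddPowerSum≤ N x K') c n +ℚ newtonSum (λ r → iverson (r ≡ᵇ k) d) c n ≡⟨ sym (newtonSum-+ (twiceOddPowerSum≤ N x K') (λ r → iverson (r ≡ᵇ k) d) c n) ⟩
  newtonSum (λ r → twiceOddPowerSum≤ N x K' r +ℚ iverson (r ≡ᵇ k) d) c n ≡⟨ newtonSum-congˡ _ _ c n (λ r → sym (twiceOddPowerSum≤-suc N x K' r)) ⟩
  newtonSum (twiceOddPowerSum≤ N x (suc K')) c n ∎
  where
  k : ℕ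
  k = suc (suc K')
  c : ℕ → ℚ
  c = partConv N x (suc K') (partTerm₁ N x)
  d : ℚ
  d = partNewtonWeight N x k 1
  shiftedSum : sumBelow (suc n) (λ s → iverson (suc s * k ≤ᵇ n) (partNewtonWeight N x k (suc s) *ℚ c (n ∸ suc s * k))) ≡ iverson (k ≤ᵇ n) (d *ℚ c (n ∸ k))
  shiftedSum = trans (cong₂ _+ℚ_ (cong (λ z → iverson (z ≤ᵇ n) (d *ℚ c (n ∸ z))) (NP.+-identityʳ k))
                            (trans (sumBelow-cong n (λ s → trans (cong (iverson (suc (suc s) * k ≤ᵇ n)) (QP.*-zeroˡ (c (n ∸ suc (suc s) * k)))) (iverson-0 (suc (suc s) * k ≤ᵇ n)))) (sumBelow-0 n)))
                (QP.+-identityʳ _)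
  singleWeight : newtonSum (λ r → iverson (r ≡ᵇ k) d) c n ≡ iverson (k ≤ᵇ n) (d *ℚ c (n ∸ k))
  singleWeight = trans (sumBelow-cong n (λ i → iverson-*ʳ (suc i ≡ᵇ k) d (c (n ∸ suc i)))) (sumBelow-iverson-≡ᵇ n (suc K') (λ i → d *ℚ c (n ∸ suc i)))

partConv-cong : ∀ N x K (b b' : ℕ → ℚ) → (∀ n → b n ≡ b' n) → ∀ n → partConv N x K b n ≡ partConv N x K b' n
partConv-cong N x zero b b' e n = e n
partConv-cong N x (suc K) b b' e n = sumBelow-cong (suc n) (λ m → cong (λ z → iverson (m * suc (suc K) ≤ᵇ n) (partTerm N x (suc (suc K)) m *ℚ z)) (partConv-cong N x K b b' e (n ∸ m * suc (suc K))))

partConv-+ : ∀ N x K (b₁ b₂ : ℕ → ℚ) n → partConv N x K (λ m → b₁ m +ℚ b₂ m) n ≡ partConv N x K b₁ n +ℚ partConv N x K b₂ n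
partConv-+ N x zero b₁ b₂ n = refl
partConv-+ N x (suc K) b₁ b₂ n = trans (sumBelow-cong (suc n) termwise)
  (sumBelow-+ (suc n) (λ m → iverson (m * k ≤ᵇ n) (partTerm N x k m *ℚ partConv N x K b₁ (n ∸ m * k))) (λ m → iverson (m * k ≤ᵇ n) (partTerm N x k m *ℚ partConv N x K b₂ (n ∸ m * k))))
  where
  k : ℕ
  k = suc (suc K)
  termwise : ∀ m → iverson (m * k ≤ᵇ n) (partTerm N x k m *ℚ partConv N x K (λ m → b₁ m +ℚ b₂ m) (n ∸ m * k))
           ≡ iverson (m * k ≤ᵇ n) (partTerm N x k m *ℚ partConv N x K b₁ (n ∸ m * k)) +ℚ iverson (m * k ≤ᵇ n) (partTerm N x k m *ℚ partConv N x K b₂ (n ∸ m * k))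
  termwise m rewrite partConv-+ N x K b₁ b₂ (n ∸ m * k) with m * k ≤ᵇ n
  ... | true = QP.*-distribˡ-+ (partTerm N x k m) _ _
  ... | false = refl

partConv-* : ∀ N x K (α : ℚ) (b : ℕ → ℚ) n → partConv N x K (λ m → α *ℚ b m) n ≡ α *ℚ partConv N x K b n
partConv-* N x zero α b n = refl
partConv-* N x (suc K) α b n = trans (sumBelow-cong (suc n) termwise) (sym (*-distribˡ-sumBelow α (suc n) (λ m → iverson (m * k ≤ᵇ n) (partTerm N x k m *ℚ partConv N x K b (n ∸ m * k)))))
  where
  k : ℕ
  k = suc (suc K)
  termwise : ∀ m → iverson (m * k ≤ᵇ n) (partTerm N x k m *ℚ partConv N x K (λ m → α *ℚ b m) (n ∸ m * k))
           ≡ α *ℚ iverson (m * k ≤ᵇ n) (partTerm N x k m *ℚ partConv N x K b (n ∸ m * k))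
  termwise m rewrite partConv-* N x K α b (n ∸ m * k) with m * k ≤ᵇ n
  ... | true = solve 3 (λ E A B → E :* (A :* B) := A :* (E :* B)) refl (partTerm N x k m) α (partConv N x K b (n ∸ m * k))
  ... | false = sym (QP.*-zeroʳ α)

partConv-shift : ∀ N x (α : ℚ) (b b' : ℕ → ℚ) → b' 0 ≡ 0ℚ → (∀ n → b' (suc n) ≡ α *ℚ b n) →
  ∀ K → (partConv N x K b' 0 ≡ 0ℚ) × (∀ n → partConv N x K b' (suc n) ≡ α *ℚ partConv N x K b n)
partConv-shift N x α b b' z0 zs zero = z0 , zs
partConv-shift N x α b b' z0 zs (suc K) = atZero , atSuc
  where
  k : ℕ
  k = suc (suc K)
  ih : (partConv N x K b' 0 ≡ 0ℚ) × (∀ n → partConv N x K b' (suc n) ≡ α *ℚ partConv N x K b n)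
  ih = partConv-shift N x α b b' z0 zs K
  c' : ℕ → ℚ
  c' = partConv N x K b'
  c : ℕ → ℚ
  c = partConv N x K b
  atZero : partConv N x (suc K) b' 0 ≡ 0ℚ
  atZero = trans (QP.+-identityʳ (partTerm N x k 0 *ℚ c' 0)) (trans (cong (partTerm N x k 0 *ℚ_) (proj₁ ih)) (QP.*-zeroʳ (partTerm N x k 0)))
  atSuc : ∀ n → partConv N x (suc K) b' (suc n) ≡ α *ℚ partConv N x (suc K) b n
  atSuc n = begin
    sumBelow (suc (suc n)) (λ m → iverson (m * k ≤ᵇ suc n) (partTerm N x k m *ℚ c' (suc n ∸ m * k))) ≡⟨ sumBelow-cong (suc (suc n)) termwise ⟩
    sumBelow (suc (suc n)) (λ m → α *ℚ iverson (m * k ≤ᵇ n) (partTerm N x k m *ℚ c (n ∸ m * k))) ≡⟨ sym (*-distribˡ-sumBelow α (suc (suc n)) (λ m → iverson (m * k ≤ᵇ n) (partTerm N x k m *ℚ c (n ∸ m * k)))) ⟩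
    α *ℚ sumBelow (suc (suc n)) (λ m → iverson (m * k ≤ᵇ n) (partTerm N x k m *ℚ c (n ∸ m * k)))
      ≡⟨ cong (α *ℚ_) (sumBelow-multiples-truncate (suc K) (suc (suc n)) n (λ m → partTerm N x k m *ℚ c (n ∸ m * k)) (NP.n≤1+n (suc n))) ⟩
    α *ℚ partConv N x (suc K) b n ∎
    where
    termwise : ∀ m → iverson (m * k ≤ᵇ suc n) (partTerm N x k m *ℚ c' (suc n ∸ m * k)) ≡ α *ℚ iverson (m * k ≤ᵇ n) (partTerm N x k m *ℚ c (n ∸ m * k))
    termwise m with m * k ≤? n
    ... | yes le rewrite ≤⇒≤ᵇ≡true (m * k) (suc n) (NP.≤-trans le (NP.n≤1+n n)) | ≤⇒≤ᵇ≡true (m * k) n le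
                       | NP.+-∸-assoc 1 le | proj₂ ih (n ∸ m * k) =
      solve 3 (λ E A B → E :* (A :* B) := A :* (E :* B)) refl (partTerm N x k m) α (c (n ∸ m * k))
    ... | no nle rewrite >⇒≤ᵇ≡false (m * k) n (NP.≰⇒> nle) with m * k ≤? suc n
    ...   | yes le2 rewrite ≤⇒≤ᵇ≡true (m * k) (suc n) le2 | NP.≤-antisym le2 (NP.≰⇒> nle) | NP.n∸n≡0 (suc n) | proj₁ ih =
      trans (QP.*-zeroʳ (partTerm N x k m)) (sym (QP.*-zeroʳ α))
    ...   | no nle2 rewrite >⇒≤ᵇ≡false (m * k) (suc n) (NP.≰⇒> nle2) = sym (QP.*-zeroʳ α)

partConv-0 : ∀ N x K → partConv N x K (partTerm₁ N x) 0 ≡ 1ℚ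
partConv-0 N x zero = refl
partConv-0 N x (suc K) = trans (QP.+-identityʳ _) (trans (cong (partTerm N x (suc (suc K)) 0 *ℚ_) (partConv-0 N x K)) refl)

twiceOddPowerSum≡≤ : ∀ N x K r → r ≤ suc K → twiceOddPowerSum x N r ≡ twiceOddPowerSum≤ N x K r
twiceOddPowerSum≡≤ N x K r le rewrite ≤⇒≤ᵇ≡true r (suc K) le | BP.∧-identityʳ (isOdd r) =
  cong (λ z → iverson (isOdd r) (two *ℚ z)) (sym (sumOver-upTo N (λ j → powℚ (x j) r)))

partConv≡rowSum : ∀ N x K j → j ≤ suc K → partConv N x K (partTerm₁ N x) j ≡ rowSum x N j
partConv≡rowSum N x K j le = sym (newton-unique (twiceOddPowerSum x N) (twiceOddPowerSum≤ N x K) (rowSum x N) (partConv N x K (partTerm₁ N x)) (suc K)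
  (rowSum-newton x N) (partConv-newton N x K) (sym (partConv-0 N x K)) (twiceOddPowerSum≡≤ N x K) j le)

sumOver-OP : ∀ n (f : List ℕ → ℚ) → sumOver (OP n) f ≡ partitionSum n n (λ μ → iverson (allᵇ isOdd μ) (f μ))
sumOver-OP n f = sumOver-filterᵇ (allᵇ isOdd) (partitions n) f

OPsum-coeffA≡rowSum : ∀ n N x → sumℚ (map (λ μ → coeffA μ *ℚ pEval N x μ) (OP (suc n))) ≡ rowSum x N (suc n)
OPsum-coeffA≡rowSum n N x = begin
  sumOver (OP (suc n)) (λ μ → coeffA μ *ℚ pEval N x μ) ≡⟨ sumOver-OP (suc n) (λ μ → coeffA μ *ℚ pEval N x μ) ⟩
  partitionSum (suc n) (suc n) (oddTerm N x) ≡⟨ sumOver-cong (partsLE (suc n) (suc n) (suc n)) (λ μ → sym (QP.*-identityˡ (oddTerm N x μ))) ⟩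
  partitionSum (suc n) (suc n) (weightedOddTerm N x (λ _ → 1ℚ)) ≡⟨ partitionSum≡partConv N x (λ _ → 1ℚ) n (suc n) ⟩
  partConv N x n (λ m → 1ℚ *ℚ partTerm₁ N x m) (suc n) ≡⟨ partConv-cong N x n _ _ (λ m → QP.*-identityˡ (partTerm₁ N x m)) (suc n) ⟩
  partConv N x n (partTerm₁ N x) (suc n) ≡⟨ partConv≡rowSum N x n (suc n) NP.≤-refl ⟩
  rowSum x N (suc n) ∎

-1ℚ : ℚ
-1ℚ = -ℚ 1ℚ

m₁Factor : ℕ → ℚ
m₁Factor zero = 1ℚ
m₁Factor (suc zero) = 0ℚ
m₁Factor (suc (suc zero)) = 0ℚ
m₁Factor (suc (suc (suc m))) = fromℕ ((suc (suc m)) C 2)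

coeffB≡m₁Factor*baseCoeff : ∀ μ → coeffB μ ≡ m₁Factor (mult 1 μ) *ℚ baseCoeff μ
coeffB≡m₁Factor*baseCoeff μ with mult 1 μ
... | zero = sym (QP.*-identityˡ (baseCoeff μ))
... | suc zero = sym (QP.*-zeroˡ (baseCoeff μ))
... | suc (suc zero) = sym (QP.*-zeroˡ (baseCoeff μ))
... | suc (suc (suc m)) = refl

2*[1+n]C2 : ∀ n → 2 * (suc n C 2) ≡ suc n * n
2*[1+n]C2 zero = refl
2*[1+n]C2 (suc n) = begin
  2 * (suc (suc n) C 2) ≡⟨ cong (2 *_) (sym (nCk+nC[k+1]≡[n+1]C[k+1] (suc n) 1)) ⟩
  2 * (suc n C 1 + suc n C 2) ≡⟨ cong (λ z → 2 * (z + suc n C 2)) (nC1≡n (suc n)) ⟩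
  2 * (suc n + suc n C 2) ≡⟨ NP.*-distribˡ-+ 2 (suc n) (suc n C 2) ⟩
  2 * suc n + 2 * (suc n C 2) ≡⟨ cong (2 * suc n +_) (2*[1+n]C2 n) ⟩
  2 * suc n + suc n * n ≡⟨ cong (_+ suc n * n) (NP.*-comm 2 (suc n)) ⟩
  suc n * 2 + suc n * n ≡⟨ sym (NP.*-distribˡ-+ (suc n) 2 n) ⟩
  suc n * (2 + n) ≡⟨ NP.*-comm (suc n) (suc (suc n)) ⟩
  suc (suc n) * suc n ∎

fromℕ-[2+m]C2 : ∀ m → fromℕ ((suc (suc m)) C 2) ≡ ½ *ℚ (fromℕ (suc (suc m)) *ℚ fromℕ (suc m))
fromℕ-[2+m]C2 m = begin
  fromℕ c ≡⟨ sym (QP.*-identityˡ (fromℕ c)) ⟩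
  1ℚ *ℚ fromℕ c ≡⟨⟩
  (½ *ℚ fromℕ 2) *ℚ fromℕ c ≡⟨ QP.*-assoc ½ (fromℕ 2) (fromℕ c) ⟩
  ½ *ℚ (fromℕ 2 *ℚ fromℕ c) ≡⟨ cong (½ *ℚ_) (sym (fromℕ-* 2 c)) ⟩
  ½ *ℚ fromℕ (2 * c) ≡⟨ cong (λ z → ½ *ℚ fromℕ z) (2*[1+n]C2 (suc m)) ⟩
  ½ *ℚ fromℕ (suc (suc m) * suc m) ≡⟨ cong (½ *ℚ_) (fromℕ-* (suc (suc m)) (suc m)) ⟩
  ½ *ℚ (fromℕ (suc (suc m)) *ℚ fromℕ (suc m)) ∎
  where
  c : ℕ
  c = suc (suc m) C 2

module FallingTerms (N : ℕ) (x : ℕ → ℚ) where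
  fallingTerm₁ : ℕ → ℚ
  fallingTerm₁ j = fromℕ j *ℚ partTerm₁ N x j
  fallingTerm₂ : ℕ → ℚ
  fallingTerm₂ j = fromℕ j *ℚ (fromℕ (j ∸ 1) *ℚ partTerm₁ N x j)

  twoP₁ : ℚ
  twoP₁ = two *ℚ pEval1 N x 1

  m₁Factor-linear : ∀ j → m₁Factor j *ℚ partTerm₁ N x j ≡ ½ *ℚ fallingTerm₂ j +ℚ (-1ℚ *ℚ fallingTerm₁ j +ℚ partTerm₁ N x j)
  m₁Factor-linear zero = solve 1 (λ E → con 1ℚ :* E := con ½ :* (con 0ℚ :* (con 0ℚ :* E)) :+ (con -1ℚ :* (con 0ℚ :* E) :+ E)) refl (partTerm₁ N x 0)
  m₁Factor-linear (suc zero) = solve 1 (λ E → con 0ℚ :* E := con ½ :* (con 1ℚ :* (con 0ℚ :* E)) :+ (con -1ℚ :* (con 1ℚ :* E) :+ E)) refl (partTerm₁ N x 1)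
  m₁Factor-linear (suc (suc zero)) = solve 1 (λ E → con 0ℚ :* E := con ½ :* (con (fromℕ 2) :* (con 1ℚ :* E)) :+ (con -1ℚ :* (con (fromℕ 2) :* E) :+ E)) refl (partTerm₁ N x 2)
  m₁Factor-linear (suc (suc (suc m))) = begin
    fromℕ (suc (suc m) C 2) *ℚ E ≡⟨ cong (_*ℚ E) (fromℕ-[2+m]C2 m) ⟩
    ½ *ℚ (fromℕ (suc (suc m)) *ℚ fromℕ (suc m)) *ℚ E ≡⟨ cong (λ z → ½ *ℚ (z *ℚ fromℕ (suc m)) *ℚ E) (fromℕ-suc (suc m)) ⟩
    ½ *ℚ ((1ℚ +ℚ a) *ℚ a) *ℚ E
      ≡⟨ solve 2 (λ Aa Ee → con ½ :* ((con 1ℚ :+ Aa) :* Aa) :* Ee := con ½ :* ((con 1ℚ :+ (con 1ℚ :+ Aa)) :* ((con 1ℚ :+ Aa) :* Ee)) :+ (con -1ℚ :* ((con 1ℚ :+ (con 1ℚ :+ Aa)) :* Ee) :+ Ee)) refl a E ⟩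
    ½ *ℚ ((1ℚ +ℚ (1ℚ +ℚ a)) *ℚ ((1ℚ +ℚ a) *ℚ E)) +ℚ (-1ℚ *ℚ ((1ℚ +ℚ (1ℚ +ℚ a)) *ℚ E) +ℚ E)
      ≡⟨ cong₂ (λ u w → ½ *ℚ (u *ℚ (w *ℚ E)) +ℚ (-1ℚ *ℚ (u *ℚ E) +ℚ E)) (sym fromℕ-3+m) (sym (fromℕ-suc (suc m))) ⟩
    ½ *ℚ fallingTerm₂ (suc (suc (suc m))) +ℚ (-1ℚ *ℚ fallingTerm₁ (suc (suc (suc m))) +ℚ E) ∎
    where
    E : ℚ
    E = partTerm₁ N x (suc (suc (suc m)))
    a : ℚ
    a = fromℕ (suc m)
    fromℕ-3+m : fromℕ (suc (suc (suc m))) ≡ 1ℚ +ℚ (1ℚ +ℚ a)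
    fromℕ-3+m = trans (fromℕ-suc (suc (suc m))) (cong (1ℚ +ℚ_) (fromℕ-suc (suc m)))

  fallingTerm₁-0 : fallingTerm₁ 0 ≡ 0ℚ
  fallingTerm₁-0 = QP.*-zeroˡ (partTerm₁ N x 0)

  fallingTerm₁-suc : ∀ j → fallingTerm₁ (suc j) ≡ twoP₁ *ℚ partTerm₁ N x j
  fallingTerm₁-suc j = begin
    fromℕ (suc j) *ℚ partTerm₁ N x (suc j) ≡⟨ cong (λ z → fromℕ z *ℚ partTerm₁ N x (suc j)) (sym (NP.*-identityʳ (suc j))) ⟩
    fromℕ (suc j * 1) *ℚ partTerm₁ N x (suc j) ≡⟨ partTerm-newton N x 0 (suc j) ⟩
    twoP₁ *ℚ partTerm₁ N x j +ℚ sumBelow j (λ s → partNewtonWeight N x 1 (suc (suc s)) *ℚ partTerm₁ N x (j ∸ suc s))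
      ≡⟨ cong (twoP₁ *ℚ partTerm₁ N x j +ℚ_) (trans (sumBelow-cong j (λ s → QP.*-zeroˡ (partTerm₁ N x (j ∸ suc s)))) (sumBelow-0 j)) ⟩
    twoP₁ *ℚ partTerm₁ N x j +ℚ 0ℚ ≡⟨ QP.+-identityʳ _ ⟩
    twoP₁ *ℚ partTerm₁ N x j ∎

  fallingTerm₂-0 : fallingTerm₂ 0 ≡ 0ℚ
  fallingTerm₂-0 = QP.*-zeroˡ (0ℚ *ℚ partTerm₁ N x 0)

  fallingTerm₂-suc : ∀ j → fallingTerm₂ (suc j) ≡ twoP₁ *ℚ fallingTerm₁ j
  fallingTerm₂-suc j = begin
    fromℕ (suc j) *ℚ (fromℕ j *ℚ partTerm₁ N x (suc j))
      ≡⟨ solve 3 (λ A B C → A :* (B :* C) := B :* (A :* C)) refl (fromℕ (suc j)) (fromℕ j) (partTerm₁ N x (suc j)) ⟩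
    fromℕ j *ℚ (fromℕ (suc j) *ℚ partTerm₁ N x (suc j)) ≡⟨ cong (fromℕ j *ℚ_) (fallingTerm₁-suc j) ⟩
    fromℕ j *ℚ (twoP₁ *ℚ partTerm₁ N x j) ≡⟨ solve 3 (λ A B C → A :* (B :* C) := B :* (A :* C)) refl (fromℕ j) twoP₁ (partTerm₁ N x j) ⟩
    twoP₁ *ℚ fallingTerm₁ j ∎

  partConv-m₁Factor : ∀ K m → partConv N x K (λ j → m₁Factor j *ℚ partTerm₁ N x j) (suc (suc m))
    ≡ ½ *ℚ (twoP₁ *ℚ (twoP₁ *ℚ partConv N x K (partTerm₁ N x) m))
      +ℚ (-1ℚ *ℚ (twoP₁ *ℚ partConv N x K (partTerm₁ N x) (suc m)) +ℚ partConv N x K (partTerm₁ N x) (suc (suc m)))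
  partConv-m₁Factor K m = begin
    partConv N x K (λ j → m₁Factor j *ℚ partTerm₁ N x j) n ≡⟨ partConv-cong N x K _ _ m₁Factor-linear n ⟩
    partConv N x K (λ j → ½ *ℚ fallingTerm₂ j +ℚ (-1ℚ *ℚ fallingTerm₁ j +ℚ partTerm₁ N x j)) n ≡⟨ partConv-+ N x K _ _ n ⟩
    partConv N x K (λ j → ½ *ℚ fallingTerm₂ j) n +ℚ partConv N x K (λ j → -1ℚ *ℚ fallingTerm₁ j +ℚ partTerm₁ N x j) n
      ≡⟨ cong₂ _+ℚ_ (partConv-* N x K ½ fallingTerm₂ n) (trans (partConv-+ N x K _ _ n) (cong (_+ℚ G n) (partConv-* N x K -1ℚ fallingTerm₁ n))) ⟩
    ½ *ℚ partConv N x K fallingTerm₂ n +ℚ (-1ℚ *ℚ partConv N x K fallingTerm₁ n +ℚ G n)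
      ≡⟨ cong₂ (λ u w → ½ *ℚ u +ℚ (-1ℚ *ℚ w +ℚ G n)) (trans (shift₂ (suc m)) (cong (twoP₁ *ℚ_) (shift₁ m))) (shift₁ (suc m)) ⟩
    ½ *ℚ (twoP₁ *ℚ (twoP₁ *ℚ G m)) +ℚ (-1ℚ *ℚ (twoP₁ *ℚ G (suc m)) +ℚ G n) ∎
    where
    n : ℕ
    n = suc (suc m)
    G : ℕ → ℚ
    G = partConv N x K (partTerm₁ N x)
    shift₁ : ∀ j → partConv N x K fallingTerm₁ (suc j) ≡ twoP₁ *ℚ G j
    shift₁ = proj₂ (partConv-shift N x twoP₁ (partTerm₁ N x) fallingTerm₁ fallingTerm₁-0 fallingTerm₁-suc K)
    shift₂ : ∀ j → partConv N x K fallingTerm₂ (suc j) ≡ twoP₁ *ℚ partConv N x K fallingTerm₁ j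
    shift₂ = proj₂ (partConv-shift N x twoP₁ fallingTerm₁ fallingTerm₂ fallingTerm₂-0 fallingTerm₂-suc K)

pEval1-1≡sumVars : ∀ N x → pEval1 N x 1 ≡ sumVars x N
pEval1-1≡sumVars N x = trans (sumOver-upTo N (λ j → powℚ (x j) 1)) (sumBelow-cong N (λ j → QP.*-identityʳ (x j)))

oddTerm-m₁Factor : ∀ N x μ → iverson (allᵇ isOdd μ) (coeffB μ *ℚ pEval N x μ) ≡ weightedOddTerm N x m₁Factor μ
oddTerm-m₁Factor N x μ rewrite coeffB≡m₁Factor*baseCoeff μ with allᵇ isOdd μ
... | true = QP.*-assoc (m₁Factor (mult 1 μ)) (baseCoeff μ) (pEval N x μ)
... | false = sym (QP.*-zeroʳ (m₁Factor (mult 1 μ)))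

OPsum-coeffB≡hookClosedForm : ∀ m N x → sumℚ (map (λ μ → coeffB μ *ℚ pEval N x μ) (OP (suc (suc (suc m))))) ≡ hookClosedForm x N m
OPsum-coeffB≡hookClosedForm m N x = begin
  sumOver (OP n) (λ μ → coeffB μ *ℚ pEval N x μ) ≡⟨ sumOver-OP n (λ μ → coeffB μ *ℚ pEval N x μ) ⟩
  partitionSum n n (λ μ → iverson (allᵇ isOdd μ) (coeffB μ *ℚ pEval N x μ)) ≡⟨ sumOver-cong (partsLE n n n) (oddTerm-m₁Factor N x) ⟩
  partitionSum n n (weightedOddTerm N x m₁Factor) ≡⟨ partitionSum≡partConv N x m₁Factor K n ⟩
  partConv N x K (λ j → m₁Factor j *ℚ partTerm₁ N x j) n ≡⟨ partConv-m₁Factor K (suc m) ⟩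
  ½ *ℚ (twoP₁ *ℚ (twoP₁ *ℚ G (suc m))) +ℚ (-1ℚ *ℚ (twoP₁ *ℚ G K) +ℚ G n)
    ≡⟨ cong₂ (λ u v → ½ *ℚ (twoP₁ *ℚ (twoP₁ *ℚ u)) +ℚ (-1ℚ *ℚ (twoP₁ *ℚ v) +ℚ G n))
         (partConv≡rowSum N x K (suc m) (NP.≤-trans (NP.n≤1+n (suc m)) (NP.n≤1+n K))) (partConv≡rowSum N x K K (NP.n≤1+n K)) ⟩
  ½ *ℚ (twoP₁ *ℚ (twoP₁ *ℚ rowSum x N (suc m))) +ℚ (-1ℚ *ℚ (twoP₁ *ℚ rowSum x N K) +ℚ G n)
    ≡⟨ cong₂ (λ p q → ½ *ℚ ((two *ℚ p) *ℚ ((two *ℚ p) *ℚ rowSum x N (suc m))) +ℚ (-1ℚ *ℚ ((two *ℚ p) *ℚ rowSum x N K) +ℚ q))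
         (pEval1-1≡sumVars N x) (partConv≡rowSum N x K n NP.≤-refl) ⟩
  ½ *ℚ ((two *ℚ X) *ℚ ((two *ℚ X) *ℚ rowSum x N (suc m))) +ℚ (-1ℚ *ℚ ((two *ℚ X) *ℚ rowSum x N K) +ℚ rowSum x N n)
    ≡⟨ solve 4 (λ Xx A1 A2 A3 → con ½ :* ((con two :* Xx) :* ((con two :* Xx) :* A1)) :+ (con -1ℚ :* ((con two :* Xx) :* A2) :+ A3)
                             := con two :* (Xx :* Xx) :* A1 :+ :- (con two :* Xx :* A2) :+ A3) refl X (rowSum x N (suc m)) (rowSum x N K) (rowSum x N n) ⟩
  hookClosedForm x N m ∎
  where
  open FallingTerms N x
  n K : ℕ
  n = suc (suc (suc m))
  K = suc (suc m)
  X : ℚ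
  X = sumVars x N
  G : ℕ → ℚ
  G = partConv N x K (partTerm₁ N x)

coeffA-nonNeg : ∀ μ → 0ℚ ≤ℚ coeffA μ
coeffA-nonNeg μ = frac-nonNeg (2 ^ length μ) (z μ)

coeffB-nonNeg : ∀ μ → 0ℚ ≤ℚ coeffB μ
coeffB-nonNeg μ with mult 1 μ
... | zero = coeffA-nonNeg μ
... | suc zero = QP.≤-refl
... | suc (suc zero) = QP.≤-refl
... | suc (suc (suc m)) = *-nonNeg (fromℕ (suc (suc m) C 2)) (baseCoeff μ) (frac-nonNeg (suc (suc m) C 2) 1) (coeffA-nonNeg μ)

proposition4p6 : ((n : ℕ) → 1 ≤ n → (N : ℕ) → (x : ℕ → ℚ) →
  rEval (triangle n 1) N x ≡ sumℚ (map (λ μ → coeffA μ *ℚ pEval N x μ) (OP n)))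
  × ((n : ℕ) → 3 ≤ n → (N : ℕ) → (x : ℕ → ℚ) →
  rEval (triangle n 3) N x ≡ sumℚ (map (λ μ → coeffB μ *ℚ pEval N x μ) (OP n)))
  × ((n : ℕ) → 1 ≤ n → All (λ μ → 0ℚ ≤ℚ coeffA μ) (OP n))
  × ((n : ℕ) → 3 ≤ n → All (λ μ → 0ℚ ≤ℚ coeffB μ) (OP n))
proposition4p6 = rowCase , hookCase , (λ n _ → All.universal coeffA-nonNeg (OP n)) , (λ n _ → All.universal coeffB-nonNeg (OP n))
  where
  rowCase : (n : ℕ) → 1 ≤ n → (N : ℕ) → (x : ℕ → ℚ) → rEval (triangle n 1) N x ≡ sumℚ (map (λ μ → coeffA μ *ℚ pEval N x μ) (OP n))
  rowCase (suc n) _ N x = trans (rEval-row n N x) (sym (OPsum-coeffA≡rowSum n N x))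
  hookCase : (n : ℕ) → 3 ≤ n → (N : ℕ) → (x : ℕ → ℚ) → rEval (triangle n 3) N x ≡ sumℚ (map (λ μ → coeffB μ *ℚ pEval N x μ) (OP n))
  hookCase _ (s≤s (s≤s (s≤s {n = m} _))) N x = trans (rEval-hook m N x) (sym (OPsum-coeffB≡hookClosedForm m N x))
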